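{- Let $k$ be a fixed nonnegative integer, and for $0\le j\le k$ let $L_j$ be the number of chords of length $j$ in $C_n$. Then, as $n\to\infty$, \[(L_0,L_1,\dots,L_k)\xrightarrow{d}(T_0,T_1,\dots,T_k),\] where $T_0,\dots,T_k$ are independent Poisson random variables with mean $1$.
   Context: A chord diagram of size $n$ is a perfect matching of the points $1,\dots,2n$ placed clockwise on a circle; $C_n$ is a uniformly random chord diagram of size $n$. The length of a chord $\langle x,y\rangle$ with $x<y$ is $\min(y-x-1,\,2n-y+x-1)$; equivalently, for $j\le n-2$ a chord has length $j$ iff it is $\langle i,i+j+1\rangle$ for some $i\in[2n]$ (addition modulo $2n$). -}

module Defs where

open import Data.Nat using (ℕ; zero; suc; _∸_; _!; _⊓_; ∣_-_∣; _<?_; _≤_)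
import Data.Nat as ℕ
open import Data.Nat.Properties using (_!≢0)
open import Data.Fin using (Fin; toℕ)
import Data.Fin as Fin
open import Data.Fin.Properties using (all?; _≟_)
open import Data.Vec using (Vec; []; _∷_; lookup)
open import Data.List using (List; [_]; map; concatMap; allFin; filter; length)
open import Data.Product using (_×_)
open import Data.Integer using (+_; -[1+_])
open import Data.Rational using (ℚ; _/_; _*_; _+_; 1ℚ; 0ℚ)
import Data.Rational as ℚ
open import Relation.Binary.PropositionalEquality using (_≡_; _≢_)
open import Relation.Nullary using (Dec; ¬?)
open import Relation.Nullary.Decidable using (_×-dec_)

-- Chord diagrams of size n on the points 0,…,2n-1 (the points 1,…,2n of
-- the paper shifted by one).  A chord diagram (perfect matching) is
-- represented by its partner map v : point ↦ partner, i.e. a fixed-point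
-- free involution of Fin (2n), stored as a vector.

Diagram : ℕ → Set
Diagram n = Vec (Fin (2 ℕ.* n)) (2 ℕ.* n)

IsChordDiagram : ∀ n → Diagram n → Set
IsChordDiagram n v = ∀ i → (lookup v (lookup v i) ≡ i) × (lookup v i ≢ i)

isChordDiagram? : ∀ n (v : Diagram n) → Dec (IsChordDiagram n v)
isChordDiagram? n v = all? λ i → (lookup v (lookup v i) ≟ i) ×-dec ¬? (lookup v i ≟ i)

allVecs : ∀ m l → List (Vec (Fin m) l)
allVecs m zero    = [ [] ]
allVecs m (suc l) = concatMap (λ i → map (i ∷_) (allVecs m l)) (allFin m)

chordDiagrams : ∀ n → List (Diagram n)
chordDiagrams n = filter (isChordDiagram? n) (allVecs (2 ℕ.* n) (2 ℕ.* n))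

numDiagrams : ℕ → ℕ
numDiagrams n = length (chordDiagrams n)

chordLength : ∀ n → Fin (2 ℕ.* n) → Fin (2 ℕ.* n) → ℕ
chordLength n x y = (d ∸ 1) ⊓ (2 ℕ.* n ∸ d ∸ 1)
  where d = ∣ toℕ x - toℕ y ∣

-- L_j(v): number of chords of length j in v (each chord ⟨x,y⟩ counted once,
-- at its smaller endpoint x < y)
numChordsOfLength : ∀ n → Diagram n → ℕ → ℕ
numChordsOfLength n v j =
  length (filter (λ x → (toℕ x <? toℕ (lookup v x))
                        ×-dec (chordLength n x (lookup v x) ℕ.≟ j))
                 (allFin (2 ℕ.* n)))

HasProfile : ∀ n k → (Fin (suc k) → ℕ) → Diagram n → Set
HasProfile n k a v = ∀ j → numChordsOfLength n v (toℕ j) ≡ a j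

hasProfile? : ∀ n k a (v : Diagram n) → Dec (HasProfile n k a v)
hasProfile? n k a v = all? λ j → numChordsOfLength n v (toℕ j) ℕ.≟ a j

-- number of chord diagrams of size n with (L_0,…,L_k) = a;
-- so P(C_n has profile a) = numWithProfile n k a / numDiagrams n
numWithProfile : ∀ n k → (Fin (suc k) → ℕ) → ℕ
numWithProfile n k a = length (filter (hasProfile? n k a) (chordDiagrams n))

-- Rational approximations of e^{-1}:  s_m = Σ_{i=0}^{m} (-1)^i / i!
-- (term_i = (-1)^i / i!), s_m → e^{-1}.

expTerm : ℕ → ℚ
expTerm zero    = 1ℚ
expTerm (suc i) = expTerm i * (-[1+ 0 ] / suc i)

expNegOneApprox : ℕ → ℚ
expNegOneApprox zero    = expTerm zero
expNegOneApprox (suc m) = expNegOneApprox m + expTerm (suc m)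

-- Poisson(1) point mass at a with e^{-1} replaced by its approximation s:
--   s / a!
poissonApprox : ℚ → ℕ → ℚ
poissonApprox s a = s * (_/_ (+ 1) (a !) {{a !≢0}})

prodFin : ∀ k → (Fin k → ℚ) → ℚ
prodFin zero    f = 1ℚ
prodFin (suc k) f = f Fin.zero * prodFin k (λ j → f (Fin.suc j))

-- approximation (using s_m in place of e^{-1}) of
-- P(T_0 = a_0, …, T_k = a_k) = ∏_j e^{-1} / a_j!   (T_j iid Poisson(1))
jointPoissonApprox : ∀ k → (Fin (suc k) → ℕ) → ℕ → ℚ
jointPoissonApprox k a m = prodFin (suc k) (λ j → poissonApprox (expNegOneApprox m) (a j))

module Submission where

-- Method of moments. Fix r ∈ ℕ^{k+1} and put s = Σⱼ rⱼ. The joint factorial moment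
-- E[∏ⱼ (Lⱼ)_{rⱼ}] counts diagrams together with an ordered choice of rⱼ distinct chords of
-- each length j. Choose these s chords one at a time: there are exactly 2n slots ⟨i, i+j+1⟩
-- for a chord of length j, and each chord already chosen blocks at most 8 of them, so every
-- step has between 2n - 8s and 2n choices; the remaining 2(n-s) points are then matched in
-- (2(n-s)-1)!! ways. As (2n-1)!! = (2n-1)(2n-3)⋯(2n-2s+1)·(2(n-s)-1)!!, the moment tends to 1,
-- the joint factorial moment of independent Poisson(1) variables.
-- The alternating truncations of [L = x] = Σₜ (-1)ᵗ C(x+t,t) C(L,x+t) (Bonferroni's
-- inequalities) turn convergence of these moments into convergence of the point probabilities,
-- one coordinate at a time; e⁻¹ enters through the partial sums Σ_{t≤T} (-1)ᵗ/t!.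

module RationalFacts where

  open import Level using (0ℓ)
  open import Data.Nat as ℕ using (ℕ; zero; suc; NonZero)
  import Data.Nat.Properties as ℕₚ
  open import Data.Integer as ℤ using (+_; -[1+_])
  open import Data.Rational as ℚ using (ℚ; mkℚ; _/_; _+_; _*_; _-_; -_; ∣_∣; _≤_; _<_; 0ℚ; 1ℚ; ½)
  import Data.Rational.Properties as ℚₚ
  import Data.Rational.Unnormalised as ℚᵘ
  import Data.Rational.Unnormalised.Properties as ℚᵘₚ
  open import Data.Product using (∃-syntax; _×_; _,_)
  open import Data.Sum using (inj₁; inj₂)
  open import Data.Empty using (⊥-elim)
  open import Relation.Binary.PropositionalEquality
  open import Relation.Nullary.Decidable using (dec⇒maybe)
  open import Tactic.RingSolver using (solve-∀)
  import Tactic.RingSolver.Core.AlmostCommutativeRing as ACR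
  import Data.Integer.Tactic.RingSolver as ℤ-Solver

  ℚ-ring : ACR.AlmostCommutativeRing 0ℓ 0ℓ
  ℚ-ring = ACR.fromCommutativeRing ℚₚ.+-*-commutativeRing (λ x → dec⇒maybe (0ℚ ℚₚ.≟ x))

  fromℚᵘ-+ : ∀ p q → ℚ.fromℚᵘ (p ℚᵘ.+ q) ≡ ℚ.fromℚᵘ p + ℚ.fromℚᵘ q
  fromℚᵘ-+ p q = ℚₚ.toℚᵘ-injective (ℚᵘₚ.≃-trans (ℚₚ.toℚᵘ-fromℚᵘ (p ℚᵘ.+ q))
    (ℚᵘₚ.≃-trans (ℚᵘₚ.+-cong (ℚᵘₚ.≃-sym (ℚₚ.toℚᵘ-fromℚᵘ p)) (ℚᵘₚ.≃-sym (ℚₚ.toℚᵘ-fromℚᵘ q)))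
      (ℚᵘₚ.≃-sym (ℚₚ.toℚᵘ-homo-+ (ℚ.fromℚᵘ p) (ℚ.fromℚᵘ q)))))

  fromℚᵘ-* : ∀ p q → ℚ.fromℚᵘ (p ℚᵘ.* q) ≡ ℚ.fromℚᵘ p * ℚ.fromℚᵘ q
  fromℚᵘ-* p q = ℚₚ.toℚᵘ-injective (ℚᵘₚ.≃-trans (ℚₚ.toℚᵘ-fromℚᵘ (p ℚᵘ.* q))
    (ℚᵘₚ.≃-trans (ℚᵘₚ.*-cong (ℚᵘₚ.≃-sym (ℚₚ.toℚᵘ-fromℚᵘ p)) (ℚᵘₚ.≃-sym (ℚₚ.toℚᵘ-fromℚᵘ q)))
      (ℚᵘₚ.≃-sym (ℚₚ.toℚᵘ-homo-* (ℚ.fromℚᵘ p) (ℚ.fromℚᵘ q)))))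

  fromℕ : ℕ → ℚ
  fromℕ n = + n / 1

  fromℕ-suc : ∀ n → fromℕ (suc n) ≡ 1ℚ + fromℕ n
  fromℕ-suc n = trans (ℚₚ.fromℚᵘ-cong {ℚᵘ.mkℚᵘ (+ suc n) 0} {ℚᵘ.mkℚᵘ (+ 1) 0 ℚᵘ.+ ℚᵘ.mkℚᵘ (+ n) 0} (ℚᵘ.*≡* (eq (+ n))))
    (fromℚᵘ-+ (ℚᵘ.mkℚᵘ (+ 1) 0) (ℚᵘ.mkℚᵘ (+ n) 0))
    where
    eq : ∀ x → (+ 1 ℤ.+ x) ℤ.* + 1 ≡ (+ 1 ℤ.* + 1 ℤ.+ x ℤ.* + 1) ℤ.* + 1
    eq = ℤ-Solver.solve-∀

  fromℕ-+ : ∀ a b → fromℕ (a ℕ.+ b) ≡ fromℕ a + fromℕ b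
  fromℕ-+ zero    b = sym (ℚₚ.+-identityˡ (fromℕ b))
  fromℕ-+ (suc a) b = begin
    fromℕ (suc (a ℕ.+ b))    ≡⟨ fromℕ-suc (a ℕ.+ b) ⟩
    1ℚ + fromℕ (a ℕ.+ b)     ≡⟨ cong (λ z → 1ℚ + z) (fromℕ-+ a b) ⟩
    1ℚ + (fromℕ a + fromℕ b) ≡⟨ ℚₚ.+-assoc 1ℚ (fromℕ a) (fromℕ b) ⟨
    1ℚ + fromℕ a + fromℕ b   ≡⟨ cong (_+ fromℕ b) (fromℕ-suc a) ⟨
    fromℕ (suc a) + fromℕ b  ∎
    where open ≡-Reasoning

  fromℕ-* : ∀ a b → fromℕ (a ℕ.* b) ≡ fromℕ a * fromℕ b
  fromℕ-* zero    b = sym (ℚₚ.*-zeroˡ (fromℕ b))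
  fromℕ-* (suc a) b = begin
    fromℕ (b ℕ.+ a ℕ.* b)        ≡⟨ fromℕ-+ b (a ℕ.* b) ⟩
    fromℕ b + fromℕ (a ℕ.* b)    ≡⟨ cong (λ z → fromℕ b + z) (fromℕ-* a b) ⟩
    fromℕ b + fromℕ a * fromℕ b  ≡⟨ distrib (fromℕ a) (fromℕ b) ⟩
    (1ℚ + fromℕ a) * fromℕ b     ≡⟨ cong (_* fromℕ b) (fromℕ-suc a) ⟨
    fromℕ (suc a) * fromℕ b      ∎
    where
    open ≡-Reasoning
    distrib : ∀ x y → y + x * y ≡ (1ℚ + x) * y
    distrib = solve-∀ ℚ-ring

  fromℕ-nonNeg : ∀ a → 0ℚ ≤ fromℕ a
  fromℕ-nonNeg a = ℚₚ.nonNegative⁻¹ (fromℕ a) {{ℚₚ.normalize-nonNeg a 1}}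

  ≤-by-diff : ∀ {a b} u → 0ℚ ≤ u → b - a ≡ u → a ≤ b
  ≤-by-diff {a} {b} u 0≤u b-a≡u =
    subst₂ _≤_ (ℚₚ.+-identityʳ a) (a+[b-a]≡b a b) (ℚₚ.+-monoʳ-≤ a (subst (0ℚ ≤_) (sym b-a≡u) 0≤u))
    where
    a+[b-a]≡b : ∀ a b → a + (b - a) ≡ b
    a+[b-a]≡b = solve-∀ ℚ-ring

  ≤⇒0≤diff : ∀ {a b} → a ≤ b → 0ℚ ≤ b - a
  ≤⇒0≤diff {a} {b} a≤b = subst (_≤ b - a) (ℚₚ.+-inverseʳ a) (ℚₚ.+-monoˡ-≤ (- a) a≤b)

  fromℕ-mono-≤ : ∀ {a b} → a ℕ.≤ b → fromℕ a ≤ fromℕ b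
  fromℕ-mono-≤ {a} {b} a≤b = ≤-by-diff (fromℕ (b ℕ.∸ a)) (fromℕ-nonNeg (b ℕ.∸ a)) (begin
    fromℕ b - fromℕ a                          ≡⟨ cong (λ z → fromℕ z - fromℕ a) (ℕₚ.m+[n∸m]≡n a≤b) ⟨
    fromℕ (a ℕ.+ (b ℕ.∸ a)) - fromℕ a          ≡⟨ cong (_- fromℕ a) (fromℕ-+ a (b ℕ.∸ a)) ⟩
    fromℕ a + fromℕ (b ℕ.∸ a) - fromℕ a        ≡⟨ cancel (fromℕ a) (fromℕ (b ℕ.∸ a)) ⟩
    fromℕ (b ℕ.∸ a)                            ∎)
    where
    open ≡-Reasoning
    cancel : ∀ x y → x + y - x ≡ y
    cancel = solve-∀ ℚ-ring

  -- The sign conditions are arguments rather than instances. Callers often pass implicit arguments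
  -- explicitly: unifying them under _*_ would unfold the normalising rational arithmetic.
  *-monoʳ-≤-nonNeg : ∀ {a b c} → 0ℚ ≤ c → a ≤ b → a * c ≤ b * c
  *-monoʳ-≤-nonNeg {c = c} 0≤c = ℚₚ.*-monoʳ-≤-nonNeg c {{ℚ.nonNegative 0≤c}}

  *-monoˡ-≤-nonNeg : ∀ {a b c} → 0ℚ ≤ c → a ≤ b → c * a ≤ c * b
  *-monoˡ-≤-nonNeg {c = c} 0≤c = ℚₚ.*-monoˡ-≤-nonNeg c {{ℚ.nonNegative 0≤c}}

  nonNeg-* : ∀ {x y} → 0ℚ ≤ x → 0ℚ ≤ y → 0ℚ ≤ x * y
  nonNeg-* {x} {y} 0≤x 0≤y = subst (_≤ x * y) (ℚₚ.*-zeroˡ y) (*-monoʳ-≤-nonNeg 0≤y 0≤x)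

  *-mono-≤-nonNeg : ∀ {a b c d} → 0ℚ ≤ a → a ≤ b → 0ℚ ≤ c → c ≤ d → a * c ≤ b * d
  *-mono-≤-nonNeg {a} {b} {c} {d} 0≤a a≤b 0≤c c≤d =
    ℚₚ.≤-trans (*-monoˡ-≤-nonNeg 0≤a c≤d) (*-monoʳ-≤-nonNeg (ℚₚ.≤-trans 0≤c c≤d) a≤b)

  recip : (d : ℕ) → .{{NonZero d}} → ℚ
  recip d = + 1 / d

  recip-cong : ∀ {a b} .{{_ : NonZero a}} .{{_ : NonZero b}} → a ≡ b → recip a ≡ recip b
  recip-cong refl = refl

  fromℕ*recip≡1 : ∀ d .{{_ : NonZero d}} → fromℕ d * recip d ≡ 1ℚ
  fromℕ*recip≡1 (suc d) = trans (sym (fromℚᵘ-* (ℚᵘ.mkℚᵘ (+ suc d) 0) (ℚᵘ.mkℚᵘ (+ 1) d)))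
    (ℚₚ.fromℚᵘ-cong {ℚᵘ.mkℚᵘ (+ suc d) 0 ℚᵘ.* ℚᵘ.mkℚᵘ (+ 1) d} {ℚᵘ.mkℚᵘ (+ 1) 0} (ℚᵘ.*≡* (eq (+ suc d))))
    where
    eq : ∀ x → (x ℤ.* + 1) ℤ.* + 1 ≡ + 1 ℤ.* (+ 1 ℤ.* x)
    eq = ℤ-Solver.solve-∀

  recip-* : ∀ a b .{{_ : NonZero a}} .{{_ : NonZero b}} .{{_ : NonZero (a ℕ.* b)}} →
            recip (a ℕ.* b) ≡ recip a * recip b
  recip-* (suc a) (suc b) = trans
    (ℚₚ.fromℚᵘ-cong {ℚᵘ.mkℚᵘ (+ 1) (b ℕ.+ a ℕ.* suc b)} {ℚᵘ.mkℚᵘ (+ 1) a ℚᵘ.* ℚᵘ.mkℚᵘ (+ 1) b} (ℚᵘ.*≡* (eq (+ suc a) (+ suc b))))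
    (fromℚᵘ-* (ℚᵘ.mkℚᵘ (+ 1) a) (ℚᵘ.mkℚᵘ (+ 1) b))
    where
    eq : ∀ x y → + 1 ℤ.* (x ℤ.* y) ≡ (+ 1 ℤ.* + 1) ℤ.* (x ℤ.* y)
    eq = ℤ-Solver.solve-∀

  recip-nonNeg : ∀ d .{{_ : NonZero d}} → 0ℚ ≤ recip d
  recip-nonNeg d = ℚₚ.nonNegative⁻¹ (recip d) {{ℚₚ.normalize-nonNeg 1 d}}

  recip-antimono-≤ : ∀ a b .{{_ : NonZero a}} .{{_ : NonZero b}} → a ℕ.≤ b → recip b ≤ recip a
  recip-antimono-≤ a b a≤b = subst₂ _≤_ (cancelˡ b a) (cancelʳ b a)
    (*-monoʳ-≤-nonNeg (recip-nonNeg a) (*-monoˡ-≤-nonNeg (recip-nonNeg b) (fromℕ-mono-≤ a≤b)))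
    where
    cancelˡ : ∀ b a .{{_ : NonZero a}} .{{_ : NonZero b}} → recip b * fromℕ a * recip a ≡ recip b
    cancelˡ b a = trans (ℚₚ.*-assoc (recip b) (fromℕ a) (recip a))
      (trans (cong (recip b *_) (fromℕ*recip≡1 a)) (ℚₚ.*-identityʳ (recip b)))
    cancelʳ : ∀ b a .{{_ : NonZero a}} .{{_ : NonZero b}} → recip b * fromℕ b * recip a ≡ recip a
    cancelʳ b a = trans (cong (_* recip a) (trans (ℚₚ.*-comm (recip b) (fromℕ b)) (fromℕ*recip≡1 b)))
      (ℚₚ.*-identityˡ (recip a))

  recip≤1 : ∀ d .{{_ : NonZero d}} → recip d ≤ 1ℚ
  recip≤1 d@(suc _) = recip-antimono-≤ 1 d (ℕ.s≤s ℕ.z≤n)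

  archimedean : ∀ ε → 0ℚ < ε → ∃[ q ] recip (suc q) ≤ ε
  archimedean ε@(mkℚ (+ suc p) d _) _ = d , subst (recip (suc d) ≤_) ε≡[1+p]/[1+d] (begin
    recip (suc d)                     ≡⟨ ℚₚ.*-identityˡ (recip (suc d)) ⟨
    1ℚ * recip (suc d)                ≤⟨ *-monoʳ-≤-nonNeg (recip-nonNeg (suc d)) (fromℕ-mono-≤ {1} {suc p} (ℕ.s≤s ℕ.z≤n)) ⟩
    fromℕ (suc p) * recip (suc d)     ∎)
    where
    open ℚₚ.≤-Reasoning
    ε≡[1+p]/[1+d] : fromℕ (suc p) * recip (suc d) ≡ ε
    ε≡[1+p]/[1+d] = trans (sym (fromℚᵘ-* (ℚᵘ.mkℚᵘ (+ suc p) 0) (ℚᵘ.mkℚᵘ (+ 1) d)))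
      (trans (ℚₚ.fromℚᵘ-cong {ℚᵘ.mkℚᵘ (+ suc p) 0 ℚᵘ.* ℚᵘ.mkℚᵘ (+ 1) d} {ℚᵘ.mkℚᵘ (+ suc p) d} (ℚᵘ.*≡* (eq (+ suc p) (+ suc d)))) (ℚₚ.↥p/↧p≡p ε))
      where
      eq : ∀ x y → (x ℤ.* + 1) ℤ.* y ≡ x ℤ.* (+ 1 ℤ.* y)
      eq = ℤ-Solver.solve-∀
  archimedean (mkℚ (+ 0)      _ _) 0<ε = ⊥-elim (ℤ.Positive.pos (ℚ.positive 0<ε))
  archimedean (mkℚ -[1+ _ ]   _ _) 0<ε = ⊥-elim (ℤ.Positive.pos (ℚ.positive 0<ε))

  neg-involutive : ∀ p → - (- p) ≡ p
  neg-involutive = solve-∀ ℚ-ring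

  -b≤p≤b⇒∣p∣≤b : ∀ {p b} → - b ≤ p → p ≤ b → ∣ p ∣ ≤ b
  -b≤p≤b⇒∣p∣≤b {p} {b} -b≤p p≤b with ℚₚ.∣p∣≡p∨∣p∣≡-p p
  ... | inj₁ ∣p∣≡p  = subst (_≤ b) (sym ∣p∣≡p) p≤b
  ... | inj₂ ∣p∣≡-p = subst₂ _≤_ (sym ∣p∣≡-p) (neg-involutive b) (ℚₚ.neg-antimono-≤ -b≤p)

  p≤∣p∣ : ∀ p → p ≤ ∣ p ∣
  p≤∣p∣ p with ℚₚ.∣p∣≡p∨∣p∣≡-p p
  ... | inj₁ ∣p∣≡p  = ℚₚ.≤-reflexive (sym ∣p∣≡p)
  ... | inj₂ ∣p∣≡-p = ℚₚ.≤-trans p≤0 (ℚₚ.0≤∣p∣ p)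
    where
    p≤0 : p ≤ 0ℚ
    p≤0 = subst₂ _≤_ (neg-involutive p) refl (ℚₚ.neg-antimono-≤ (subst (0ℚ ≤_) ∣p∣≡-p (ℚₚ.0≤∣p∣ p)))

  ∣p∣≤b⇒-b≤p≤b : ∀ {p b} → ∣ p ∣ ≤ b → (- b ≤ p) × (p ≤ b)
  ∣p∣≤b⇒-b≤p≤b {p} {b} ∣p∣≤b =
    subst (- b ≤_) (neg-involutive p)
      (ℚₚ.neg-antimono-≤ (ℚₚ.≤-trans (p≤∣p∣ (- p)) (subst (_≤ b) (sym (ℚₚ.∣-p∣≡∣p∣ p)) ∣p∣≤b))) ,
    ℚₚ.≤-trans (p≤∣p∣ p) ∣p∣≤b

  ∣p-q∣≡∣q-p∣ : ∀ p q → ∣ p - q ∣ ≡ ∣ q - p ∣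
  ∣p-q∣≡∣q-p∣ p q = trans (cong ∣_∣ (flip p q)) (ℚₚ.∣-p∣≡∣p∣ (q - p))
    where
    flip : ∀ p q → p - q ≡ - (q - p)
    flip = solve-∀ ℚ-ring

  halve : ∀ ε → 0ℚ < ε → ∃[ δ ] (0ℚ < δ) × (δ + δ ≤ ε)
  halve ε 0<ε = ε * ½ , ℚₚ.positive⁻¹ _ {{ℚₚ.pos*pos⇒pos ε {{ℚ.positive 0<ε}} ½}} ,
    ℚₚ.≤-reflexive (trans (sym (ℚₚ.*-distribˡ-+ ε ½ ½)) (ℚₚ.*-identityʳ ε))

  shrink : ∀ ε → 0ℚ < ε → ∀ K → ∃[ δ ] (0ℚ < δ) × (fromℕ K * δ ≤ ε)
  shrink ε 0<ε K = ε * recip (suc K) ,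
    ℚₚ.positive⁻¹ _ {{ℚₚ.pos*pos⇒pos ε {{ℚ.positive 0<ε}} (recip (suc K)) {{ℚₚ.normalize-pos 1 (suc K)}}}} ,
    (begin
      fromℕ K * (ε * recip (suc K))        ≤⟨ *-monoʳ-≤-nonNeg 0≤δ (fromℕ-mono-≤ (ℕₚ.n≤1+n K)) ⟩
      fromℕ (suc K) * (ε * recip (suc K))  ≡⟨ rearrange (fromℕ (suc K)) ε (recip (suc K)) ⟩
      ε * (fromℕ (suc K) * recip (suc K))  ≡⟨ cong (ε *_) (fromℕ*recip≡1 (suc K)) ⟩
      ε * 1ℚ                               ≡⟨ ℚₚ.*-identityʳ ε ⟩
      ε                                    ∎)
    where
    open ℚₚ.≤-Reasoning
    0≤δ : 0ℚ ≤ ε * recip (suc K)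
    0≤δ = nonNeg-* (ℚₚ.<⇒≤ 0<ε) (recip-nonNeg (suc K))
    rearrange : ∀ a b c → a * (b * c) ≡ b * (a * c)
    rearrange = solve-∀ ℚ-ring

  nonNeg*[nonPos*nonNeg]≤0 : ∀ a b c → 0ℚ ≤ a → b ≤ 0ℚ → 0ℚ ≤ c → a * (b * c) ≤ 0ℚ
  nonNeg*[nonPos*nonNeg]≤0 a b c 0≤a b≤0 0≤c =
    ≤-by-diff (a * (- b * c)) (nonNeg-* {a} {(- b) * c} 0≤a (nonNeg-* {(- b)} {c} (ℚₚ.neg-antimono-≤ b≤0) 0≤c)) (negate a b c)
    where
    negate : ∀ a b c → 0ℚ - a * (b * c) ≡ a * (- b * c)
    negate = solve-∀ ℚ-ring

  ∣p*q∣≤1 : ∀ p q → ∣ p ∣ ≤ 1ℚ → ∣ q ∣ ≤ 1ℚ → ∣ p * q ∣ ≤ 1ℚ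
  ∣p*q∣≤1 p q ∣p∣≤1 ∣q∣≤1 = subst (_≤ 1ℚ) (sym (ℚₚ.∣p*q∣≡∣p∣*∣q∣ p q))
    (*-mono-≤-nonNeg {∣ p ∣} {1ℚ} {∣ q ∣} {1ℚ} (ℚₚ.0≤∣p∣ p) ∣p∣≤1 (ℚₚ.0≤∣p∣ q) ∣q∣≤1)


module Indicators where

  open import Data.Nat using (ℕ; _≤_; _+_; _*_; z≤n; s≤s)
  import Data.Nat.Properties as ℕₚ
  open import Data.Bool using (true; false; if_then_else_)
  open import Data.Sum using (_⊎_; inj₁; inj₂)
  open import Relation.Binary.PropositionalEquality
  open import Relation.Nullary using (Dec; yes; no; does; ¬_; ¬?)
  open import Relation.Nullary.Decidable using (_×-dec_; dec-true; dec-false; does-⇔)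
  open import Function.Bundles using (mk⇔)

  χ : ∀ {p} {P : Set p} → Dec P → ℕ
  χ d = if does d then 1 else 0

  χ-yes : ∀ {p} {P : Set p} → P → (d : Dec P) → χ d ≡ 1
  χ-yes p d = cong (if_then 1 else 0) (dec-true d p)

  χ-no : ∀ {p} {P : Set p} → ¬ P → (d : Dec P) → χ d ≡ 0
  χ-no ¬p d = cong (if_then 1 else 0) (dec-false d ¬p)

  χ-⇔ : ∀ {p q} {P : Set p} {Q : Set q} → (P → Q) → (Q → P) → (d : Dec P) (e : Dec Q) → χ d ≡ χ e
  χ-⇔ f g d e = cong (if_then 1 else 0) (does-⇔ (mk⇔ f g) d e)

  χ-× : ∀ {p q} {P : Set p} {Q : Set q} (d : Dec P) (e : Dec Q) → χ (d ×-dec e) ≡ χ d * χ e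
  χ-× d e with does d
  ... | true  = sym (ℕₚ.+-identityʳ (χ e))
  ... | false = refl

  χ≡0⊎χ≡1 : ∀ {p} {P : Set p} (d : Dec P) → (χ d ≡ 0) ⊎ (χ d ≡ 1)
  χ≡0⊎χ≡1 (yes _) = inj₂ refl
  χ≡0⊎χ≡1 (no _)  = inj₁ refl

  χ≤1 : ∀ {p} {P : Set p} (d : Dec P) → χ d ≤ 1
  χ≤1 d with does d
  ... | true  = s≤s z≤n
  ... | false = z≤n

  χ-mono : ∀ {p q} {P : Set p} {Q : Set q} → (P → Q) → (d : Dec P) (e : Dec Q) → χ d ≤ χ e
  χ-mono P⇒Q (yes p) e = ℕₚ.≤-reflexive (sym (χ-yes (P⇒Q p) e))
  χ-mono P⇒Q (no _)  e = z≤n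

  χ+χ¬≡1 : ∀ {p} {P : Set p} (d : Dec P) → χ d + χ (¬? d) ≡ 1
  χ+χ¬≡1 (yes _) = refl
  χ+χ¬≡1 (no _)  = refl


module FiniteSums where

  open import Data.Nat as ℕ using (ℕ; zero; suc; _+_; _*_; _≤_; _<_; z≤n; s≤s)
  import Data.Nat.Properties as ℕₚ
  open import Data.Fin as Fin using (Fin)
  import Data.Fin.Properties as FinP
  open import Data.Product using (∃-syntax; _,_)
  open import Data.List using (List; []; _∷_; _++_; map; concatMap; filter; length; allFin; tabulate)
  open import Data.Bool using (true; false)
  open import Data.Nat.Tactic.RingSolver using (solve-∀)
  open import Relation.Binary.PropositionalEquality
  open import Relation.Nullary using (Dec; does; ¬?)
  open import Function using (_∘_)
  open import Data.Vec.Functional using (updateAt)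
  open import Algebra.Properties.Semiring.Sum ℕₚ.+-*-semiring public
    using (sum; sum-syntax; ∑-distrib-+; ∑-comm; sum-cong-≗; *-distribˡ-sum; *-distribʳ-sum)
  open Indicators

  ∑-const : ∀ M c → ∑[ i < M ] c ≡ M * c
  ∑-const zero    c = refl
  ∑-const (suc M) c = cong (c +_) (∑-const M c)

  ∑-zero : ∀ M {f : Fin M → ℕ} → (∀ i → f i ≡ 0) → sum f ≡ 0
  ∑-zero M f≡0 = trans (sum-cong-≗ f≡0) (trans (∑-const M 0) (ℕₚ.*-zeroʳ M))

  ∑-mono-≤ : ∀ {M} {f g : Fin M → ℕ} → (∀ i → f i ≤ g i) → sum f ≤ sum g
  ∑-mono-≤ {zero}  f≤g = z≤n
  ∑-mono-≤ {suc M} f≤g = ℕₚ.+-mono-≤ (f≤g Fin.zero) (∑-mono-≤ (f≤g ∘ Fin.suc))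

  ∑-δ : ∀ {M} (a : Fin M) (g : Fin M → ℕ) → ∑[ y < M ] (χ (a Fin.≟ y) * g y) ≡ g a
  ∑-δ {suc M} Fin.zero g =
    trans (cong₂ _+_ (ℕₚ.+-identityʳ (g Fin.zero)) (∑-zero M (λ y → cong (_* g (Fin.suc y)) (χ-no (λ ()) (Fin.zero Fin.≟ Fin.suc y)))))
          (ℕₚ.+-identityʳ (g Fin.zero))
  ∑-δ {suc M} (Fin.suc a) g = trans
    (cong₂ _+_ (cong (_* g Fin.zero) (χ-no (λ ()) (Fin.suc a Fin.≟ Fin.zero)))
               (trans (sum-cong-≗ (λ y → cong (_* g (Fin.suc y)) (χ-⇔ FinP.suc-injective (cong Fin.suc) (Fin.suc a Fin.≟ Fin.suc y) (a Fin.≟ y))))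
                      (∑-δ a (g ∘ Fin.suc))))
    refl

  ∑-δ′ : ∀ {M} (a : Fin M) (g : Fin M → ℕ) → ∑[ y < M ] (χ (y Fin.≟ a) * g y) ≡ g a
  ∑-δ′ a g = trans (sum-cong-≗ (λ y → cong (_* g y) (χ-⇔ sym sym (y Fin.≟ a) (a Fin.≟ y)))) (∑-δ a g)

  term≤∑ : ∀ {M} (f : Fin M → ℕ) a → f a ≤ sum f
  term≤∑ {suc M} f Fin.zero    = ℕₚ.m≤m+n (f Fin.zero) _
  term≤∑ {suc M} f (Fin.suc a) = ℕₚ.≤-trans (term≤∑ (f ∘ Fin.suc) a) (ℕₚ.m≤n+m _ (f Fin.zero))

  ∑-pos : ∀ {M} (f : Fin M → ℕ) → 0 < sum f → ∃[ a ] 0 < f a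
  ∑-pos {suc M} f 0<∑ with f Fin.zero in eq
  ... | suc _ = Fin.zero , subst (0 <_) (sym eq) (s≤s z≤n)
  ... | zero  with ∑-pos (f ∘ Fin.suc) 0<∑
  ...   | a , 0<fa = Fin.suc a , 0<fa

  ∑-χ+∑-χ¬ : ∀ M {P : Fin M → Set} (P? : ∀ i → Dec (P i)) → ∑[ i < M ] χ (P? i) + ∑[ i < M ] χ (¬? (P? i)) ≡ M
  ∑-χ+∑-χ¬ M P? = trans (sym (∑-distrib-+ (λ i → χ (P? i)) (λ i → χ (¬? (P? i)))))
    (trans (sum-cong-≗ (λ i → χ+χ¬≡1 (P? i))) (trans (∑-const M 1) (ℕₚ.*-identityʳ M)))

  sumℕ : ∀ {a} {A : Set a} → List A → (A → ℕ) → ℕ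
  sumℕ []       f = 0
  sumℕ (x ∷ xs) f = f x + sumℕ xs f

  module _ {a} {A : Set a} where

    sumℕ-cong : ∀ (xs : List A) {f g} → (∀ x → f x ≡ g x) → sumℕ xs f ≡ sumℕ xs g
    sumℕ-cong []       f≗g = refl
    sumℕ-cong (x ∷ xs) f≗g = cong₂ _+_ (f≗g x) (sumℕ-cong xs f≗g)

    sumℕ-+ : ∀ (xs : List A) f g → sumℕ xs (λ x → f x + g x) ≡ sumℕ xs f + sumℕ xs g
    sumℕ-+ []       f g = refl
    sumℕ-+ (x ∷ xs) f g = trans (cong (f x + g x +_) (sumℕ-+ xs f g)) (interchange (f x) (g x) (sumℕ xs f) (sumℕ xs g))
      where
      interchange : ∀ a b c d → a + b + (c + d) ≡ a + c + (b + d)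
      interchange = solve-∀

    sumℕ-*ˡ : ∀ (xs : List A) c f → sumℕ xs (λ x → c * f x) ≡ c * sumℕ xs f
    sumℕ-*ˡ []       c f = sym (ℕₚ.*-zeroʳ c)
    sumℕ-*ˡ (x ∷ xs) c f = trans (cong (c * f x +_) (sumℕ-*ˡ xs c f)) (sym (ℕₚ.*-distribˡ-+ c (f x) (sumℕ xs f)))

    sumℕ-mono-≤ : ∀ (xs : List A) {f g} → (∀ x → f x ≤ g x) → sumℕ xs f ≤ sumℕ xs g
    sumℕ-mono-≤ []       f≤g = z≤n
    sumℕ-mono-≤ (x ∷ xs) f≤g = ℕₚ.+-mono-≤ (f≤g x) (sumℕ-mono-≤ xs f≤g)

    sumℕ-const : ∀ (xs : List A) c → sumℕ xs (λ _ → c) ≡ length xs * c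
    sumℕ-const []       c = refl
    sumℕ-const (x ∷ xs) c = cong (c +_) (sumℕ-const xs c)

    sumℕ-++ : ∀ (xs ys : List A) f → sumℕ (xs ++ ys) f ≡ sumℕ xs f + sumℕ ys f
    sumℕ-++ []       ys f = refl
    sumℕ-++ (x ∷ xs) ys f = trans (cong (f x +_) (sumℕ-++ xs ys f)) (sym (ℕₚ.+-assoc (f x) (sumℕ xs f) (sumℕ ys f)))

    sumℕ-filter : ∀ {p} {P : A → Set p} (P? : ∀ x → Dec (P x)) (xs : List A) f →
                  sumℕ (filter P? xs) f ≡ sumℕ xs (λ x → χ (P? x) * f x)
    sumℕ-filter P? []       f = refl
    sumℕ-filter P? (x ∷ xs) f with does (P? x)
    ... | true  = cong₂ _+_ (sym (ℕₚ.+-identityʳ (f x))) (sumℕ-filter P? xs f)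
    ... | false = sumℕ-filter P? xs f

    length-filter≡sumℕ-χ : ∀ {p} {P : A → Set p} (P? : ∀ x → Dec (P x)) (xs : List A) →
                           length (filter P? xs) ≡ sumℕ xs (λ x → χ (P? x))
    length-filter≡sumℕ-χ P? xs = trans (sym (trans (sumℕ-const (filter P? xs) 1) (ℕₚ.*-identityʳ _)))
      (trans (sumℕ-filter P? xs (λ _ → 1)) (sumℕ-cong xs (λ x → ℕₚ.*-identityʳ (χ (P? x)))))

    sumℕ-∑-comm : ∀ (xs : List A) M (f : A → Fin M → ℕ) → sumℕ xs (λ x → ∑[ i < M ] f x i) ≡ ∑[ i < M ] sumℕ xs (λ x → f x i)
    sumℕ-∑-comm []       M f = sym (∑-zero M (λ _ → refl))
    sumℕ-∑-comm (x ∷ xs) M f = trans (cong (sum (f x) +_) (sumℕ-∑-comm xs M f)) (sym (∑-distrib-+ (f x) (λ i → sumℕ xs (λ x → f x i))))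

  sumℕ-map : ∀ {a b} {A : Set a} {B : Set b} (g : A → B) (xs : List A) (f : B → ℕ) → sumℕ (map g xs) f ≡ sumℕ xs (f ∘ g)
  sumℕ-map g []       f = refl
  sumℕ-map g (x ∷ xs) f = cong (f (g x) +_) (sumℕ-map g xs f)

  sumℕ-concatMap : ∀ {a b} {A : Set a} {B : Set b} (g : A → List B) (xs : List A) (f : B → ℕ) →
                   sumℕ (concatMap g xs) f ≡ sumℕ xs (λ x → sumℕ (g x) f)
  sumℕ-concatMap g []       f = refl
  sumℕ-concatMap g (x ∷ xs) f = trans (sumℕ-++ (g x) (concatMap g xs) f) (cong (sumℕ (g x) f +_) (sumℕ-concatMap g xs f))

  sumℕ-tabulate : ∀ {a} {A : Set a} M (g : Fin M → A) (f : A → ℕ) → sumℕ (tabulate g) f ≡ ∑[ i < M ] f (g i)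
  sumℕ-tabulate zero    g f = refl
  sumℕ-tabulate (suc M) g f = cong (f (g Fin.zero) +_) (sumℕ-tabulate M (g ∘ Fin.suc) f)

  sumℕ-allFin : ∀ M (f : Fin M → ℕ) → sumℕ (allFin M) f ≡ sum f
  sumℕ-allFin M f = sumℕ-tabulate M (λ i → i) f

  open import Algebra.Properties.CommutativeMonoid.Sum ℕₚ.*-1-commutativeMonoid public
    using () renaming (sum to product; sum-cong-≗ to product-cong)

  product-extract : ∀ {K} (f g : Fin K → ℕ) j₀ c → f j₀ ≡ c * g j₀ → (∀ j → j ≢ j₀ → f j ≡ g j) → product f ≡ c * product g
  product-extract {suc K} f g Fin.zero c f≡cg f≡g =
    trans (cong₂ _*_ f≡cg (product-cong {K} (λ j → f≡g (Fin.suc j) (λ ())))) (ℕₚ.*-assoc c (g Fin.zero) _)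
  product-extract {suc K} f g (Fin.suc j₀) c f≡cg f≡g =
    trans (cong₂ _*_ (f≡g Fin.zero (λ ())) (product-extract (f ∘ Fin.suc) (g ∘ Fin.suc) j₀ c f≡cg (λ j j≢j₀ → f≡g (Fin.suc j) (j≢j₀ ∘ FinP.suc-injective))))
          (swap (g Fin.zero) c (product (g ∘ Fin.suc)))
    where
    swap : ∀ a b c → a * (b * c) ≡ b * (a * c)
    swap = solve-∀

  product-1 : ∀ {K} {f : Fin K → ℕ} → (∀ j → f j ≡ 1) → product f ≡ 1
  product-1 {zero}  f≡1 = refl
  product-1 {suc K} f≡1 = cong₂ _*_ (f≡1 Fin.zero) (product-1 (f≡1 ∘ Fin.suc))

  ∑-updateAt-pred : ∀ {K} (r : Fin K → ℕ) j₀ → 0 < r j₀ → sum r ≡ suc (sum (updateAt r j₀ ℕ.pred))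
  ∑-updateAt-pred {suc K} r Fin.zero 0<r with r Fin.zero
  ... | suc r′ = refl
  ∑-updateAt-pred {suc K} r (Fin.suc j₀) 0<r =
    trans (cong (r Fin.zero +_) (∑-updateAt-pred (r ∘ Fin.suc) j₀ 0<r)) (ℕₚ.+-suc (r Fin.zero) _)

  ∑≡0⇒≡0 : ∀ {K} (r : Fin K → ℕ) → sum r ≡ 0 → ∀ j → r j ≡ 0
  ∑≡0⇒≡0 r ∑≡0 j = ℕₚ.n≤0⇒n≡0 (ℕₚ.≤-trans (term≤∑ r j) (ℕₚ.≤-reflexive ∑≡0))


module BonferroniInequalities where

  open import Data.Nat as ℕ using (ℕ; zero; suc; _!; _∸_; z≤n; s≤s)
  import Data.Nat.Properties as ℕₚ
  open import Data.Integer using (+_)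
  open import Data.Rational as ℚ using (ℚ; _+_; _*_; _-_; -_; ∣_∣; _≤_; 0ℚ; 1ℚ)
  import Data.Rational.Properties as ℚₚ
  open import Data.Sum using (inj₁; inj₂)
  open import Relation.Binary.PropositionalEquality
  open import Relation.Binary using (Tri; tri<; tri≈; tri>)
  open import Relation.Nullary using (Dec; yes; no; ¬_)
  open import Tactic.RingSolver using (solve-∀)
  open import Defs using (expTerm; expNegOneApprox)
  open RationalFacts
  open Indicators

  infix 8 _↓_

  _↓_ : ℕ → ℕ → ℕ
  L ↓ zero  = 1
  L ↓ suc r = L ℕ.* ((L ∸ 1) ↓ r)

  ↓-+ : ∀ L a t → L ↓ (a ℕ.+ t) ≡ L ↓ a ℕ.* (L ∸ a) ↓ t
  ↓-+ L zero    t = sym (ℕₚ.+-identityʳ (L ↓ t))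
  ↓-+ L (suc a) t = begin
    L ℕ.* (L ∸ 1) ↓ (a ℕ.+ t)                        ≡⟨ cong (L ℕ.*_) (↓-+ (L ∸ 1) a t) ⟩
    L ℕ.* ((L ∸ 1) ↓ a ℕ.* (L ∸ 1 ∸ a) ↓ t)          ≡⟨ ℕₚ.*-assoc L _ _ ⟨
    L ℕ.* (L ∸ 1) ↓ a ℕ.* (L ∸ 1 ∸ a) ↓ t            ≡⟨ cong (λ z → L ℕ.* (L ∸ 1) ↓ a ℕ.* z ↓ t) (ℕₚ.∸-+-assoc L 1 a) ⟩
    L ℕ.* (L ∸ 1) ↓ a ℕ.* (L ∸ suc a) ↓ t            ∎
    where open ≡-Reasoning

  n↓n≡n! : ∀ n → n ↓ n ≡ n !
  n↓n≡n! zero    = refl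
  n↓n≡n! (suc n) = cong (suc n ℕ.*_) (n↓n≡n! n)

  ↓-zero : ∀ L r → L ℕ.< r → L ↓ r ≡ 0
  ↓-zero zero    (suc r) _         = refl
  ↓-zero (suc L) (suc r) (s≤s L<r) = trans (cong (suc L ℕ.*_) (↓-zero L r L<r)) (ℕₚ.*-zeroʳ (suc L))

  ↓-pos : ∀ L r → r ℕ.≤ L → 0 ℕ.< L ↓ r
  ↓-pos L       zero    _         = s≤s z≤n
  ↓-pos (suc L) (suc r) (s≤s r≤L) = ℕₚ.*-mono-< {0} {suc L} {0} (s≤s z≤n) (↓-pos L r r≤L)

  ↓-suc : ∀ N T → N ↓ suc T ≡ N ↓ T ℕ.* (N ∸ T)
  ↓-suc N zero    = ℕₚ.*-comm N 1
  ↓-suc N (suc T) = begin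
    N ℕ.* (N ∸ 1) ↓ suc T                ≡⟨ cong (N ℕ.*_) (↓-suc (N ∸ 1) T) ⟩
    N ℕ.* ((N ∸ 1) ↓ T ℕ.* (N ∸ 1 ∸ T))  ≡⟨ ℕₚ.*-assoc N _ _ ⟨
    N ℕ.* (N ∸ 1) ↓ T ℕ.* (N ∸ 1 ∸ T)    ≡⟨ cong (N ℕ.* (N ∸ 1) ↓ T ℕ.*_) (ℕₚ.∸-+-assoc N 1 T) ⟩
    N ℕ.* (N ∸ 1) ↓ T ℕ.* (N ∸ suc T)    ∎
    where open ≡-Reasoning

  ↓-pascal : ∀ N T → suc N ↓ suc T ≡ suc T ℕ.* N ↓ T ℕ.+ N ↓ suc T
  ↓-pascal N T with ℕₚ.≤-<-connex T N
  ... | inj₁ T≤N = begin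
    suc N ℕ.* N ↓ T                              ≡⟨ cong (ℕ._* N ↓ T) (cong suc (ℕₚ.m+[n∸m]≡n T≤N)) ⟨
    (suc T ℕ.+ (N ∸ T)) ℕ.* N ↓ T                ≡⟨ ℕₚ.*-distribʳ-+ (N ↓ T) (suc T) (N ∸ T) ⟩
    suc T ℕ.* N ↓ T ℕ.+ (N ∸ T) ℕ.* N ↓ T        ≡⟨ cong (suc T ℕ.* N ↓ T ℕ.+_) (trans (ℕₚ.*-comm (N ∸ T) (N ↓ T)) (sym (↓-suc N T))) ⟩
    suc T ℕ.* N ↓ T ℕ.+ N ↓ suc T                ∎
    where open ≡-Reasoning
  ... | inj₂ N<T rewrite ↓-zero N T N<T | ↓-zero N (suc T) (ℕₚ.m<n⇒m<1+n N<T) | ℕₚ.*-zeroʳ (suc N) | ℕₚ.*-zeroʳ T = refl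

  invFact : ℕ → ℚ
  invFact r = recip (r !) {{r ℕₚ.!≢0}}

  invFact-nonNeg : ∀ r → 0ℚ ≤ invFact r
  invFact-nonNeg r = recip-nonNeg (r !) {{r ℕₚ.!≢0}}

  invFact≤1 : ∀ r → invFact r ≤ 1ℚ
  invFact≤1 r = recip≤1 (r !) {{r ℕₚ.!≢0}}

  invFact-suc : ∀ i → invFact (suc i) ≡ recip (suc i) * invFact i
  invFact-suc i = recip-* (suc i) (i !) {{_}} {{i ℕₚ.!≢0}} {{suc i ℕₚ.!≢0}}

  choose : ℕ → ℕ → ℚ
  choose L r = fromℕ (L ↓ r) * invFact r

  choose-nonNeg : ∀ L r → 0ℚ ≤ choose L r
  choose-nonNeg L r = nonNeg-* (fromℕ-nonNeg (L ↓ r)) (invFact-nonNeg r)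

  ∣expTerm∣≡invFact : ∀ i → ∣ expTerm i ∣ ≡ invFact i
  ∣expTerm∣≡invFact zero    = refl
  ∣expTerm∣≡invFact (suc i) = begin
    ∣ expTerm i * - recip (suc i) ∣        ≡⟨ ℚₚ.∣p*q∣≡∣p∣*∣q∣ (expTerm i) (- recip (suc i)) ⟩
    ∣ expTerm i ∣ * ∣ - recip (suc i) ∣    ≡⟨ cong₂ _*_ (∣expTerm∣≡invFact i) ∣-recip∣ ⟩
    invFact i * recip (suc i)              ≡⟨ ℚₚ.*-comm (invFact i) (recip (suc i)) ⟩
    recip (suc i) * invFact i              ≡⟨ invFact-suc i ⟨
    invFact (suc i)                        ∎
    where
    open ≡-Reasoning
    ∣-recip∣ : ∣ - recip (suc i) ∣ ≡ recip (suc i)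
    ∣-recip∣ = trans (ℚₚ.∣-p∣≡∣p∣ (recip (suc i))) (ℚₚ.0≤p⇒∣p∣≡p (recip-nonNeg (suc i)))

  expTerm-even-nonNeg : ∀ U → 0ℚ ≤ expTerm (U ℕ.+ U)
  expTerm-odd-nonPos  : ∀ U → expTerm (suc (U ℕ.+ U)) ≤ 0ℚ

  expTerm-even-nonNeg zero    = ℚₚ.nonNegative⁻¹ 1ℚ
  expTerm-even-nonNeg (suc U) rewrite ℕₚ.+-suc U U =
    subst (0ℚ ≤_) (sym (neg*neg (expTerm (U ℕ.+ U)) (recip (suc (U ℕ.+ U))) (recip (suc (suc (U ℕ.+ U))))))
      (nonNeg-* (expTerm-even-nonNeg U) (nonNeg-* (recip-nonNeg (suc (U ℕ.+ U))) (recip-nonNeg (suc (suc (U ℕ.+ U))))))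
    where
    neg*neg : ∀ a b c → a * - b * - c ≡ a * (b * c)
    neg*neg = solve-∀ ℚ-ring
  expTerm-odd-nonPos U =
    ≤-by-diff (expTerm (U ℕ.+ U) * recip (suc (U ℕ.+ U))) (nonNeg-* (expTerm-even-nonNeg U) (recip-nonNeg (suc (U ℕ.+ U))))
      (negate (expTerm (U ℕ.+ U)) (recip (suc (U ℕ.+ U))))
    where
    negate : ∀ a b → 0ℚ - a * - b ≡ a * b
    negate = solve-∀ ℚ-ring

  sumUpTo : ℕ → (ℕ → ℚ) → ℚ
  sumUpTo zero    g = g 0
  sumUpTo (suc T) g = sumUpTo T g + g (suc T)

  sumUpTo-cong : ∀ T {f g} → (∀ t → f t ≡ g t) → sumUpTo T f ≡ sumUpTo T g
  sumUpTo-cong zero    f≗g = f≗g 0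
  sumUpTo-cong (suc T) f≗g = cong₂ _+_ (sumUpTo-cong T f≗g) (f≗g (suc T))

  sumUpTo-*ˡ : ∀ T c g → sumUpTo T (λ t → c * g t) ≡ c * sumUpTo T g
  sumUpTo-*ˡ zero    c g = refl
  sumUpTo-*ˡ (suc T) c g =
    trans (cong (_+ c * g (suc T)) (sumUpTo-*ˡ T c g)) (sym (ℚₚ.*-distribˡ-+ c (sumUpTo T g) (g (suc T))))

  sumUpTo-*ʳ : ∀ T g c → sumUpTo T (λ t → g t * c) ≡ sumUpTo T g * c
  sumUpTo-*ʳ zero    g c = refl
  sumUpTo-*ʳ (suc T) g c =
    trans (cong (_+ g (suc T) * c) (sumUpTo-*ʳ T g c)) (sym (ℚₚ.*-distribʳ-+ c (sumUpTo T g) (g (suc T))))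

  sumUpTo-expTerm : ∀ T → sumUpTo T expTerm ≡ expNegOneApprox T
  sumUpTo-expTerm zero    = refl
  sumUpTo-expTerm (suc T) = cong (_+ expTerm (suc T)) (sumUpTo-expTerm T)

  alternatingSum : ℕ → ℕ → ℚ
  alternatingSum T N = sumUpTo T (λ t → expTerm t * fromℕ (N ↓ t))

  alternatingSum-zero : ∀ T → alternatingSum T 0 ≡ 1ℚ
  alternatingSum-zero zero    = refl
  alternatingSum-zero (suc T) =
    trans (cong₂ _+_ (alternatingSum-zero T) (ℚₚ.*-zeroʳ (expTerm (suc T)))) (ℚₚ.+-identityʳ 1ℚ)

  -- Pascal's rule makes the partial sums telescope.
  alternatingSum-suc : ∀ T N → alternatingSum T (suc N) ≡ expTerm T * fromℕ (N ↓ T)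
  alternatingSum-suc zero    N = refl
  alternatingSum-suc (suc T) N = begin
    alternatingSum T (suc N) + e' * fromℕ (suc N ↓ suc T)
      ≡⟨ cong₂ _+_ (alternatingSum-suc T N) (cong (λ z → e' * fromℕ z) (↓-pascal N T)) ⟩
    e * P + e' * fromℕ (suc T ℕ.* N ↓ T ℕ.+ N ↓ suc T)
      ≡⟨ cong (λ z → e * P + e' * z) (trans (fromℕ-+ (suc T ℕ.* N ↓ T) (N ↓ suc T)) (cong (_+ fromℕ (N ↓ suc T)) (fromℕ-* (suc T) (N ↓ T)))) ⟩
    e * P + e * - u * (w * P + fromℕ (N ↓ suc T))
      ≡⟨ telescope e P u w (fromℕ (N ↓ suc T)) ⟩
    e * P * (1ℚ - w * u) + e' * fromℕ (N ↓ suc T)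
      ≡⟨ cong (λ z → e * P * (1ℚ - z) + e' * fromℕ (N ↓ suc T)) (fromℕ*recip≡1 (suc T)) ⟩
    e * P * (1ℚ - 1ℚ) + e' * fromℕ (N ↓ suc T)
      ≡⟨ vanish (e * P) (e' * fromℕ (N ↓ suc T)) ⟩
    e' * fromℕ (N ↓ suc T) ∎
    where
    open ≡-Reasoning
    e e' P u w : ℚ
    e  = expTerm T
    e' = expTerm (suc T)
    P  = fromℕ (N ↓ T)
    u  = recip (suc T)
    w  = fromℕ (suc T)
    telescope : ∀ e P u w q → e * P + e * - u * (w * P + q) ≡ e * P * (1ℚ - w * u) + e * - u * q
    telescope = solve-∀ ℚ-ring
    vanish : ∀ a b → a * (1ℚ - 1ℚ) + b ≡ b
    vanish = solve-∀ ℚ-ring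

  [x+t]!≡[x+t]↓t*x! : ∀ x t → (x ℕ.+ t) ! ≡ (x ℕ.+ t) ↓ t ℕ.* x !
  [x+t]!≡[x+t]↓t*x! x t = begin
    (x ℕ.+ t) !                                 ≡⟨ n↓n≡n! (x ℕ.+ t) ⟨
    (x ℕ.+ t) ↓ (x ℕ.+ t)                       ≡⟨ cong ((x ℕ.+ t) ↓_) (ℕₚ.+-comm x t) ⟩
    (x ℕ.+ t) ↓ (t ℕ.+ x)                       ≡⟨ ↓-+ (x ℕ.+ t) t x ⟩
    (x ℕ.+ t) ↓ t ℕ.* (x ℕ.+ t ∸ t) ↓ x         ≡⟨ cong (λ z → (x ℕ.+ t) ↓ t ℕ.* z ↓ x) (ℕₚ.m+n∸n≡m x t) ⟩
    (x ℕ.+ t) ↓ t ℕ.* x ↓ x                     ≡⟨ cong ((x ℕ.+ t) ↓ t ℕ.*_) (n↓n≡n! x) ⟩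
    (x ℕ.+ t) ↓ t ℕ.* x !                       ∎
    where open ≡-Reasoning

  bonferroniCoeff : ℕ → ℕ → ℚ
  bonferroniCoeff x t = expTerm t * fromℕ ((x ℕ.+ t) ↓ t)

  bonferroniSum : ℕ → ℕ → ℕ → ℚ
  bonferroniSum x T L = sumUpTo T (λ t → bonferroniCoeff x t * choose L (x ℕ.+ t))

  module _ (x t : ℕ) where
    private
      f : ℕ
      f = (x ℕ.+ t) ↓ t
      instance
        f≢0 : ℕ.NonZero f
        f≢0 = ℕ.>-nonZero (↓-pos (x ℕ.+ t) t (ℕₚ.m≤n+m t x))

      invFact-split : invFact (x ℕ.+ t) ≡ recip f * invFact x
      invFact-split = trans (recip-cong {{(x ℕ.+ t) ℕₚ.!≢0}} {{ℕₚ.m*n≢0 f (x !) {{f≢0}} {{x ℕₚ.!≢0}}}} ([x+t]!≡[x+t]↓t*x! x t))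
        (recip-* f (x !) {{f≢0}} {{x ℕₚ.!≢0}} {{ℕₚ.m*n≢0 f (x !) {{f≢0}} {{x ℕₚ.!≢0}}}})

    bonferroniCoeff*invFact : bonferroniCoeff x t * invFact (x ℕ.+ t) ≡ expTerm t * invFact x
    bonferroniCoeff*invFact = begin
      expTerm t * fromℕ f * invFact (x ℕ.+ t)        ≡⟨ cong (expTerm t * fromℕ f *_) invFact-split ⟩
      expTerm t * fromℕ f * (recip f * invFact x)    ≡⟨ regroup (expTerm t) (fromℕ f) (recip f) (invFact x) ⟩
      fromℕ f * recip f * (expTerm t * invFact x)    ≡⟨ cong (_* (expTerm t * invFact x)) (fromℕ*recip≡1 f) ⟩
      1ℚ * (expTerm t * invFact x)                   ≡⟨ ℚₚ.*-identityˡ _ ⟩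
      expTerm t * invFact x                          ∎
      where
      open ≡-Reasoning
      regroup : ∀ e a u v → e * a * (u * v) ≡ a * u * (e * v)
      regroup = solve-∀ ℚ-ring

    bonferroniTerm≡ : ∀ L → bonferroniCoeff x t * choose L (x ℕ.+ t) ≡ choose L x * (expTerm t * fromℕ ((L ∸ x) ↓ t))
    bonferroniTerm≡ L = begin
      e * fromℕ f * (fromℕ (L ↓ (x ℕ.+ t)) * invFact (x ℕ.+ t))
        ≡⟨ cong₂ (λ a b → e * fromℕ f * (fromℕ a * b)) (↓-+ L x t) invFact-split ⟩
      e * fromℕ f * (fromℕ (L ↓ x ℕ.* g) * (recip f * invFact x))
        ≡⟨ cong (λ z → e * fromℕ f * (z * (recip f * invFact x))) (fromℕ-* (L ↓ x) g) ⟩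
      e * fromℕ f * (fromℕ (L ↓ x) * fromℕ g * (recip f * invFact x))
        ≡⟨ regroup e (fromℕ f) (fromℕ (L ↓ x)) (fromℕ g) (recip f) (invFact x) ⟩
      fromℕ f * recip f * (choose L x * (e * fromℕ g))
        ≡⟨ cong (_* (choose L x * (e * fromℕ g))) (fromℕ*recip≡1 f) ⟩
      1ℚ * (choose L x * (e * fromℕ g))
        ≡⟨ ℚₚ.*-identityˡ _ ⟩
      choose L x * (e * fromℕ g) ∎
      where
      open ≡-Reasoning
      e : ℚ
      e = expTerm t
      g : ℕ
      g = (L ∸ x) ↓ t
      regroup : ∀ e a b c u v → e * a * (b * c * (u * v)) ≡ a * u * ((b * v) * (e * c))
      regroup = solve-∀ ℚ-ring

  ∣bonferroniCoeff∣≤ : ∀ x t → ∣ bonferroniCoeff x t ∣ ≤ fromℕ ((x ℕ.+ t) ↓ t)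
  ∣bonferroniCoeff∣≤ x t = begin
    ∣ expTerm t * fromℕ f ∣          ≡⟨ ℚₚ.∣p*q∣≡∣p∣*∣q∣ (expTerm t) (fromℕ f) ⟩
    ∣ expTerm t ∣ * ∣ fromℕ f ∣      ≡⟨ cong₂ _*_ (∣expTerm∣≡invFact t) (ℚₚ.0≤p⇒∣p∣≡p (fromℕ-nonNeg f)) ⟩
    invFact t * fromℕ f              ≤⟨ *-monoʳ-≤-nonNeg (fromℕ-nonNeg f) (invFact≤1 t) ⟩
    1ℚ * fromℕ f                     ≡⟨ ℚₚ.*-identityˡ (fromℕ f) ⟩
    fromℕ f                          ∎
    where
    open ℚₚ.≤-Reasoning
    f : ℕ
    f = (x ℕ.+ t) ↓ t

  bonferroniSum≡ : ∀ x T L → bonferroniSum x T L ≡ choose L x * alternatingSum T (L ∸ x)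
  bonferroniSum≡ x T L = trans (sumUpTo-cong T (λ t → bonferroniTerm≡ x t L))
    (sumUpTo-*ˡ T (choose L x) (λ t → expTerm t * fromℕ ((L ∸ x) ↓ t)))

  bonferroniSum-self : ∀ x T → bonferroniSum x T x ≡ 1ℚ
  bonferroniSum-self x T = begin
    bonferroniSum x T x                              ≡⟨ bonferroniSum≡ x T x ⟩
    fromℕ (x ↓ x) * invFact x * alternatingSum T (x ∸ x)
      ≡⟨ cong₂ (λ a b → fromℕ a * invFact x * alternatingSum T b) (n↓n≡n! x) (ℕₚ.n∸n≡0 x) ⟩
    fromℕ (x !) * invFact x * alternatingSum T 0     ≡⟨ cong₂ _*_ (fromℕ*recip≡1 (x !) {{x ℕₚ.!≢0}}) (alternatingSum-zero T) ⟩
    1ℚ                                               ∎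
    where open ≡-Reasoning

  bonferroniSum-below : ∀ x T L → L ℕ.< x → bonferroniSum x T L ≡ 0ℚ
  bonferroniSum-below x T L L<x = begin
    bonferroniSum x T L                        ≡⟨ bonferroniSum≡ x T L ⟩
    fromℕ (L ↓ x) * invFact x * A              ≡⟨ cong (λ z → fromℕ z * invFact x * A) (↓-zero L x L<x) ⟩
    fromℕ 0 * invFact x * A                    ≡⟨ cong (λ z → z * invFact x * A) fromℕ0≡0ℚ ⟩
    0ℚ * invFact x * A                         ≡⟨ cong (_* A) (ℚₚ.*-zeroˡ (invFact x)) ⟩
    0ℚ * A                                     ≡⟨ ℚₚ.*-zeroˡ A ⟩
    0ℚ                                         ∎
    where
    open ≡-Reasoning
    A : ℚ
    A = alternatingSum T (L ∸ x)
    fromℕ0≡0ℚ : fromℕ 0 ≡ 0ℚ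
    fromℕ0≡0ℚ = refl

  bonferroniSum-above : ∀ x T L → x ℕ.< L → bonferroniSum x T L ≡ choose L x * (expTerm T * fromℕ ((L ∸ suc x) ↓ T))
  bonferroniSum-above x T L x<L = trans (bonferroniSum≡ x T L)
    (cong (choose L x *_) (trans (cong (alternatingSum T) (L∸x≡suc x<L)) (alternatingSum-suc T (L ∸ suc x))))
    where
    L∸x≡suc : ∀ {x L} → x ℕ.< L → L ∸ x ≡ suc (L ∸ suc x)
    L∸x≡suc {zero}  {suc L} _         = refl
    L∸x≡suc {suc x} {suc L} (s≤s x<L) = L∸x≡suc x<L

  fromℕ-χ-yes : ∀ {P : Set} → P → (d : Dec P) → fromℕ (χ d) ≡ 1ℚ
  fromℕ-χ-yes p d = cong fromℕ (χ-yes p d)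

  fromℕ-χ-no : ∀ {P : Set} → ¬ P → (d : Dec P) → fromℕ (χ d) ≡ 0ℚ
  fromℕ-χ-no ¬p d = cong fromℕ (χ-no ¬p d)

  χ≤bonferroniSum-even : ∀ x U L → fromℕ (χ (L ℕ.≟ x)) ≤ bonferroniSum x (U ℕ.+ U) L
  χ≤bonferroniSum-even x U L = byCases (ℕₚ.<-cmp L x)
    where
    T : ℕ
    T = U ℕ.+ U
    byCases : Tri (L ℕ.< x) (L ≡ x) (x ℕ.< L) → fromℕ (χ (L ℕ.≟ x)) ≤ bonferroniSum x T L
    byCases (tri< L<x L≢x _) = subst₂ _≤_ (sym (fromℕ-χ-no L≢x (L ℕ.≟ x))) (sym (bonferroniSum-below x T L L<x)) ℚₚ.≤-refl
    byCases (tri≈ _ refl _)  = subst₂ _≤_ (sym (fromℕ-χ-yes refl (L ℕ.≟ L))) (sym (bonferroniSum-self L T)) ℚₚ.≤-refl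
    byCases (tri> _ L≢x x<L) = subst₂ _≤_ (sym (fromℕ-χ-no L≢x (L ℕ.≟ x))) (sym (bonferroniSum-above x T L x<L))
      (nonNeg-* {choose L x} {expTerm T * fromℕ ((L ∸ suc x) ↓ T)} (choose-nonNeg L x)
        (nonNeg-* {expTerm T} {fromℕ ((L ∸ suc x) ↓ T)} (expTerm-even-nonNeg U) (fromℕ-nonNeg ((L ∸ suc x) ↓ T))))

  bonferroniSum-odd≤χ : ∀ x U L → bonferroniSum x (suc (U ℕ.+ U)) L ≤ fromℕ (χ (L ℕ.≟ x))
  bonferroniSum-odd≤χ x U L = byCases (ℕₚ.<-cmp L x)
    where
    T : ℕ
    T = suc (U ℕ.+ U)
    byCases : Tri (L ℕ.< x) (L ≡ x) (x ℕ.< L) → bonferroniSum x T L ≤ fromℕ (χ (L ℕ.≟ x))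
    byCases (tri< L<x L≢x _) = subst₂ _≤_ (sym (bonferroniSum-below x T L L<x)) (sym (fromℕ-χ-no L≢x (L ℕ.≟ x))) ℚₚ.≤-refl
    byCases (tri≈ _ refl _)  = subst₂ _≤_ (sym (bonferroniSum-self L T)) (sym (fromℕ-χ-yes refl (L ℕ.≟ L))) ℚₚ.≤-refl
    byCases (tri> _ L≢x x<L) = subst₂ _≤_ (sym (bonferroniSum-above x T L x<L)) (sym (fromℕ-χ-no L≢x (L ℕ.≟ x)))
      (nonNeg*[nonPos*nonNeg]≤0 (choose L x) (expTerm T) (fromℕ ((L ∸ suc x) ↓ T))
        (choose-nonNeg L x) (expTerm-odd-nonPos U) (fromℕ-nonNeg ((L ∸ suc x) ↓ T)))


module AlternatingExponentialSeries where

  open import Data.Nat as ℕ using (ℕ; zero; suc; _!; _∸_; z≤n; s≤s)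
  import Data.Nat.Properties as ℕₚ
  open import Data.Rational as ℚ using (ℚ; _+_; _*_; _-_; -_; ∣_∣; _≤_; _<_; 0ℚ; 1ℚ)
  import Data.Rational.Properties as ℚₚ
  open import Data.Product using (∃-syntax; _,_)
  open import Data.Sum using (inj₁; inj₂)
  open import Relation.Binary.PropositionalEquality
  open import Tactic.RingSolver using (solve-∀)
  open import Defs using (expTerm; expNegOneApprox)
  open RationalFacts
  open BonferroniInequalities

  invFact-halves : ∀ m → 1 ℕ.≤ m → invFact (suc m) + invFact (suc m) ≤ invFact m
  invFact-halves m 1≤m = begin
    invFact (suc m) + invFact (suc m)        ≡⟨ cong (λ z → z + z) (invFact-suc m) ⟩
    recip (suc m) * invFact m + recip (suc m) * invFact m
                                             ≡⟨ ℚₚ.*-distribʳ-+ (invFact m) (recip (suc m)) (recip (suc m)) ⟨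
    (recip (suc m) + recip (suc m)) * invFact m
                                             ≤⟨ *-monoʳ-≤-nonNeg (invFact-nonNeg m) 2/[1+m]≤1 ⟩
    1ℚ * invFact m                           ≡⟨ ℚₚ.*-identityˡ (invFact m) ⟩
    invFact m                                ∎
    where
    open ℚₚ.≤-Reasoning
    2/[1+m]≤1 : recip (suc m) + recip (suc m) ≤ 1ℚ
    2/[1+m]≤1 = begin
      recip (suc m) + recip (suc m)  ≤⟨ ℚₚ.+-mono-≤ (recip-antimono-≤ 2 (suc m) (s≤s 1≤m)) (recip-antimono-≤ 2 (suc m) (s≤s 1≤m)) ⟩
      recip 2 + recip 2              ≡⟨⟩
      1ℚ                             ∎

  -- The terms alternate in sign and at least halve in size, so every partial tail is dominated by its first term.
  ∣s[t+k]-s[t]∣≤ : ∀ t k → 1 ℕ.≤ t → ∣ expNegOneApprox (t ℕ.+ k) - expNegOneApprox t ∣ ≤ invFact t - invFact (t ℕ.+ k)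
  ∣s[t+k]-s[t]∣≤ t zero 1≤t rewrite ℕₚ.+-identityʳ t =
    subst₂ _≤_ (cong ∣_∣ (sym (ℚₚ.+-inverseʳ (expNegOneApprox t)))) (sym (ℚₚ.+-inverseʳ (invFact t))) ℚₚ.≤-refl
  ∣s[t+k]-s[t]∣≤ t (suc k) 1≤t rewrite ℕₚ.+-suc t k = begin
    ∣ s m + expTerm (suc m) - s t ∣              ≡⟨ cong ∣_∣ (swap (s m) (s t) (expTerm (suc m))) ⟩
    ∣ (s m - s t) + expTerm (suc m) ∣            ≤⟨ ℚₚ.∣p+q∣≤∣p∣+∣q∣ (s m - s t) (expTerm (suc m)) ⟩
    ∣ s m - s t ∣ + ∣ expTerm (suc m) ∣          ≤⟨ ℚₚ.+-mono-≤ (∣s[t+k]-s[t]∣≤ t k 1≤t) (ℚₚ.≤-reflexive (∣expTerm∣≡invFact (suc m))) ⟩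
    invFact t - invFact m + invFact (suc m)      ≤⟨ ≤-by-diff _ (≤⇒0≤diff (invFact-halves m (ℕₚ.≤-trans 1≤t (ℕₚ.m≤m+n t k))))
                                                      (rearrange (invFact t) (invFact m) (invFact (suc m))) ⟩
    invFact t - invFact (suc m)                  ∎
    where
    open ℚₚ.≤-Reasoning
    s : ℕ → ℚ
    s = expNegOneApprox
    m : ℕ
    m = t ℕ.+ k
    swap : ∀ a b c → a + c - b ≡ (a - b) + c
    swap = solve-∀ ℚ-ring
    rearrange : ∀ a b c → a - c - (a - b + c) ≡ b - (c + c)
    rearrange = solve-∀ ℚ-ring

  ∣s[t+k]-s[t]∣≤invFact : ∀ t k → 1 ℕ.≤ t → ∣ expNegOneApprox (t ℕ.+ k) - expNegOneApprox t ∣ ≤ invFact t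
  ∣s[t+k]-s[t]∣≤invFact t k 1≤t = ℚₚ.≤-trans (∣s[t+k]-s[t]∣≤ t k 1≤t)
    (≤-by-diff (invFact (t ℕ.+ k)) (invFact-nonNeg (t ℕ.+ k)) (cancel (invFact t) (invFact (t ℕ.+ k))))
    where
    cancel : ∀ a b → a - (a - b) ≡ b
    cancel = solve-∀ ℚ-ring

  expNegOneApprox-cauchy : ∀ η → 0ℚ < η → ∃[ T₀ ] (∀ t m → T₀ ℕ.≤ t → T₀ ℕ.≤ m → ∣ expNegOneApprox t - expNegOneApprox m ∣ ≤ η)
  expNegOneApprox-cauchy η 0<η with archimedean η 0<η
  ... | q , 1/[1+q]≤η = suc q , close
    where
    s : ℕ → ℚ
    s = expNegOneApprox
    tail≤η : ∀ t k → suc q ℕ.≤ t → ∣ s (t ℕ.+ k) - s t ∣ ≤ η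
    tail≤η t k q<t = ℚₚ.≤-trans (∣s[t+k]-s[t]∣≤invFact t k (ℕₚ.≤-trans (s≤s z≤n) q<t))
      (ℚₚ.≤-trans (recip-antimono-≤ (suc q) (t !) {{_}} {{t ℕₚ.!≢0}} (ℕₚ.≤-trans q<t (n≤n! t))) 1/[1+q]≤η)
      where
      n≤n! : ∀ n → n ℕ.≤ n !
      n≤n! zero    = z≤n
      n≤n! (suc n) = subst (ℕ._≤ suc n ℕ.* n !) (ℕₚ.*-identityʳ (suc n)) (ℕₚ.*-monoʳ-≤ (suc n) (ℕₚ.1≤n! n))
    close : ∀ t m → suc q ℕ.≤ t → suc q ℕ.≤ m → ∣ s t - s m ∣ ≤ η
    close t m q<t q<m with ℕₚ.≤-total t m
    ... | inj₁ t≤m rewrite sym (ℕₚ.m+[n∸m]≡n t≤m) =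
      subst (_≤ η) (∣p-q∣≡∣q-p∣ (s (t ℕ.+ (m ∸ t))) (s t)) (tail≤η t (m ∸ t) q<t)
    ... | inj₂ m≤t rewrite sym (ℕₚ.m+[n∸m]≡n m≤t) = tail≤η m (t ∸ m) q<m

  ∣expNegOneApprox∣≤1 : ∀ m → ∣ expNegOneApprox m ∣ ≤ 1ℚ
  ∣expNegOneApprox∣≤1 zero    = ℚₚ.≤-refl
  ∣expNegOneApprox∣≤1 (suc m) = subst (_≤ 1ℚ) (cong ∣_∣ (ℚₚ.+-identityʳ (expNegOneApprox (suc m)))) (∣s[t+k]-s[t]∣≤invFact 1 m (s≤s z≤n))


module FiniteExpectations where

  open import Data.Nat as ℕ using (ℕ; zero; suc; _⊔_)
  import Data.Nat.Properties as ℕₚ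
  open import Data.Rational as ℚ using (ℚ; _+_; _*_; _-_; -_; ∣_∣; _≤_; _<_; 0ℚ)
  import Data.Rational.Properties as ℚₚ
  open import Data.List using (List; []; _∷_; length)
  open import Data.Product using (∃-syntax; _×_; _,_; proj₁; proj₂)
  open import Relation.Binary.PropositionalEquality
  open import Tactic.RingSolver using (solve-∀)
  open RationalFacts
  open BonferroniInequalities using (sumUpTo)

  sumℚ : ∀ {A : Set} → List A → (A → ℚ) → ℚ
  sumℚ []       f = 0ℚ
  sumℚ (x ∷ xs) f = f x + sumℚ xs f

  module _ {A : Set} where

    sumℚ-cong : ∀ (xs : List A) {f g} → (∀ x → f x ≡ g x) → sumℚ xs f ≡ sumℚ xs g
    sumℚ-cong []       f≗g = refl
    sumℚ-cong (x ∷ xs) f≗g = cong₂ _+_ (f≗g x) (sumℚ-cong xs f≗g)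

    sumℚ-+ : ∀ (xs : List A) f g → sumℚ xs (λ x → f x + g x) ≡ sumℚ xs f + sumℚ xs g
    sumℚ-+ []       f g = refl
    sumℚ-+ (x ∷ xs) f g = trans (cong (f x + g x +_) (sumℚ-+ xs f g)) (interchange (f x) (g x) (sumℚ xs f) (sumℚ xs g))
      where
      interchange : ∀ a b c d → a + b + (c + d) ≡ a + c + (b + d)
      interchange = solve-∀ ℚ-ring

    sumℚ-*ˡ : ∀ (xs : List A) c f → sumℚ xs (λ x → c * f x) ≡ c * sumℚ xs f
    sumℚ-*ˡ []       c f = sym (ℚₚ.*-zeroʳ c)
    sumℚ-*ˡ (x ∷ xs) c f = trans (cong (c * f x +_) (sumℚ-*ˡ xs c f)) (sym (ℚₚ.*-distribˡ-+ c (f x) (sumℚ xs f)))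

    sumℚ-mono-≤ : ∀ (xs : List A) {f g} → (∀ x → f x ≤ g x) → sumℚ xs f ≤ sumℚ xs g
    sumℚ-mono-≤ []       f≤g = ℚₚ.≤-refl
    sumℚ-mono-≤ (x ∷ xs) f≤g = ℚₚ.+-mono-≤ (f≤g x) (sumℚ-mono-≤ xs f≤g)

  module Expectations {Ω : ℕ → Set} (space : (n : ℕ) → List (Ω n)) where

    Observable : Set
    Observable = (n : ℕ) → Ω n → ℚ

    total : Observable → ℕ → ℚ
    total F n = sumℚ (space n) (F n)

    size : ℕ → ℚ
    size n = fromℕ (length (space n))

    -- The statement "E_n[F] = τ_m up to δ, for all large n and m", multiplied out by the size of the n-th space.
    record ExpectationWithin (δ : ℚ) (F : Observable) (τ : ℕ → ℚ) : Set where
      constructor within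
      field
        threshold : ℕ
        bound     : ∀ n m → threshold ℕ.≤ n → threshold ℕ.≤ m → ∣ total F n - size n * τ m ∣ ≤ δ * size n

    ExpectationTendsTo : Observable → (ℕ → ℚ) → Set
    ExpectationTendsTo F τ = ∀ δ → 0ℚ < δ → ExpectationWithin δ F τ

    private
      size-nonNeg : ∀ n → 0ℚ ≤ size n
      size-nonNeg n = fromℕ-nonNeg (length (space n))

      ⊔≤⇒ˡ : ∀ {a b c} → a ⊔ b ℕ.≤ c → a ℕ.≤ c
      ⊔≤⇒ˡ {a} {b} = ℕₚ.≤-trans (ℕₚ.m≤m⊔n a b)

      ⊔≤⇒ʳ : ∀ {a b c} → a ⊔ b ℕ.≤ c → b ℕ.≤ c
      ⊔≤⇒ʳ {a} {b} = ℕₚ.≤-trans (ℕₚ.m≤n⊔m a b)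

    within-+ : ∀ {F G τ σ δ₁ δ₂} → ExpectationWithin δ₁ F τ → ExpectationWithin δ₂ G σ →
               ExpectationWithin (δ₁ + δ₂) (λ n ω → F n ω + G n ω) (λ m → τ m + σ m)
    within-+ {F} {G} {τ} {σ} {δ₁} {δ₂} (within N₁ F≈τ) (within N₂ G≈σ) = within (N₁ ⊔ N₂) λ n m N≤n N≤m → begin
      ∣ total (λ n ω → F n ω + G n ω) n - size n * (τ m + σ m) ∣
        ≡⟨ cong (λ z → ∣ z - size n * (τ m + σ m) ∣) (sumℚ-+ (space n) (F n) (G n)) ⟩
      ∣ total F n + total G n - size n * (τ m + σ m) ∣
        ≡⟨ cong ∣_∣ (regroup (total F n) (total G n) (size n) (τ m) (σ m)) ⟩
      ∣ (total F n - size n * τ m) + (total G n - size n * σ m) ∣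
        ≤⟨ ℚₚ.∣p+q∣≤∣p∣+∣q∣ (total F n - size n * τ m) (total G n - size n * σ m) ⟩
      ∣ total F n - size n * τ m ∣ + ∣ total G n - size n * σ m ∣
        ≤⟨ ℚₚ.+-mono-≤ (F≈τ n m (⊔≤⇒ˡ N≤n) (⊔≤⇒ˡ N≤m)) (G≈σ n m (⊔≤⇒ʳ N≤n) (⊔≤⇒ʳ N≤m)) ⟩
      δ₁ * size n + δ₂ * size n
        ≡⟨ ℚₚ.*-distribʳ-+ (size n) δ₁ δ₂ ⟨
      (δ₁ + δ₂) * size n ∎
      where
      open ℚₚ.≤-Reasoning
      regroup : ∀ a b d t s → a + b - d * (t + s) ≡ (a - d * t) + (b - d * s)
      regroup = solve-∀ ℚ-ring

    within-scale : ∀ {F τ δ} c → ExpectationWithin δ F τ → ExpectationWithin (∣ c ∣ * δ) (λ n ω → c * F n ω) (λ m → c * τ m)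
    within-scale {F} {τ} {δ} c (within N F≈τ) = within N λ n m N≤n N≤m → begin
      ∣ total (λ n ω → c * F n ω) n - size n * (c * τ m) ∣
        ≡⟨ cong (λ z → ∣ z - size n * (c * τ m) ∣) (sumℚ-*ˡ (space n) c (F n)) ⟩
      ∣ c * total F n - size n * (c * τ m) ∣
        ≡⟨ cong ∣_∣ (factor (total F n) (size n) c (τ m)) ⟩
      ∣ c * (total F n - size n * τ m) ∣
        ≡⟨ ℚₚ.∣p*q∣≡∣p∣*∣q∣ c (total F n - size n * τ m) ⟩
      ∣ c ∣ * ∣ total F n - size n * τ m ∣
        ≤⟨ *-monoˡ-≤-nonNeg (ℚₚ.0≤∣p∣ c) (F≈τ n m N≤n N≤m) ⟩
      ∣ c ∣ * (δ * size n)
        ≡⟨ ℚₚ.*-assoc ∣ c ∣ δ (size n) ⟨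
      ∣ c ∣ * δ * size n ∎
      where
      open ℚₚ.≤-Reasoning
      factor : ∀ a d c t → c * a - d * (c * t) ≡ c * (a - d * t)
      factor = solve-∀ ℚ-ring

    within-weaken : ∀ {F τ δ δ′} → δ ≤ δ′ → ExpectationWithin δ F τ → ExpectationWithin δ′ F τ
    within-weaken δ≤δ′ (within N F≈τ) = within N λ n m N≤n N≤m →
      ℚₚ.≤-trans (F≈τ n m N≤n N≤m) (*-monoʳ-≤-nonNeg (size-nonNeg n) δ≤δ′)

    within-retarget : ∀ {F τ ρ δ η} → ExpectationWithin δ F τ → ∃[ N ] (∀ m → N ℕ.≤ m → ∣ τ m - ρ m ∣ ≤ η) →
                      ExpectationWithin (δ + η) F ρ
    within-retarget {F} {τ} {ρ} {δ} {η} (within N F≈τ) (N′ , τ≈ρ) = within (N ⊔ N′) λ n m N≤n N≤m → begin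
      ∣ total F n - size n * ρ m ∣
        ≡⟨ cong ∣_∣ (regroup (total F n) (size n) (τ m) (ρ m)) ⟩
      ∣ (total F n - size n * τ m) + size n * (τ m - ρ m) ∣
        ≤⟨ ℚₚ.∣p+q∣≤∣p∣+∣q∣ (total F n - size n * τ m) (size n * (τ m - ρ m)) ⟩
      ∣ total F n - size n * τ m ∣ + ∣ size n * (τ m - ρ m) ∣
        ≡⟨ cong (∣ total F n - size n * τ m ∣ +_)
                (trans (ℚₚ.∣p*q∣≡∣p∣*∣q∣ (size n) (τ m - ρ m)) (cong (_* ∣ τ m - ρ m ∣) (ℚₚ.0≤p⇒∣p∣≡p (size-nonNeg n)))) ⟩
      ∣ total F n - size n * τ m ∣ + size n * ∣ τ m - ρ m ∣
        ≤⟨ ℚₚ.+-mono-≤ (F≈τ n m (⊔≤⇒ˡ N≤n) (⊔≤⇒ˡ N≤m)) (*-monoˡ-≤-nonNeg (size-nonNeg n) (τ≈ρ m (⊔≤⇒ʳ N≤m))) ⟩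
      δ * size n + size n * η
        ≡⟨ collect δ η (size n) ⟩
      (δ + η) * size n ∎
      where
      open ℚₚ.≤-Reasoning
      regroup : ∀ a d t r → a - d * r ≡ (a - d * t) + d * (t - r)
      regroup = solve-∀ ℚ-ring
      collect : ∀ δ η d → δ * d + d * η ≡ (δ + η) * d
      collect = solve-∀ ℚ-ring

    within-sandwich : ∀ {Lo Hi F ρ δ} → ExpectationWithin δ Lo ρ → ExpectationWithin δ Hi ρ →
                      (∀ n ω → Lo n ω ≤ F n ω) → (∀ n ω → F n ω ≤ Hi n ω) → ExpectationWithin δ F ρ
    within-sandwich {Lo} {Hi} {F} {ρ} {δ} (within N₁ Lo≈ρ) (within N₂ Hi≈ρ) Lo≤F F≤Hi = within (N₁ ⊔ N₂) λ n m N≤n N≤m →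
      -b≤p≤b⇒∣p∣≤b
        (ℚₚ.≤-trans (proj₁ (∣p∣≤b⇒-b≤p≤b (Lo≈ρ n m (⊔≤⇒ˡ N≤n) (⊔≤⇒ˡ N≤m))))
                    (ℚₚ.+-monoˡ-≤ (- (size n * ρ m)) (sumℚ-mono-≤ (space n) (Lo≤F n))))
        (ℚₚ.≤-trans (ℚₚ.+-monoˡ-≤ (- (size n * ρ m)) (sumℚ-mono-≤ (space n) (F≤Hi n)))
                    (proj₂ (∣p∣≤b⇒-b≤p≤b (Hi≈ρ n m (⊔≤⇒ʳ N≤n) (⊔≤⇒ʳ N≤m)))))

    tendsTo-+ : ∀ {F G τ σ} → ExpectationTendsTo F τ → ExpectationTendsTo G σ →
                ExpectationTendsTo (λ n ω → F n ω + G n ω) (λ m → τ m + σ m)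
    tendsTo-+ {F} {G} {τ} {σ} F→τ G→σ δ 0<δ = split (halve δ 0<δ)
      where
      split : ∃[ δ′ ] (0ℚ < δ′) × (δ′ + δ′ ≤ δ) → ExpectationWithin δ (λ n ω → F n ω + G n ω) (λ m → τ m + σ m)
      split (δ′ , 0<δ′ , 2δ′≤δ) =
        within-weaken {δ = δ′ + δ′} 2δ′≤δ (within-+ {δ₁ = δ′} {δ₂ = δ′} (F→τ δ′ 0<δ′) (G→σ δ′ 0<δ′))

    tendsTo-scale : ∀ {F τ} c K → ∣ c ∣ ≤ fromℕ K → ExpectationTendsTo F τ →
                    ExpectationTendsTo (λ n ω → c * F n ω) (λ m → c * τ m)
    tendsTo-scale {F} {τ} c K ∣c∣≤K F→τ δ 0<δ = scaled (shrink δ 0<δ K)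
      where
      scaled : ∃[ δ′ ] (0ℚ < δ′) × (fromℕ K * δ′ ≤ δ) → ExpectationWithin δ (λ n ω → c * F n ω) (λ m → c * τ m)
      scaled (δ′ , 0<δ′ , Kδ′≤δ) =
        within-weaken {δ = ∣ c ∣ * δ′} (ℚₚ.≤-trans (*-monoʳ-≤-nonNeg {∣ c ∣} {fromℕ K} {δ′} (ℚₚ.<⇒≤ 0<δ′) ∣c∣≤K) Kδ′≤δ)
          (within-scale {δ = δ′} c (F→τ δ′ 0<δ′))

    tendsTo-cong : ∀ {F G τ ρ} → (∀ n ω → F n ω ≡ G n ω) → (∀ m → τ m ≡ ρ m) →
                   ExpectationTendsTo F τ → ExpectationTendsTo G ρ
    tendsTo-cong {F} {G} {τ} {ρ} F≗G τ≗ρ F→τ δ 0<δ = within N λ n m N≤n N≤m →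
      subst₂ (λ a b → ∣ a - size n * b ∣ ≤ δ * size n) (sumℚ-cong (space n) (F≗G n)) (τ≗ρ m) (bound n m N≤n N≤m)
      where open ExpectationWithin (F→τ δ 0<δ) renaming (threshold to N)

    tendsTo-sumUpTo : ∀ {F : ℕ → Observable} {τ : ℕ → ℕ → ℚ} T → (∀ t → ExpectationTendsTo (F t) (τ t)) →
                      ExpectationTendsTo (λ n ω → sumUpTo T (λ t → F t n ω)) (λ m → sumUpTo T (λ t → τ t m))
    tendsTo-sumUpTo zero    F→τ = F→τ 0
    tendsTo-sumUpTo (suc T) F→τ = tendsTo-+ (tendsTo-sumUpTo T F→τ) (F→τ (suc T))


module MethodOfMoments where

  open import Data.Nat as ℕ using (ℕ; zero; suc)
  import Data.Nat.Properties as ℕₚ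
  open import Data.Fin as Fin using (Fin)
  open import Data.Rational as ℚ using (ℚ; _+_; _*_; _-_; -_; ∣_∣; _≤_; _<_; 0ℚ; 1ℚ)
  import Data.Rational.Properties as ℚₚ
  open import Data.List using (List)
  open import Data.Product using (∃-syntax; _×_; _,_)
  open import Function using (_∘_)
  open import Data.Vec.Functional using (_∷_)
  open import Relation.Binary.PropositionalEquality
  open import Tactic.RingSolver using (solve-∀)
  open import Defs using (expTerm; expNegOneApprox; poissonApprox; prodFin)
  open RationalFacts
  open Indicators
  open BonferroniInequalities
  open AlternatingExponentialSeries
  open FiniteExpectations

  prodFin-nonNeg : ∀ K (f : Fin K → ℚ) → (∀ j → 0ℚ ≤ f j) → 0ℚ ≤ prodFin K f
  prodFin-nonNeg zero    f f≥0 = ℚₚ.nonNegative⁻¹ 1ℚ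
  prodFin-nonNeg (suc K) f f≥0 = nonNeg-* {f Fin.zero} {prodFin K (f ∘ Fin.suc)} (f≥0 Fin.zero) (prodFin-nonNeg K (f ∘ Fin.suc) (f≥0 ∘ Fin.suc))

  ∣prodFin∣≤1 : ∀ K (f : Fin K → ℚ) → (∀ j → ∣ f j ∣ ≤ 1ℚ) → ∣ prodFin K f ∣ ≤ 1ℚ
  ∣prodFin∣≤1 zero    f ∣f∣≤1 = ℚₚ.≤-refl
  ∣prodFin∣≤1 (suc K) f ∣f∣≤1 = ∣p*q∣≤1 (f Fin.zero) (prodFin K (f ∘ Fin.suc)) (∣f∣≤1 Fin.zero) (∣prodFin∣≤1 K (f ∘ Fin.suc) (∣f∣≤1 ∘ Fin.suc))

  ∣invFact∣≤1 : ∀ r → ∣ invFact r ∣ ≤ 1ℚ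
  ∣invFact∣≤1 r = subst (_≤ 1ℚ) (sym (ℚₚ.0≤p⇒∣p∣≡p (invFact-nonNeg r))) (invFact≤1 r)

  ∣poissonApprox∣≤1 : ∀ m a → ∣ poissonApprox (expNegOneApprox m) a ∣ ≤ 1ℚ
  ∣poissonApprox∣≤1 m a = ∣p*q∣≤1 (expNegOneApprox m) (invFact a) (∣expNegOneApprox∣≤1 m) (∣invFact∣≤1 a)

  module _ {Ω : ℕ → Set} (space : (n : ℕ) → List (Ω n)) where
    open Expectations space

    module _ (L : (n : ℕ) → Ω n → ℕ) (R : Observable) (ρ : ℕ → ℚ)
             (R-nonNeg : ∀ n ω → 0ℚ ≤ R n ω) (∣ρ∣≤1 : ∀ m → ∣ ρ m ∣ ≤ 1ℚ)
             (moments : ∀ r → ExpectationTendsTo (λ n ω → choose (L n ω) r * R n ω) (λ m → invFact r * ρ m))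
             (x : ℕ) where
      private
        truncation : ℕ → Observable
        truncation T n ω = sumUpTo T (λ t → bonferroniCoeff x t * (choose (L n ω) (x ℕ.+ t) * R n ω))

        truncationLimit : ℕ → ℕ → ℚ
        truncationLimit T m = sumUpTo T (λ t → bonferroniCoeff x t * (invFact (x ℕ.+ t) * ρ m))

        truncation-tendsTo : ∀ T → ExpectationTendsTo (truncation T) (truncationLimit T)
        truncation-tendsTo T = tendsTo-sumUpTo T (λ t →
          tendsTo-scale (bonferroniCoeff x t) ((x ℕ.+ t) ↓ t) (∣bonferroniCoeff∣≤ x t) (moments (x ℕ.+ t)))

        truncation≡ : ∀ T n ω → truncation T n ω ≡ bonferroniSum x T (L n ω) * R n ω
        truncation≡ T n ω = trans
          (sumUpTo-cong T (λ t → sym (ℚₚ.*-assoc (bonferroniCoeff x t) (choose (L n ω) (x ℕ.+ t)) (R n ω))))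
          (sumUpTo-*ʳ T (λ t → bonferroniCoeff x t * choose (L n ω) (x ℕ.+ t)) (R n ω))

        truncationLimit≡ : ∀ T m → truncationLimit T m ≡ expNegOneApprox T * invFact x * ρ m
        truncationLimit≡ T m = begin
          truncationLimit T m
            ≡⟨ sumUpTo-cong T (λ t → trans (sym (ℚₚ.*-assoc (bonferroniCoeff x t) (invFact (x ℕ.+ t)) (ρ m)))
                                           (cong (_* ρ m) (bonferroniCoeff*invFact x t))) ⟩
          sumUpTo T (λ t → expTerm t * invFact x * ρ m)
            ≡⟨ sumUpTo-*ʳ T (λ t → expTerm t * invFact x) (ρ m) ⟩
          sumUpTo T (λ t → expTerm t * invFact x) * ρ m
            ≡⟨ cong (_* ρ m) (trans (sumUpTo-*ʳ T expTerm (invFact x)) (cong (_* invFact x) (sumUpTo-expTerm T))) ⟩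
          expNegOneApprox T * invFact x * ρ m ∎
          where open ≡-Reasoning

        ∣truncationLimit-target∣≤ : ∀ T m → ∣ truncationLimit T m - poissonApprox (expNegOneApprox m) x * ρ m ∣ ≤ ∣ expNegOneApprox T - expNegOneApprox m ∣
        ∣truncationLimit-target∣≤ T m = begin
          ∣ truncationLimit T m - expNegOneApprox m * invFact x * ρ m ∣
            ≡⟨ cong (λ z → ∣ z - expNegOneApprox m * invFact x * ρ m ∣) (truncationLimit≡ T m) ⟩
          ∣ expNegOneApprox T * invFact x * ρ m - expNegOneApprox m * invFact x * ρ m ∣
            ≡⟨ cong ∣_∣ (factor (expNegOneApprox T) (expNegOneApprox m) (invFact x) (ρ m)) ⟩
          ∣ (expNegOneApprox T - expNegOneApprox m) * (invFact x * ρ m) ∣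
            ≡⟨ ℚₚ.∣p*q∣≡∣p∣*∣q∣ (expNegOneApprox T - expNegOneApprox m) (invFact x * ρ m) ⟩
          ∣ expNegOneApprox T - expNegOneApprox m ∣ * ∣ invFact x * ρ m ∣
            ≤⟨ *-monoˡ-≤-nonNeg (ℚₚ.0≤∣p∣ (expNegOneApprox T - expNegOneApprox m)) ∣invFact*ρ∣≤1 ⟩
          ∣ expNegOneApprox T - expNegOneApprox m ∣ * 1ℚ
            ≡⟨ ℚₚ.*-identityʳ _ ⟩
          ∣ expNegOneApprox T - expNegOneApprox m ∣ ∎
          where
          open ℚₚ.≤-Reasoning
          factor : ∀ a b c d → a * c * d - b * c * d ≡ (a - b) * (c * d)
          factor = solve-∀ ℚ-ring
          ∣invFact*ρ∣≤1 : ∣ invFact x * ρ m ∣ ≤ 1ℚ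
          ∣invFact*ρ∣≤1 = begin
            ∣ invFact x * ρ m ∣           ≡⟨ ℚₚ.∣p*q∣≡∣p∣*∣q∣ (invFact x) (ρ m) ⟩
            ∣ invFact x ∣ * ∣ ρ m ∣       ≡⟨ cong (_* ∣ ρ m ∣) (ℚₚ.0≤p⇒∣p∣≡p (invFact-nonNeg x)) ⟩
            invFact x * ∣ ρ m ∣           ≤⟨ *-mono-≤-nonNeg (invFact-nonNeg x) (invFact≤1 x) (ℚₚ.0≤∣p∣ (ρ m)) (∣ρ∣≤1 m) ⟩
            1ℚ * 1ℚ                       ≡⟨⟩
            1ℚ                            ∎

      -- Sandwich the indicator between consecutive Bonferroni truncations; their limits differ from the target only through s_T - s_m.
      pointMass-tendsTo : ExpectationTendsTo (λ n ω → fromℕ (χ (L n ω ℕ.≟ x)) * R n ω)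
                                             (λ m → poissonApprox (expNegOneApprox m) x * ρ m)
      pointMass-tendsTo δ 0<δ = split (halve δ 0<δ)
        where
        target : ℕ → ℚ
        target m = poissonApprox (expNegOneApprox m) x * ρ m

        split : ∃[ δ′ ] (0ℚ < δ′) × (δ′ + δ′ ≤ δ) → ExpectationWithin δ (λ n ω → fromℕ (χ (L n ω ℕ.≟ x)) * R n ω) target
        split (δ′ , 0<δ′ , 2δ′≤δ) = sandwich (expNegOneApprox-cauchy δ′ 0<δ′)
          where
          sandwich : ∃[ T₀ ] (∀ t m → T₀ ℕ.≤ t → T₀ ℕ.≤ m → ∣ expNegOneApprox t - expNegOneApprox m ∣ ≤ δ′) →
                     ExpectationWithin δ (λ n ω → fromℕ (χ (L n ω ℕ.≟ x)) * R n ω) target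
          sandwich (T₀ , cauchy) = within-weaken {δ = δ′ + δ′} 2δ′≤δ (within-sandwich
              {Lo = truncation (suc (T₀ ℕ.+ T₀))} {Hi = truncation (T₀ ℕ.+ T₀)}
              (approximate (suc (T₀ ℕ.+ T₀)) (ℕₚ.≤-trans (ℕₚ.m≤m+n T₀ T₀) (ℕₚ.n≤1+n _)))
              (approximate (T₀ ℕ.+ T₀) (ℕₚ.m≤m+n T₀ T₀))
              lower upper)
            where
            approximate : ∀ T → T₀ ℕ.≤ T → ExpectationWithin (δ′ + δ′) (truncation T) target
            approximate T T₀≤T = within-retarget {τ = truncationLimit T} {δ = δ′} {η = δ′} (truncation-tendsTo T δ′ 0<δ′)
              (T₀ , λ m T₀≤m → ℚₚ.≤-trans (∣truncationLimit-target∣≤ T m) (cauchy T m T₀≤T T₀≤m))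
            lower : ∀ n ω → truncation (suc (T₀ ℕ.+ T₀)) n ω ≤ fromℕ (χ (L n ω ℕ.≟ x)) * R n ω
            lower n ω = subst (_≤ fromℕ (χ (L n ω ℕ.≟ x)) * R n ω) (sym (truncation≡ (suc (T₀ ℕ.+ T₀)) n ω))
              (*-monoʳ-≤-nonNeg {bonferroniSum x (suc (T₀ ℕ.+ T₀)) (L n ω)} {fromℕ (χ (L n ω ℕ.≟ x))} {R n ω}
                (R-nonNeg n ω) (bonferroniSum-odd≤χ x T₀ (L n ω)))
            upper : ∀ n ω → fromℕ (χ (L n ω ℕ.≟ x)) * R n ω ≤ truncation (T₀ ℕ.+ T₀) n ω
            upper n ω = subst (fromℕ (χ (L n ω ℕ.≟ x)) * R n ω ≤_) (sym (truncation≡ (T₀ ℕ.+ T₀) n ω))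
              (*-monoʳ-≤-nonNeg {fromℕ (χ (L n ω ℕ.≟ x))} {bonferroniSum x (T₀ ℕ.+ T₀) (L n ω)} {R n ω}
                (R-nonNeg n ω) (χ≤bonferroniSum-even x T₀ (L n ω)))

    -- Induction on the number of coordinates: the first coordinate is handled by pointMass-tendsTo, with the remaining factors absorbed into the weight R.
    jointPointMass-tendsTo :
      ∀ K (L : Fin K → (n : ℕ) → Ω n → ℕ) (R : Observable) (ρ : ℕ → ℚ) →
      (∀ n ω → 0ℚ ≤ R n ω) → (∀ m → ∣ ρ m ∣ ≤ 1ℚ) →
      (∀ (r : Fin K → ℕ) → ExpectationTendsTo (λ n ω → prodFin K (λ j → choose (L j n ω) (r j)) * R n ω)
                                (λ m → prodFin K (λ j → invFact (r j)) * ρ m)) →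
      ∀ (a : Fin K → ℕ) → ExpectationTendsTo (λ n ω → prodFin K (λ j → fromℕ (χ (L j n ω ℕ.≟ a j))) * R n ω)
                               (λ m → prodFin K (λ j → poissonApprox (expNegOneApprox m) (a j)) * ρ m)
    jointPointMass-tendsTo zero    L R ρ _        _     moments a = moments (λ ())
    jointPointMass-tendsTo (suc K) L R ρ R-nonNeg ∣ρ∣≤1 moments a =
      tendsTo-cong (λ n ω → *-assoc⁻ (indicator₀ n ω) (indicators n ω) (R n ω)) (λ m → *-assoc⁻ (poisson₀ m) (poissons m) (ρ m))
        (pointMass-tendsTo (L Fin.zero) restR restρ restR-nonNeg ∣restρ∣≤1 firstMoments (a Fin.zero))
      where
      *-assoc⁻ : ∀ p q r → p * (q * r) ≡ p * q * r
      *-assoc⁻ p q r = sym (ℚₚ.*-assoc p q r)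
      swap : ∀ p q r → p * (q * r) ≡ q * (p * r)
      swap = solve-∀ ℚ-ring
      pull : ∀ p q r → p * q * r ≡ q * (p * r)
      pull = solve-∀ ℚ-ring

      indicator₀ : Observable
      indicator₀ n ω = fromℕ (χ (L Fin.zero n ω ℕ.≟ a Fin.zero))

      indicators : Observable
      indicators n ω = prodFin K (λ j → fromℕ (χ (L (Fin.suc j) n ω ℕ.≟ a (Fin.suc j))))

      poisson₀ : ℕ → ℚ
      poisson₀ m = poissonApprox (expNegOneApprox m) (a Fin.zero)

      poissons : ℕ → ℚ
      poissons m = prodFin K (λ j → poissonApprox (expNegOneApprox m) (a (Fin.suc j)))

      restR : Observable
      restR n ω = indicators n ω * R n ω

      restρ : ℕ → ℚ
      restρ m = poissons m * ρ m

      restR-nonNeg : ∀ n ω → 0ℚ ≤ restR n ω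
      restR-nonNeg n ω = nonNeg-* {indicators n ω} {R n ω}
        (prodFin-nonNeg K (λ j → fromℕ (χ (L (Fin.suc j) n ω ℕ.≟ a (Fin.suc j))))
          (λ j → fromℕ-nonNeg (χ (L (Fin.suc j) n ω ℕ.≟ a (Fin.suc j)))))
        (R-nonNeg n ω)

      ∣restρ∣≤1 : ∀ m → ∣ restρ m ∣ ≤ 1ℚ
      ∣restρ∣≤1 m = ∣p*q∣≤1 (poissons m) (ρ m)
        (∣prodFin∣≤1 K (λ j → poissonApprox (expNegOneApprox m) (a (Fin.suc j))) (λ j → ∣poissonApprox∣≤1 m (a (Fin.suc j))))
        (∣ρ∣≤1 m)

      firstMoments : ∀ r₀ → ExpectationTendsTo (λ n ω → choose (L Fin.zero n ω) r₀ * restR n ω) (λ m → invFact r₀ * restρ m)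
      firstMoments r₀ =
        tendsTo-cong (λ n ω → swap (indicators n ω) (choose (L Fin.zero n ω) r₀) (R n ω)) (λ m → swap (poissons m) (invFact r₀) (ρ m))
          (jointPointMass-tendsTo K (λ j → L (Fin.suc j)) (λ n ω → choose (L Fin.zero n ω) r₀ * R n ω) (λ m → invFact r₀ * ρ m)
            (λ n ω → nonNeg-* {choose (L Fin.zero n ω) r₀} {R n ω} (choose-nonNeg (L Fin.zero n ω) r₀) (R-nonNeg n ω))
            (λ m → ∣p*q∣≤1 (invFact r₀) (ρ m) (∣invFact∣≤1 r₀) (∣ρ∣≤1 m))
            (λ r → tendsTo-cong
              (λ n ω → pull (choose (L Fin.zero n ω) r₀) (prodFin K (λ j → choose (L (Fin.suc j) n ω) (r j))) (R n ω))
              (λ m → pull (invFact r₀) (prodFin K (λ j → invFact (r j))) (ρ m))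
              (moments (r₀ ∷ r)))
            (λ j → a (Fin.suc j)))


module PerfectMatchings where

  open import Data.Nat as ℕ using (ℕ; zero; suc; _+_; _*_; _<_; z≤n; s≤s)
  import Data.Nat.Properties as ℕₚ
  open import Data.Nat.Tactic.RingSolver using (solve-∀)
  open import Data.Fin as Fin using (Fin)
  open import Data.Vec using (Vec; []; _∷_; lookup; tabulate)
  import Data.Vec.Properties as VecP
  open import Data.List as List using (List; length; map; allFin)
  open import Data.List.Relation.Unary.Any using (here; there)
  open import Data.List.Relation.Unary.All as All using (All; all?)
  open import Data.List.Relation.Unary.All.Properties using (All¬⇒¬Any; ¬Any⇒All¬)
  open import Data.List.Relation.Unary.Unique.Propositional using (Unique)
  open import Data.List.Relation.Unary.AllPairs using ([]; _∷_)
  open import Data.List.Membership.Propositional using (_∈_; _∉_)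
  open import Data.Bool using (if_then_else_)
  open import Data.Product using (∃-syntax; _×_; _,_; proj₁; proj₂)
  open import Data.Sum using (_⊎_; inj₁; inj₂)
  open import Data.Empty using (⊥-elim)
  open import Function using (_∘_)
  open import Relation.Binary.PropositionalEquality
  open import Relation.Nullary using (Dec; yes; no; does; ¬_; ¬?)
  open import Relation.Nullary.Decidable using (_×-dec_; dec-true; dec-false; decidable-stable)
  open import Defs
  open Indicators
  open FiniteSums

  matchings : ℕ → ℕ
  matchings zero    = 1
  matchings (suc m) = suc (m + m) * matchings m

  allVecs-unique : ∀ m l (w : Vec (Fin m) l) → sumℕ (allVecs m l) (λ v → χ (VecP.≡-dec Fin._≟_ v w)) ≡ 1
  allVecs-unique m zero    []      = refl
  allVecs-unique m (suc l) (x ∷ w) = begin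
    sumℕ (List.concatMap (λ i → map (i ∷_) (allVecs m l)) (allFin m)) (λ v → χ (v ≟ᵥ (x ∷ w)))
      ≡⟨ sumℕ-concatMap (λ i → map (i ∷_) (allVecs m l)) (allFin m) (λ v → χ (v ≟ᵥ (x ∷ w))) ⟩
    sumℕ (allFin m) (λ i → sumℕ (map (i ∷_) (allVecs m l)) (λ v → χ (v ≟ᵥ (x ∷ w))))
      ≡⟨ sumℕ-cong (allFin m) (λ i → trans (sumℕ-map (i ∷_) (allVecs m l) (λ v → χ (v ≟ᵥ (x ∷ w))))
                                             (sumℕ-cong (allVecs m l) (λ v → χ-× (i Fin.≟ x) (v ≟ᵥ w)))) ⟩
    sumℕ (allFin m) (λ i → sumℕ (allVecs m l) (λ v → χ (i Fin.≟ x) * χ (v ≟ᵥ w)))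
      ≡⟨ sumℕ-cong (allFin m) (λ i → sumℕ-*ˡ (allVecs m l) (χ (i Fin.≟ x)) (λ v → χ (v ≟ᵥ w))) ⟩
    sumℕ (allFin m) (λ i → χ (i Fin.≟ x) * sumℕ (allVecs m l) (λ v → χ (v ≟ᵥ w)))
      ≡⟨ sumℕ-cong (allFin m) (λ i → cong (χ (i Fin.≟ x) *_) (allVecs-unique m l w)) ⟩
    sumℕ (allFin m) (λ i → χ (i Fin.≟ x) * 1)
      ≡⟨ trans (sumℕ-allFin m (λ i → χ (i Fin.≟ x) * 1)) (∑-δ′ x (λ _ → 1)) ⟩
    1 ∎
    where
    open ≡-Reasoning
    _≟ᵥ_ : ∀ {k} → (u v : Vec (Fin m) k) → Dec (u ≡ v)
    _≟ᵥ_ = VecP.≡-dec Fin._≟_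

  head∉ : ∀ {a} {A : Set a} {x : A} {xs} → Unique (x List.∷ xs) → x ∉ xs
  head∉ (x≢xs ∷ _) = All¬⇒¬Any x≢xs

  module PartialMatchings (n : ℕ) where

    M : ℕ
    M = 2 * n

    open import Data.List.Membership.DecPropositional (Fin._≟_ {M}) using (_∈?_)

    Chord : Set
    Chord = Fin M × Fin M

    points : List Chord → List (Fin M)
    points List.[]             = List.[]
    points ((a , b) List.∷ Q) = a List.∷ b List.∷ points Q

    Valid : List Chord → Set
    Valid Q = Unique (points Q)

    Contains : List Chord → Diagram n → Set
    Contains Q v = All (λ c → lookup v (proj₁ c) ≡ proj₂ c) Q

    contains? : ∀ Q v → Dec (Contains Q v)
    contains? Q v = all? (λ c → lookup v (proj₁ c) Fin.≟ proj₂ c) Q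

    χ-contains-∷ : ∀ a b Q v → χ (contains? ((a , b) List.∷ Q) v) ≡ χ (lookup v a Fin.≟ b) * χ (contains? Q v)
    χ-contains-∷ a b Q v = χ-× (lookup v a Fin.≟ b) (contains? Q v)

    extensions : List Chord → ℕ
    extensions Q = sumℕ (chordDiagrams n) (λ v → χ (contains? Q v))

    length-points : ∀ Q → length (points Q) ≡ length Q + length Q
    length-points List.[]        = refl
    length-points (_ List.∷ Q) = cong suc (trans (cong suc (length-points Q)) (sym (ℕₚ.+-suc (length Q) (length Q))))

    ∈points⇒ : ∀ {i} Q → i ∈ points Q → ∃[ a ] ∃[ b ] ((a , b) ∈ Q × ((i ≡ a) ⊎ (i ≡ b)))
    ∈points⇒ ((a , b) List.∷ Q) (here i≡a)         = a , b , here refl , inj₁ i≡a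
    ∈points⇒ ((a , b) List.∷ Q) (there (here i≡b)) = a , b , here refl , inj₂ i≡b
    ∈points⇒ ((a , b) List.∷ Q) (there (there i∈)) with ∈points⇒ Q i∈
    ... | a′ , b′ , ab∈ , i≡ = a′ , b′ , there ab∈ , i≡

    ∈⇒∈points : ∀ {a b} Q → (a , b) ∈ Q → (a ∈ points Q) × (b ∈ points Q)
    ∈⇒∈points (_ List.∷ Q) (here refl) = here refl , there (here refl)
    ∈⇒∈points (_ List.∷ Q) (there ab∈) with ∈⇒∈points Q ab∈
    ... | a∈ , b∈ = there (there (proj₁ (∈⇒∈points Q ab∈))) , there (there (proj₂ (∈⇒∈points Q ab∈)))

    count-members : ∀ xs → Unique xs → ∑[ w < M ] χ (w ∈? xs) ≡ length xs
    count-members List.[]         _  = ∑-zero M (λ _ → refl)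
    count-members (x List.∷ xs) u@(_ ∷ u′) = begin
      ∑[ w < M ] χ (w ∈? (x List.∷ xs))                    ≡⟨ sum-cong-≗ (λ w → split w (w Fin.≟ x)) ⟩
      ∑[ w < M ] (χ (w Fin.≟ x) * 1 + χ (w ∈? xs))         ≡⟨ ∑-distrib-+ (λ w → χ (w Fin.≟ x) * 1) (λ w → χ (w ∈? xs)) ⟩
      ∑[ w < M ] (χ (w Fin.≟ x) * 1) + ∑[ w < M ] χ (w ∈? xs) ≡⟨ cong₂ _+_ (∑-δ′ x (λ _ → 1)) (count-members xs u′) ⟩
      suc (length xs) ∎
      where
      open ≡-Reasoning
      split : ∀ w → Dec (w ≡ x) → χ (w ∈? (x List.∷ xs)) ≡ χ (w Fin.≟ x) * 1 + χ (w ∈? xs)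
      split w (yes refl) = trans (χ-yes (here refl) (w ∈? (x List.∷ xs)))
        (sym (cong₂ _+_ (cong (_* 1) (χ-yes refl (w Fin.≟ w))) (χ-no (head∉ u) (w ∈? xs))))
      split w (no w≢x) = trans (χ-⇔ (λ { (here w≡x) → ⊥-elim (w≢x w≡x) ; (there w∈) → w∈ }) there (w ∈? (x List.∷ xs)) (w ∈? xs))
        (sym (cong (_+ χ (w ∈? xs)) (cong (_* 1) (χ-no w≢x (w Fin.≟ x)))))

    count-uncovered : ∀ Q → Valid Q → ∑[ w < M ] χ (¬? (w ∈? points Q)) + (length Q + length Q) ≡ M
    count-uncovered Q valid = begin
      ∑[ w < M ] χ (¬? (w ∈? points Q)) + (length Q + length Q)
        ≡⟨ cong (∑[ w < M ] χ (¬? (w ∈? points Q)) +_) (sym (trans (count-members (points Q) valid) (length-points Q))) ⟩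
      ∑[ w < M ] χ (¬? (w ∈? points Q)) + ∑[ w < M ] χ (w ∈? points Q)
        ≡⟨ ℕₚ.+-comm (∑[ w < M ] χ (¬? (w ∈? points Q))) (∑[ w < M ] χ (w ∈? points Q)) ⟩
      ∑[ w < M ] χ (w ∈? points Q) + ∑[ w < M ] χ (¬? (w ∈? points Q))
        ≡⟨ ∑-χ+∑-χ¬ M (λ w → w ∈? points Q) ⟩
      M ∎
      where open ≡-Reasoning

    sumℕ-chordDiagrams-cong : ∀ {f g : Diagram n → ℕ} → (∀ v → IsChordDiagram n v → f v ≡ g v) →
                              sumℕ (chordDiagrams n) f ≡ sumℕ (chordDiagrams n) g
    sumℕ-chordDiagrams-cong {f} {g} f≗g = begin
      sumℕ (chordDiagrams n) f                                     ≡⟨ sumℕ-filter (isChordDiagram? n) (allVecs M M) f ⟩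
      sumℕ (allVecs M M) (λ v → χ (isChordDiagram? n v) * f v)     ≡⟨ sumℕ-cong (allVecs M M) (λ v → restrict v (isChordDiagram? n v)) ⟩
      sumℕ (allVecs M M) (λ v → χ (isChordDiagram? n v) * g v)     ≡⟨ sumℕ-filter (isChordDiagram? n) (allVecs M M) g ⟨
      sumℕ (chordDiagrams n) g                                     ∎
      where
      open ≡-Reasoning
      restrict : ∀ v (d : Dec (IsChordDiagram n v)) → χ d * f v ≡ χ d * g v
      restrict v (yes isCD) = cong (1 *_) (f≗g v isCD)
      restrict v (no _)     = refl

    extensions-zero : ∀ Q → (∀ v → IsChordDiagram n v → ¬ Contains Q v) → extensions Q ≡ 0
    extensions-zero Q never = trans (sumℕ-chordDiagrams-cong (λ v isCD → χ-no (never v isCD) (contains? Q v)))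
      (trans (sumℕ-const (chordDiagrams n) 0) (ℕₚ.*-zeroʳ (length (chordDiagrams n))))

    extensions-split : ∀ u Q → extensions Q ≡ ∑[ w < M ] extensions ((u , w) List.∷ Q)
    extensions-split u Q = trans
      (sumℕ-cong (chordDiagrams n) (λ v → sym (trans (sum-cong-≗ (λ w → χ-contains-∷ u w Q v)) (∑-δ (lookup v u) (λ _ → χ (contains? Q v))))))
      (sumℕ-∑-comm (chordDiagrams n) M (λ v w → χ (contains? ((u , w) List.∷ Q) v)))

    extension-blocked : ∀ Q u w → u ∉ points Q → (w ∈ points Q) ⊎ (w ≡ u) →
                        ∀ v → IsChordDiagram n v → ¬ Contains ((u , w) List.∷ Q) v
    extension-blocked Q u w u∉ (inj₂ w≡u) v isCD (vu≡w All.∷ _) = proj₂ (isCD u) (trans vu≡w w≡u)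
    extension-blocked Q u w u∉ (inj₁ w∈) v isCD (vu≡w All.∷ contQ) with ∈points⇒ Q w∈
    ... | a , b , ab∈ , inj₁ w≡a = u∉ (subst (_∈ points Q) (sym u≡b) (proj₂ (∈⇒∈points Q ab∈)))
      where
      u≡b : u ≡ b
      u≡b = trans (sym (proj₁ (isCD u))) (trans (cong (lookup v) (trans vu≡w w≡a)) (All.lookup contQ ab∈))
    ... | a , b , ab∈ , inj₂ w≡b = u∉ (subst (_∈ points Q) (sym u≡a) (proj₁ (∈⇒∈points Q ab∈)))
      where
      u≡a : u ≡ a
      u≡a = trans (sym (proj₁ (isCD u))) (trans (cong (lookup v) (trans vu≡w (trans w≡b (sym (All.lookup contQ ab∈))))) (proj₁ (isCD a)))

    partner : List Chord → Fin M → Fin M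
    partner List.[]             i = i
    partner ((a , b) List.∷ Q) i = if does (i Fin.≟ a) then b else (if does (i Fin.≟ b) then a else partner Q i)

    partner-∷ : ∀ a₀ b₀ Q {i} → i ≢ a₀ → i ≢ b₀ → partner ((a₀ , b₀) List.∷ Q) i ≡ partner Q i
    partner-∷ a₀ b₀ Q {i} i≢a₀ i≢b₀ rewrite dec-false (i Fin.≟ a₀) i≢a₀ | dec-false (i Fin.≟ b₀) i≢b₀ = refl

    partner-spec : ∀ Q → Valid Q → ∀ {a b} → (a , b) ∈ Q → (partner Q a ≡ b) × (partner Q b ≡ a)
    partner-spec ((a₀ , b₀) List.∷ Q) (a₀≢ ∷ _ ∷ _) (here refl)
      rewrite dec-true (a₀ Fin.≟ a₀) refl
            | dec-false (b₀ Fin.≟ a₀) (λ b₀≡a₀ → All.head a₀≢ (sym b₀≡a₀))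
            | dec-true (b₀ Fin.≟ b₀) refl = refl , refl
    partner-spec ((a₀ , b₀) List.∷ Q) (a₀≢ ∷ b₀≢ ∷ valid) {a} {b} (there ab∈) =
      trans (partner-∷ a₀ b₀ Q (avoids a₀≢ (there a∈)) (avoids b₀≢ a∈)) (proj₁ (partner-spec Q valid ab∈)) ,
      trans (partner-∷ a₀ b₀ Q (avoids a₀≢ (there b∈)) (avoids b₀≢ b∈)) (proj₂ (partner-spec Q valid ab∈))
      where
      a∈ : a ∈ points Q
      a∈ = proj₁ (∈⇒∈points Q ab∈)
      b∈ : b ∈ points Q
      b∈ = proj₂ (∈⇒∈points Q ab∈)
      avoids : ∀ {c x xs} → All (c ≢_) xs → x ∈ xs → x ≢ c
      avoids c≢xs x∈ x≡c = All.lookup c≢xs x∈ (sym x≡c)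

    chord-endpoints-distinct : ∀ Q → Valid Q → ∀ {a b} → (a , b) ∈ Q → a ≢ b
    chord-endpoints-distinct ((a₀ , b₀) List.∷ Q) (a₀≢ ∷ _ ∷ _)     (here refl) = All.head a₀≢
    chord-endpoints-distinct ((a₀ , b₀) List.∷ Q) (_ ∷ _ ∷ valid) (there ab∈) = chord-endpoints-distinct Q valid ab∈

    module _ (Q : List Chord) (|Q|≡n : length Q ≡ n) (valid : Valid Q) where
      private
        no-uncovered : ∑[ w < M ] χ (¬? (w ∈? points Q)) ≡ 0
        no-uncovered = ℕₚ.+-cancelʳ-≡ (length Q + length Q) _ 0
          (trans (count-uncovered Q valid) (trans (cong (λ k → k + (k + 0)) (sym |Q|≡n)) (cong (length Q +_) (ℕₚ.+-identityʳ (length Q)))))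

        covered : ∀ i → i ∈ points Q
        covered i = decidable-stable (i ∈? points Q) λ i∉ →
          ℕₚ.1+n≢0 (trans (sym (χ-yes i∉ (¬? (i ∈? points Q)))) (∑≡0⇒≡0 (λ w → χ (¬? (w ∈? points Q))) no-uncovered i))

        v₀ : Diagram n
        v₀ = tabulate (partner Q)

        v₀-isChordDiagram : IsChordDiagram n v₀
        v₀-isChordDiagram i with ∈points⇒ Q (covered i)
        ... | a , b , ab∈ , inj₁ refl rewrite VecP.lookup∘tabulate (partner Q) i =
          trans (VecP.lookup∘tabulate (partner Q) (partner Q i)) (trans (cong (partner Q) (proj₁ (partner-spec Q valid ab∈))) (proj₂ (partner-spec Q valid ab∈))) ,
          λ pi≡i → chord-endpoints-distinct Q valid ab∈ (trans (sym pi≡i) (proj₁ (partner-spec Q valid ab∈)))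
        ... | a , b , ab∈ , inj₂ refl rewrite VecP.lookup∘tabulate (partner Q) i =
          trans (VecP.lookup∘tabulate (partner Q) (partner Q i)) (trans (cong (partner Q) (proj₂ (partner-spec Q valid ab∈))) (proj₁ (partner-spec Q valid ab∈))) ,
          λ pi≡i → chord-endpoints-distinct Q valid ab∈ (trans (sym (proj₂ (partner-spec Q valid ab∈))) pi≡i)

        v₀-contains : Contains Q v₀
        v₀-contains = All.tabulate λ {(a , b)} ab∈ → trans (VecP.lookup∘tabulate (partner Q) a) (proj₁ (partner-spec Q valid ab∈))

        contains⇒≡v₀ : ∀ v → IsChordDiagram n v → Contains Q v → v ≡ v₀
        contains⇒≡v₀ v isCD contQ = trans (sym (VecP.tabulate∘lookup v)) (VecP.tabulate-cong agree)
          where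
          agree : ∀ i → lookup v i ≡ partner Q i
          agree i with ∈points⇒ Q (covered i)
          ... | a , b , ab∈ , inj₁ refl = trans (All.lookup contQ ab∈) (sym (proj₁ (partner-spec Q valid ab∈)))
          ... | a , b , ab∈ , inj₂ refl = trans (cong (lookup v) (sym (All.lookup contQ ab∈)))
                                                (trans (proj₁ (isCD a)) (sym (proj₂ (partner-spec Q valid ab∈))))

        indicator≡ : ∀ v → χ (isChordDiagram? n v) * χ (contains? Q v) ≡ χ (VecP.≡-dec Fin._≟_ v v₀)
        indicator≡ v = byCases (isChordDiagram? n v) (VecP.≡-dec Fin._≟_ v v₀)
          where
          byCases : (d : Dec (IsChordDiagram n v)) (e : Dec (v ≡ v₀)) → χ d * χ (contains? Q v) ≡ χ e
          byCases d        (yes refl) = cong₂ _*_ (χ-yes v₀-isChordDiagram d) (χ-yes v₀-contains (contains? Q v₀))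
          byCases (no _)   (no _)     = refl
          byCases (yes isCD) (no v≢v₀) = trans (ℕₚ.+-identityʳ _) (χ-no (v≢v₀ ∘ contains⇒≡v₀ v isCD) (contains? Q v))

      extensions-complete : extensions Q ≡ 1
      extensions-complete = trans (sumℕ-filter (isChordDiagram? n) (allVecs M M) (λ v → χ (contains? Q v)))
        (trans (sumℕ-cong (allVecs M M) indicator≡) (allVecs-unique M M v₀))

    extensions≡matchings : ∀ m Q → length Q + m ≡ n → Valid Q → extensions Q ≡ matchings m
    extensions≡matchings zero    Q |Q|+0≡n valid = extensions-complete Q (trans (sym (ℕₚ.+-identityʳ _)) |Q|+0≡n) valid
    extensions≡matchings (suc m) Q |Q|+m≡n valid = pickUncovered (∑-pos (λ w → χ (¬? (w ∈? points Q))) 0<uncovered)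
      where
      uncovered≡ : ∑[ w < M ] χ (¬? (w ∈? points Q)) ≡ suc (suc (m + m))
      uncovered≡ = ℕₚ.+-cancelʳ-≡ (length Q + length Q) _ _ (trans (count-uncovered Q valid)
        (subst (λ k → 2 * k ≡ suc (suc (m + m)) + (length Q + length Q)) |Q|+m≡n (arith (length Q) m)))
        where
        arith : ∀ q m → 2 * (q + suc m) ≡ suc (suc (m + m)) + (q + q)
        arith = solve-∀

      0<uncovered : 0 < ∑[ w < M ] χ (¬? (w ∈? points Q))
      0<uncovered = subst (0 <_) (sym uncovered≡) (s≤s z≤n)

      -- Matching an uncovered point u to each admissible partner w in turn is the recursion (2m+1)!! = (2m+1)·(2m-1)!!.
      pickUncovered : ∃[ u ] 0 < χ (¬? (u ∈? points Q)) → extensions Q ≡ matchings (suc m)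
      pickUncovered (u , 0<χ) = begin
        extensions Q                                        ≡⟨ extensions-split u Q ⟩
        ∑[ w < M ] extensions ((u , w) List.∷ Q)            ≡⟨ sum-cong-≗ (λ w → extend w (admissible? w)) ⟩
        ∑[ w < M ] (χ (admissible? w) * matchings m)        ≡⟨ *-distribʳ-sum (matchings m) (λ w → χ (admissible? w)) ⟨
        ∑[ w < M ] χ (admissible? w) * matchings m          ≡⟨ cong (_* matchings m) count-admissible ⟩
        suc (m + m) * matchings m                           ∎
        where
        open ≡-Reasoning
        u∉ : u ∉ points Q
        u∉ with u ∈? points Q
        ... | yes _  = λ _ → ℕₚ.<-irrefl refl 0<χ
        ... | no u∉′ = u∉′

        admissible? : ∀ w → Dec (w ∉ points Q × w ≢ u)
        admissible? w = ¬? (w ∈? points Q) ×-dec ¬? (w Fin.≟ u)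

        extend : ∀ w (d : Dec (w ∉ points Q × w ≢ u)) → extensions ((u , w) List.∷ Q) ≡ χ d * matchings m
        extend w (yes (w∉ , w≢u)) = trans (extensions≡matchings m ((u , w) List.∷ Q) (trans (sym (ℕₚ.+-suc (length Q) m)) |Q|+m≡n) valid′)
                                          (sym (ℕₚ.+-identityʳ (matchings m)))
          where
          valid′ : Valid ((u , w) List.∷ Q)
          valid′ = ¬Any⇒All¬ (w List.∷ points Q) (λ { (here u≡w) → w≢u (sym u≡w) ; (there u∈) → u∉ u∈ })
                 ∷ ¬Any⇒All¬ (points Q) w∉ ∷ valid
        extend w (no ¬admissible) = extensions-zero ((u , w) List.∷ Q) (extension-blocked Q u w u∉ blocked)
          where
          blocked : (w ∈ points Q) ⊎ (w ≡ u)
          blocked with w ∈? points Q | w Fin.≟ u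
          ... | yes w∈ | _       = inj₁ w∈
          ... | no _   | yes w≡u = inj₂ w≡u
          ... | no w∉  | no w≢u  = ⊥-elim (¬admissible (w∉ , w≢u))

        uncovered-split : ∀ w → χ (¬? (w ∈? points Q)) ≡ χ (admissible? w) + χ (w Fin.≟ u) * 1
        uncovered-split w = byCases (w Fin.≟ u)
          where
          byCases : Dec (w ≡ u) → χ (¬? (w ∈? points Q)) ≡ χ (admissible? w) + χ (w Fin.≟ u) * 1
          byCases (yes refl) = trans (χ-yes u∉ (¬? (u ∈? points Q)))
            (sym (cong₂ _+_ (χ-no (λ adm → proj₂ adm refl) (admissible? u)) (cong (_* 1) (χ-yes refl (u Fin.≟ u)))))
          byCases (no w≢u) = trans (χ-⇔ (_, w≢u) proj₁ (¬? (w ∈? points Q)) (admissible? w))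
            (sym (trans (cong (λ k → χ (admissible? w) + k * 1) (χ-no w≢u (w Fin.≟ u))) (ℕₚ.+-identityʳ _)))

        count-admissible : ∑[ w < M ] χ (admissible? w) ≡ suc (m + m)
        count-admissible = ℕₚ.+-cancelʳ-≡ 1 _ _ (begin
          ∑[ w < M ] χ (admissible? w) + 1
            ≡⟨ cong (∑[ w < M ] χ (admissible? w) +_) (∑-δ′ u (λ _ → 1)) ⟨
          ∑[ w < M ] χ (admissible? w) + ∑[ w < M ] (χ (w Fin.≟ u) * 1)
            ≡⟨ ∑-distrib-+ (λ w → χ (admissible? w)) (λ w → χ (w Fin.≟ u) * 1) ⟨
          ∑[ w < M ] (χ (admissible? w) + χ (w Fin.≟ u) * 1)
            ≡⟨ sum-cong-≗ uncovered-split ⟨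
          ∑[ w < M ] χ (¬? (w ∈? points Q))
            ≡⟨ uncovered≡ ⟩
          suc (suc (m + m))
            ≡⟨ ℕₚ.+-comm 1 (suc (m + m)) ⟩
          suc (m + m) + 1 ∎)

    numDiagrams≡matchings : numDiagrams n ≡ matchings n
    numDiagrams≡matchings = trans (sym (trans (sumℕ-const (chordDiagrams n) 1) (ℕₚ.*-identityʳ _)))
      (extensions≡matchings n List.[] refl [])


module ChordSlots where

  open import Data.Nat as ℕ using (ℕ; zero; suc; _+_; _*_; _≤_; _<_; _∸_; _⊓_; ∣_-_∣; z≤n; s≤s)
  import Data.Nat.Properties as ℕₚ
  open import Data.Nat.Tactic.RingSolver using (solve-∀)
  open import Data.Fin using (toℕ)
  import Data.Fin.Properties as FinP
  open import Data.Sum using (_⊎_; inj₁; inj₂)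
  open import Data.Empty using (⊥-elim)
  open import Relation.Binary.PropositionalEquality
  open import Function using (_∘′_)
  open import Relation.Nullary using (Dec; yes; no; ¬_)
  open Indicators
  open FiniteSums

  circleDistance : ℕ → ℕ → ℕ → ℕ
  circleDistance M a b = (∣ a - b ∣ ∸ 1) ⊓ (M ∸ ∣ a - b ∣ ∸ 1)

  slot : ℕ → ℕ → ℕ → ℕ → ℕ
  slot M j a b = χ (a ℕ.<? b) * χ (circleDistance M a b ℕ.≟ j)

  ∑-χ[toℕ≡c] : ∀ M c → ∑[ y < M ] χ (toℕ y ℕ.≟ c) ≡ χ (c ℕ.<? M)
  ∑-χ[toℕ≡c] zero    c       = sym (χ-no (λ ()) (c ℕ.<? 0))
  ∑-χ[toℕ≡c] (suc M) zero    = trans (cong suc (∑-zero M (λ y → χ-no (λ ()) (suc (toℕ y) ℕ.≟ 0))))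
                                     (sym (χ-yes (s≤s z≤n) (0 ℕ.<? suc M)))
  ∑-χ[toℕ≡c] (suc M) (suc c) = trans
    (cong₂ _+_ (χ-no (λ ()) (0 ℕ.≟ suc c))
               (trans (sum-cong-≗ {M} (λ y → χ-⇔ ℕₚ.suc-injective (cong suc) (suc (toℕ y) ℕ.≟ suc c) (toℕ y ℕ.≟ c))) (∑-χ[toℕ≡c] M c)))
    (χ-⇔ s≤s ℕₚ.≤-pred (c ℕ.<? M) (suc c ℕ.<? suc M))

  ∑-χ[toℕ≡c]≤1 : ∀ M c → ∑[ y < M ] χ (toℕ y ℕ.≟ c) ≤ 1
  ∑-χ[toℕ≡c]≤1 M c = ℕₚ.≤-trans (ℕₚ.≤-reflexive (∑-χ[toℕ≡c] M c)) (χ≤1 (c ℕ.<? M))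

  ∑-χ[c≡toℕ+d]≤1 : ∀ M c d → ∑[ x < M ] χ (c ℕ.≟ toℕ x + d) ≤ 1
  ∑-χ[c≡toℕ+d]≤1 M c d = ℕₚ.≤-trans (∑-mono-≤ {M} (λ x → χ-mono (c≡x+d⇒x≡c∸d {toℕ x}) (c ℕ.≟ toℕ x + d) (toℕ x ℕ.≟ c ∸ d)))
                                    (∑-χ[toℕ≡c]≤1 M (c ∸ d))
    where
    c≡x+d⇒x≡c∸d : ∀ {x} → c ≡ x + d → x ≡ c ∸ d
    c≡x+d⇒x≡c∸d {x} c≡x+d = sym (trans (cong (_∸ d) c≡x+d) (ℕₚ.m+n∸n≡m x d))

  ∑-χ[toℕ<c] : ∀ M c → ∑[ x < M ] χ (toℕ x ℕ.<? c) ≡ c ⊓ M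
  ∑-χ[toℕ<c] zero    c       = sym (ℕₚ.⊓-zeroʳ c)
  ∑-χ[toℕ<c] (suc M) zero    = ∑-zero (suc M) (λ x → χ-no (λ ()) (toℕ x ℕ.<? 0))
  ∑-χ[toℕ<c] (suc M) (suc c) = cong₂ _+_ (χ-yes (s≤s z≤n) (0 ℕ.<? suc c))
    (trans (sum-cong-≗ {M} (λ x → χ-⇔ ℕₚ.≤-pred s≤s (suc (toℕ x) ℕ.<? suc c) (toℕ x ℕ.<? c))) (∑-χ[toℕ<c] M c))

  ∑-χ[toℕ+d<M] : ∀ M d → d ≤ M → ∑[ x < M ] χ (toℕ x + d ℕ.<? M) ≡ M ∸ d
  ∑-χ[toℕ+d<M] M d d≤M = begin
    ∑[ x < M ] χ (toℕ x + d ℕ.<? M)   ≡⟨ sum-cong-≗ {M} (λ x → χ-⇔ ⇒ (⇐ (toℕ x)) (toℕ x + d ℕ.<? M) (toℕ x ℕ.<? M ∸ d)) ⟩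
    ∑[ x < M ] χ (toℕ x ℕ.<? M ∸ d)   ≡⟨ ∑-χ[toℕ<c] M (M ∸ d) ⟩
    (M ∸ d) ⊓ M                       ≡⟨ ℕₚ.m≤n⇒m⊓n≡m (ℕₚ.m∸n≤m M d) ⟩
    M ∸ d                             ∎
    where
    open ≡-Reasoning
    ⇒ : ∀ {x} → x + d < M → x < M ∸ d
    ⇒ {x} x+d<M = subst (_≤ M ∸ d) (ℕₚ.m+n∸n≡m (suc x) d) (ℕₚ.∸-monoˡ-≤ d x+d<M)
    ⇐ : ∀ x → x < M ∸ d → x + d < M
    ⇐ x x<M∸d = subst (_≤ M) (ℕₚ.+-comm d (suc x)) (subst (d + suc x ≤_) (ℕₚ.m+[n∸m]≡n d≤M) (ℕₚ.+-monoʳ-≤ d x<M∸d))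

  module _ (M j : ℕ) (2[j+1]<M : suc j + suc j < M) where
    private
      m+n≤o⇒m≤o∸n : ∀ a b → a + b ≤ M → a ≤ M ∸ b
      m+n≤o⇒m≤o∸n a b a+b≤M = subst (_≤ M ∸ b) (ℕₚ.m+n∸n≡m a b) (ℕₚ.∸-monoˡ-≤ b a+b≤M)

      j≤M∸[1+j]∸1 : j ≤ M ∸ suc j ∸ 1
      j≤M∸[1+j]∸1 = subst (j ≤_) (sym (ℕₚ.∸-+-assoc M (suc j) 1))
        (m+n≤o⇒m≤o∸n j (suc j + 1) (ℕₚ.≤-trans (ℕₚ.m≤m+n (j + (suc j + 1)) 1) (ℕₚ.≤-trans (ℕₚ.≤-reflexive (arith j)) 2[j+1]<M)))
        where
        arith : ∀ j → j + (suc j + 1) + 1 ≡ suc (suc j + suc j)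
        arith = solve-∀

      1+j≤M : suc j ≤ M
      1+j≤M = ℕₚ.≤-trans (ℕₚ.m≤m+n (suc j) (suc j)) (ℕₚ.<⇒≤ 2[j+1]<M)

      0<M∸[1+j] : 1 ≤ M ∸ suc j
      0<M∸[1+j] = ℕₚ.m<n⇒0<n∸m (ℕₚ.≤-trans (s≤s (ℕₚ.m≤m+n (suc j) (suc j))) 2[j+1]<M)

      1+j≢M∸[1+j] : suc j ≢ M ∸ suc j
      1+j≢M∸[1+j] eq = ℕₚ.<-irrefl eq (subst (_≤ M ∸ suc j) (ℕₚ.+-comm (suc j) 1)
        (m+n≤o⇒m≤o∸n (suc j + 1) (suc j) (subst (_≤ M) (sym (arith j)) 2[j+1]<M)))
        where
        arith : ∀ j → suc j + 1 + suc j ≡ suc (suc j + suc j)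
        arith = solve-∀

      length≡j⇒d≡1+j⊎d≡M∸[1+j] : ∀ d → 1 ≤ d → d < M → (d ∸ 1) ⊓ (M ∸ d ∸ 1) ≡ j → (d ≡ suc j) ⊎ (d ≡ M ∸ suc j)
      length≡j⇒d≡1+j⊎d≡M∸[1+j] (suc d) _ d<M len≡j with ℕₚ.⊓-sel d (M ∸ suc d ∸ 1)
      ... | inj₁ ⊓≡d = inj₁ (cong suc (trans (sym ⊓≡d) len≡j))
      ... | inj₂ ⊓≡other = inj₂ (trans (sym (ℕₚ.m∸[m∸n]≡n (ℕₚ.<⇒≤ d<M)))
        (cong (M ∸_) (trans (sym (ℕₚ.m∸n+n≡m {M ∸ suc d} {1} (ℕₚ.m<n⇒0<n∸m d<M)))
                            (trans (ℕₚ.+-comm (M ∸ suc d ∸ 1) 1) (cong suc (trans (sym ⊓≡other) len≡j))))))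

      d≡1+j⊎d≡M∸[1+j]⇒length≡j : ∀ d → (d ≡ suc j) ⊎ (d ≡ M ∸ suc j) → (d ∸ 1) ⊓ (M ∸ d ∸ 1) ≡ j
      d≡1+j⊎d≡M∸[1+j]⇒length≡j d (inj₁ refl) = ℕₚ.m≤n⇒m⊓n≡m j≤M∸[1+j]∸1
      d≡1+j⊎d≡M∸[1+j]⇒length≡j d (inj₂ refl) = trans (cong (λ z → (M ∸ suc j ∸ 1) ⊓ (z ∸ 1)) (ℕₚ.m∸[m∸n]≡n 1+j≤M))
                                     (ℕₚ.m≥n⇒m⊓n≡n j≤M∸[1+j]∸1)

    slot≡ : ∀ a b → b < M → slot M j a b ≡ χ (b ℕ.≟ a + suc j) + χ (b ℕ.≟ a + (M ∸ suc j))
    slot≡ a b b<M = byCases (a ℕ.<? b)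
      where
      byCases : (d : Dec (a < b)) → χ d * χ (circleDistance M a b ℕ.≟ j) ≡ χ (b ℕ.≟ a + suc j) + χ (b ℕ.≟ a + (M ∸ suc j))
      byCases (no b≤a) = sym (cong₂ _+_
        (χ-no (λ b≡ → b≤a (subst (a <_) (sym b≡) (ℕₚ.m<m+n a (s≤s z≤n)))) (b ℕ.≟ a + suc j))
        (χ-no (λ b≡ → b≤a (subst (a <_) (sym b≡) (ℕₚ.m<m+n a 0<M∸[1+j]))) (b ℕ.≟ a + (M ∸ suc j))))
      byCases (yes a<b) = trans (ℕₚ.+-identityʳ _) (byDistance (d ℕ.≟ suc j) (d ℕ.≟ M ∸ suc j))
        where
        d : ℕ
        d = b ∸ a
        b≡a+d : b ≡ a + d
        b≡a+d = sym (ℕₚ.m+[n∸m]≡n (ℕₚ.<⇒≤ a<b))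
        d≡⇒ : ∀ c → d ≡ c → b ≡ a + c
        d≡⇒ c d≡c = trans b≡a+d (cong (a +_) d≡c)
        ⇒d≡ : ∀ c → b ≡ a + c → d ≡ c
        ⇒d≡ c b≡a+c = ℕₚ.+-cancelˡ-≡ a d c (trans (sym b≡a+d) b≡a+c)
        distance≡ : circleDistance M a b ≡ (d ∸ 1) ⊓ (M ∸ d ∸ 1)
        distance≡ = cong (λ z → (z ∸ 1) ⊓ (M ∸ z ∸ 1)) (ℕₚ.m≤n⇒∣m-n∣≡n∸m (ℕₚ.<⇒≤ a<b))
        byDistance : Dec (d ≡ suc j) → Dec (d ≡ M ∸ suc j) →
                     χ (circleDistance M a b ℕ.≟ j) ≡ χ (b ℕ.≟ a + suc j) + χ (b ℕ.≟ a + (M ∸ suc j))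
        byDistance (yes d≡₁) (yes d≡₂) = ⊥-elim (1+j≢M∸[1+j] (trans (sym d≡₁) d≡₂))
        byDistance (yes d≡₁) (no d≢₂) = trans (χ-yes (trans distance≡ (d≡1+j⊎d≡M∸[1+j]⇒length≡j d (inj₁ d≡₁))) (circleDistance M a b ℕ.≟ j))
          (sym (cong₂ _+_ (χ-yes (d≡⇒ (suc j) d≡₁) (b ℕ.≟ a + suc j)) (χ-no (d≢₂ ∘′ ⇒d≡ (M ∸ suc j)) (b ℕ.≟ a + (M ∸ suc j)))))
        byDistance (no d≢₁) (yes d≡₂) = trans (χ-yes (trans distance≡ (d≡1+j⊎d≡M∸[1+j]⇒length≡j d (inj₂ d≡₂))) (circleDistance M a b ℕ.≟ j))
          (sym (cong₂ _+_ (χ-no (d≢₁ ∘′ ⇒d≡ (suc j)) (b ℕ.≟ a + suc j)) (χ-yes (d≡⇒ (M ∸ suc j) d≡₂) (b ℕ.≟ a + (M ∸ suc j)))))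
        byDistance (no d≢₁) (no d≢₂) = trans (χ-no ¬length≡j (circleDistance M a b ℕ.≟ j))
          (sym (cong₂ _+_ (χ-no (d≢₁ ∘′ ⇒d≡ (suc j)) (b ℕ.≟ a + suc j)) (χ-no (d≢₂ ∘′ ⇒d≡ (M ∸ suc j)) (b ℕ.≟ a + (M ∸ suc j)))))
          where
          ¬length≡j : ¬ (circleDistance M a b ≡ j)
          ¬length≡j len≡j with length≡j⇒d≡1+j⊎d≡M∸[1+j] d (ℕₚ.m<n⇒0<n∸m a<b) (ℕₚ.≤-<-trans (ℕₚ.m∸n≤m b a) b<M) (trans (sym distance≡) len≡j)
          ... | inj₁ d≡₁ = d≢₁ d≡₁
          ... | inj₂ d≡₂ = d≢₂ d≡₂

    ∑∑-slot : ∑[ x < M ] ∑[ y < M ] slot M j (toℕ x) (toℕ y) ≡ M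
    ∑∑-slot = begin
      ∑[ x < M ] ∑[ y < M ] slot M j (toℕ x) (toℕ y)
        ≡⟨ sum-cong-≗ {M} (λ x → trans (sum-cong-≗ {M} (λ y → slot≡ (toℕ x) (toℕ y) (FinP.toℕ<n y)))
                                   (trans (∑-distrib-+ {M} (λ y → χ (toℕ y ℕ.≟ toℕ x + suc j)) (λ y → χ (toℕ y ℕ.≟ toℕ x + (M ∸ suc j))))
                                          (cong₂ _+_ (∑-χ[toℕ≡c] M (toℕ x + suc j)) (∑-χ[toℕ≡c] M (toℕ x + (M ∸ suc j)))))) ⟩
      ∑[ x < M ] (χ (toℕ x + suc j ℕ.<? M) + χ (toℕ x + (M ∸ suc j) ℕ.<? M))
        ≡⟨ ∑-distrib-+ {M} (λ x → χ (toℕ x + suc j ℕ.<? M)) (λ x → χ (toℕ x + (M ∸ suc j) ℕ.<? M)) ⟩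
      ∑[ x < M ] χ (toℕ x + suc j ℕ.<? M) + ∑[ x < M ] χ (toℕ x + (M ∸ suc j) ℕ.<? M)
        ≡⟨ cong₂ _+_ (∑-χ[toℕ+d<M] M (suc j) 1+j≤M) (∑-χ[toℕ+d<M] M (M ∸ suc j) (ℕₚ.m∸n≤m M (suc j))) ⟩
      (M ∸ suc j) + (M ∸ (M ∸ suc j))
        ≡⟨ cong ((M ∸ suc j) +_) (ℕₚ.m∸[m∸n]≡n 1+j≤M) ⟩
      (M ∸ suc j) + suc j
        ≡⟨ ℕₚ.m∸n+n≡m 1+j≤M ⟩
      M ∎
      where open ≡-Reasoning

    ∑-slot-row≤2 : ∀ a → ∑[ y < M ] slot M j a (toℕ y) ≤ 2
    ∑-slot-row≤2 a = ℕₚ.≤-trans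
      (ℕₚ.≤-reflexive (trans (sum-cong-≗ {M} (λ y → slot≡ a (toℕ y) (FinP.toℕ<n y)))
                             (∑-distrib-+ {M} (λ y → χ (toℕ y ℕ.≟ a + suc j)) (λ y → χ (toℕ y ℕ.≟ a + (M ∸ suc j))))))
      (ℕₚ.+-mono-≤ (∑-χ[toℕ≡c]≤1 M (a + suc j)) (∑-χ[toℕ≡c]≤1 M (a + (M ∸ suc j))))

    ∑-slot-column≤2 : ∀ b → b < M → ∑[ x < M ] slot M j (toℕ x) b ≤ 2
    ∑-slot-column≤2 b b<M = ℕₚ.≤-trans
      (ℕₚ.≤-reflexive (trans (sum-cong-≗ {M} (λ x → slot≡ (toℕ x) b b<M))
                             (∑-distrib-+ {M} (λ x → χ (b ℕ.≟ toℕ x + suc j)) (λ x → χ (b ℕ.≟ toℕ x + (M ∸ suc j))))))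
      (ℕₚ.+-mono-≤ (∑-χ[c≡toℕ+d]≤1 M b (suc j)) (∑-χ[c≡toℕ+d]≤1 M b (M ∸ suc j)))


module FactorialMoments where

  open import Data.Nat as ℕ using (ℕ; zero; suc; _+_; _*_; _≤_; _<_; _∸_; _^_; z≤n; s≤s)
  import Data.Nat.Properties as ℕₚ
  open import Data.Nat.Tactic.RingSolver using (solve-∀)
  open import Data.Fin as Fin using (Fin; toℕ)
  import Data.Fin.Properties as FinP
  open import Data.Vec using (lookup)
  open import Data.List as List using (List; []; _∷_; length; allFin)
  open import Data.List.Relation.Unary.Any using (here; there)
  open import Data.List.Relation.Unary.All as All using (All)
  open import Data.List.Relation.Unary.All.Properties using (All¬⇒¬Any; ¬Any⇒All¬)
  open import Data.List.Relation.Unary.AllPairs using ([]; _∷_)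
  open import Data.List.Membership.Propositional using (_∈_; _∉_)
  open import Data.Product using (∃-syntax; _×_; _,_; proj₁; proj₂)
  open import Data.Product.Properties using () renaming (≡-dec to ×-≡-dec)
  open import Data.Sum using (_⊎_; inj₁; inj₂)
  open import Data.Empty using (⊥-elim)
  open import Function using (_∘_)
  open import Data.Vec.Functional using (updateAt)
  open import Data.Vec.Functional.Properties using (updateAt-updates; updateAt-minimal)
  open import Relation.Binary.PropositionalEquality
  open import Relation.Nullary using (Dec; yes; no; ¬_; ¬?)
  open import Relation.Nullary.Decidable using (_×-dec_)
  open import Defs
  open Indicators
  open FiniteSums
  open BonferroniInequalities using (_↓_)
  open ChordSlots
  open PerfectMatchings

  module Chords (n : ℕ) where
    open PartialMatchings n public
    open import Data.List.Membership.DecPropositional (Fin._≟_ {M}) using (_∈?_)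
    open import Data.List.Membership.DecPropositional (×-≡-dec (Fin._≟_ {M}) (Fin._≟_ {M})) using () renaming (_∈?_ to _∈ᶜ?_)

    lengthSlot : ℕ → Fin M → Fin M → ℕ
    lengthSlot j x y = slot M j (toℕ x) (toℕ y)

    numChordsOfLength≡ : ∀ v j → numChordsOfLength n v j ≡ ∑[ x < M ] ∑[ y < M ] (χ (lookup v x Fin.≟ y) * lengthSlot j x y)
    numChordsOfLength≡ v j = trans (length-filter≡sumℕ-χ _ (allFin M)) (trans (sumℕ-allFin M _) (sum-cong-≗ {M} λ x →
      trans (χ-× (toℕ x ℕ.<? toℕ (lookup v x)) (chordLength n x (lookup v x) ℕ.≟ j)) (sym (∑-δ (lookup v x) (lengthSlot j x)))))

    multiplicity : List Chord → Fin M → Fin M → ℕ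
    multiplicity []             x y = 0
    multiplicity ((a , b) ∷ P) x y = χ (a Fin.≟ x) * χ (b Fin.≟ y) + multiplicity P x y

    ∑∑-multiplicity : ∀ P (g : Fin M → Fin M → ℕ) →
                      ∑[ x < M ] ∑[ y < M ] (multiplicity P x y * g x y) ≡ sumℕ P (λ c → g (proj₁ c) (proj₂ c))
    ∑∑-multiplicity []             g = ∑-zero M (λ x → ∑-zero M (λ y → refl))
    ∑∑-multiplicity ((a , b) ∷ P) g = begin
      ∑[ x < M ] ∑[ y < M ] ((χ (a Fin.≟ x) * χ (b Fin.≟ y) + multiplicity P x y) * g x y)
        ≡⟨ sum-cong-≗ {M} (λ x → trans (sum-cong-≗ {M} (λ y → ℕₚ.*-distribʳ-+ (g x y) (χ (a Fin.≟ x) * χ (b Fin.≟ y)) (multiplicity P x y)))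
                                       (∑-distrib-+ {M} (λ y → χ (a Fin.≟ x) * χ (b Fin.≟ y) * g x y) (λ y → multiplicity P x y * g x y))) ⟩
      ∑[ x < M ] (∑[ y < M ] (χ (a Fin.≟ x) * χ (b Fin.≟ y) * g x y) + ∑[ y < M ] (multiplicity P x y * g x y))
        ≡⟨ ∑-distrib-+ {M} (λ x → ∑[ y < M ] (χ (a Fin.≟ x) * χ (b Fin.≟ y) * g x y)) (λ x → ∑[ y < M ] (multiplicity P x y * g x y)) ⟩
      ∑[ x < M ] ∑[ y < M ] (χ (a Fin.≟ x) * χ (b Fin.≟ y) * g x y) + ∑[ x < M ] ∑[ y < M ] (multiplicity P x y * g x y)
        ≡⟨ cong₂ _+_ δδ (∑∑-multiplicity P g) ⟩
      g a b + sumℕ P (λ c → g (proj₁ c) (proj₂ c)) ∎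
      where
      open ≡-Reasoning
      δδ : ∑[ x < M ] ∑[ y < M ] (χ (a Fin.≟ x) * χ (b Fin.≟ y) * g x y) ≡ g a b
      δδ = trans (sum-cong-≗ {M} (λ x → trans (sum-cong-≗ {M} (λ y → ℕₚ.*-assoc (χ (a Fin.≟ x)) (χ (b Fin.≟ y)) (g x y)))
                                                 (sym (*-distribˡ-sum (χ (a Fin.≟ x)) (λ y → χ (b Fin.≟ y) * g x y)))))
                 (trans (∑-δ a (λ x → ∑[ y < M ] (χ (b Fin.≟ y) * g x y))) (∑-δ b (g a)))

    multiplicity-uncovered : ∀ P {x} y → x ∉ points P → multiplicity P x y ≡ 0
    multiplicity-uncovered []             y x∉ = refl
    multiplicity-uncovered ((a , b) ∷ P) y x∉ =
      cong₂ _+_ (cong (_* χ (b Fin.≟ y)) (χ-no (λ a≡x → x∉ (here (sym a≡x))) (a Fin.≟ _))) (multiplicity-uncovered P y (x∉ ∘ there ∘ there))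

    multiplicity-∈ : ∀ P → Valid P → ∀ {x y} → (x , y) ∈ P → multiplicity P x y ≡ 1
    multiplicity-∈ ((a , b) ∷ P) (a≢ ∷ _) (here refl) = cong₂ _+_
      (cong₂ _*_ (χ-yes refl (a Fin.≟ a)) (χ-yes refl (b Fin.≟ b))) (multiplicity-uncovered P b (All¬⇒¬Any a≢ ∘ there))
    multiplicity-∈ ((a , b) ∷ P) (a≢ ∷ _ ∷ valid) {x} {y} (there xy∈) = trans
      (cong (λ k → k * χ (b Fin.≟ y) + multiplicity P x y) (χ-no (All.lookup a≢ (there (proj₁ (∈⇒∈points P xy∈)))) (a Fin.≟ x)))
      (multiplicity-∈ P valid xy∈)

    multiplicity-∉ : ∀ P {x y} → (x , y) ∉ P → multiplicity P x y ≡ 0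
    multiplicity-∉ []             xy∉ = refl
    multiplicity-∉ ((a , b) ∷ P) {x} {y} xy∉ = cong₂ _+_ (byCases (a Fin.≟ x) (b Fin.≟ y)) (multiplicity-∉ P (xy∉ ∘ there))
      where
      byCases : (d : Dec (a ≡ x)) (e : Dec (b ≡ y)) → χ d * χ e ≡ 0
      byCases (yes refl) (yes refl) = ⊥-elim (xy∉ (here refl))
      byCases (yes _)    (no _)     = refl
      byCases (no _)     _          = refl

    countLength : ℕ → List Chord → ℕ
    countLength j P = sumℕ P (λ c → lengthSlot j (proj₁ c) (proj₂ c))

    Oriented : List Chord → Set
    Oriented P = All (λ c → toℕ (proj₁ c) < toℕ (proj₂ c)) P

    free? : ∀ P x y → Dec ((x ∉ points P) × (y ∉ points P))
    free? P x y = ¬? (x ∈? points P) ×-dec ¬? (y ∈? points P)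

    ¬free⇒touching : ∀ P x y → ¬ ((x ∉ points P) × (y ∉ points P)) → (x ∈ points P) ⊎ (y ∈ points P)
    ¬free⇒touching P x y ¬free with x ∈? points P | y ∈? points P
    ... | yes x∈ | _      = inj₁ x∈
    ... | no _   | yes y∈ = inj₂ y∈
    ... | no x∉  | no y∉  = ⊥-elim (¬free (x∉ , y∉))

    -- v is an involution, so a chord of v sharing an endpoint with a chord of P is that chord.
    touching⇒∈ : ∀ P → Oriented P → ∀ v → IsChordDiagram n v → Contains P v → ∀ {x y} →
                 lookup v x ≡ y → toℕ x < toℕ y → (x ∈ points P) ⊎ (y ∈ points P) → (x , y) ∈ P
    touching⇒∈ P oriented v isCD contP {x} {y} vx≡y x<y (inj₁ x∈) with ∈points⇒ P x∈
    ... | a , b , ab∈ , inj₁ refl = subst (λ z → (x , z) ∈ P) (trans (sym (All.lookup contP ab∈)) vx≡y) ab∈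
    ... | a , b , ab∈ , inj₂ refl = ⊥-elim (ℕₚ.<-asym x<y (subst (λ z → toℕ z < toℕ x) a≡y (All.lookup oriented ab∈)))
      where
      a≡y : a ≡ y
      a≡y = trans (sym (proj₁ (isCD a))) (trans (cong (lookup v) (All.lookup contP ab∈)) vx≡y)
    touching⇒∈ P oriented v isCD contP {x} {y} vx≡y x<y (inj₂ y∈) with ∈points⇒ P y∈
    ... | a , b , ab∈ , inj₁ refl = ⊥-elim (ℕₚ.<-asym x<y (subst (λ z → toℕ y < toℕ z) b≡x (All.lookup oriented ab∈)))
      where
      b≡x : b ≡ x
      b≡x = trans (sym (All.lookup contP ab∈)) (trans (sym (cong (lookup v) vx≡y)) (proj₁ (isCD x)))
    ... | a , b , ab∈ , inj₂ refl = subst (λ z → (z , y) ∈ P) a≡x ab∈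
      where
      a≡x : a ≡ x
      a≡x = trans (sym (proj₁ (isCD a))) (trans (cong (lookup v) (trans (All.lookup contP ab∈) (sym vx≡y))) (proj₁ (isCD x)))

    numChordsOfLength-remaining :
      ∀ P → Valid P → Oriented P → ∀ v → IsChordDiagram n v → Contains P v → ∀ j →
      numChordsOfLength n v j ∸ countLength j P ≡ ∑[ x < M ] ∑[ y < M ] (χ (lookup v x Fin.≟ y) * lengthSlot j x y * χ (free? P x y))
    numChordsOfLength-remaining P valid oriented v isCD contP j =
      trans (cong (_∸ countLength j P) split) (ℕₚ.m+n∸n≡m Free (countLength j P))
      where
      Free : ℕ
      Free = ∑[ x < M ] ∑[ y < M ] (χ (lookup v x Fin.≟ y) * lengthSlot j x y * χ (free? P x y))

      touching : ∀ x y → χ (lookup v x Fin.≟ y) * lengthSlot j x y * χ (¬? (free? P x y)) ≡ multiplicity P x y * lengthSlot j x y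
      touching x y = byCases ((x , y) ∈ᶜ? P)
        where
        byCases : Dec ((x , y) ∈ P) → χ (lookup v x Fin.≟ y) * lengthSlot j x y * χ (¬? (free? P x y)) ≡ multiplicity P x y * lengthSlot j x y
        byCases (yes xy∈) = trans
          (cong₂ (λ a b → a * lengthSlot j x y * b) (χ-yes (All.lookup contP xy∈) (lookup v x Fin.≟ y))
                                                    (χ-yes (λ free → proj₁ free (proj₁ (∈⇒∈points P xy∈))) (¬? (free? P x y))))
          (trans (ℕₚ.*-identityʳ (1 * lengthSlot j x y)) (cong (_* lengthSlot j x y) (sym (multiplicity-∈ P valid xy∈))))
        byCases (no xy∉) = trans (vanish (lookup v x Fin.≟ y) (toℕ x ℕ.<? toℕ y) (¬? (free? P x y)))
                                 (sym (cong (_* lengthSlot j x y) (multiplicity-∉ P xy∉)))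
          where
          vanish : (d₁ : Dec (lookup v x ≡ y)) (d₂ : Dec (toℕ x < toℕ y)) (d₃ : Dec (¬ ((x ∉ points P) × (y ∉ points P)))) →
                   χ d₁ * (χ d₂ * χ (chordLength n x y ℕ.≟ j)) * χ d₃ ≡ 0
          vanish (no _)      _           _            = refl
          vanish (yes _)     (no _)      _            = refl
          vanish (yes _)     (yes _)     (no _)       = ℕₚ.*-zeroʳ (1 * (1 * χ (chordLength n x y ℕ.≟ j)))
          vanish (yes vx≡y)  (yes x<y)   (yes ¬free)  = ⊥-elim (xy∉ (touching⇒∈ P oriented v isCD contP vx≡y x<y (¬free⇒touching P x y ¬free)))

      split : numChordsOfLength n v j ≡ Free + countLength j P
      split = begin
        numChordsOfLength n v j
          ≡⟨ numChordsOfLength≡ v j ⟩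
        ∑[ x < M ] ∑[ y < M ] (χ (lookup v x Fin.≟ y) * lengthSlot j x y)
          ≡⟨ sum-cong-≗ {M} (λ x → trans (sum-cong-≗ {M} (λ y → decompose x y)) (∑-distrib-+ {M} _ _)) ⟩
        ∑[ x < M ] (∑[ y < M ] (χ (lookup v x Fin.≟ y) * lengthSlot j x y * χ (free? P x y))
                    + ∑[ y < M ] (χ (lookup v x Fin.≟ y) * lengthSlot j x y * χ (¬? (free? P x y))))
          ≡⟨ ∑-distrib-+ {M} _ _ ⟩
        Free + ∑[ x < M ] ∑[ y < M ] (χ (lookup v x Fin.≟ y) * lengthSlot j x y * χ (¬? (free? P x y)))
          ≡⟨ cong (Free +_) (trans (sum-cong-≗ {M} (λ x → sum-cong-≗ {M} (touching x))) (∑∑-multiplicity P (lengthSlot j))) ⟩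
        Free + countLength j P ∎
        where
        open ≡-Reasoning
        decompose : ∀ x y → χ (lookup v x Fin.≟ y) * lengthSlot j x y ≡
                    χ (lookup v x Fin.≟ y) * lengthSlot j x y * χ (free? P x y) + χ (lookup v x Fin.≟ y) * lengthSlot j x y * χ (¬? (free? P x y))
        decompose x y = trans (sym (ℕₚ.*-identityʳ _)) (trans (cong (χ (lookup v x Fin.≟ y) * lengthSlot j x y *_) (sym (χ+χ¬≡1 (free? P x y))))
                                                              (ℕₚ.*-distribˡ-+ (χ (lookup v x Fin.≟ y) * lengthSlot j x y) (χ (free? P x y)) (χ (¬? (free? P x y)))))

    lengthSlot-unique : ∀ j₀ x y → lengthSlot j₀ x y ≡ 1 → ∀ j → lengthSlot j x y ≡ χ (j₀ ℕ.≟ j)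
    lengthSlot-unique j₀ x y slot≡1 j = byCases (toℕ x ℕ.<? toℕ y) (chordLength n x y ℕ.≟ j₀) slot≡1
      where
      byCases : (d₁ : Dec (toℕ x < toℕ y)) (d₂ : Dec (chordLength n x y ≡ j₀)) → χ d₁ * χ d₂ ≡ 1 →
                χ d₁ * χ (chordLength n x y ℕ.≟ j) ≡ χ (j₀ ℕ.≟ j)
      byCases (yes _) (yes len≡j₀) _ = trans (ℕₚ.+-identityʳ _) (χ-⇔ (trans (sym len≡j₀)) (trans len≡j₀) (chordLength n x y ℕ.≟ j) (j₀ ℕ.≟ j))
      byCases (yes _) (no _)       ()
      byCases (no _)  _            ()

    lengthSlot-oriented : ∀ j x y → lengthSlot j x y ≡ 1 → toℕ x < toℕ y
    lengthSlot-oriented j x y slot≡1 = byCases (toℕ x ℕ.<? toℕ y) slot≡1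
      where
      byCases : (d : Dec (toℕ x < toℕ y)) → χ d * χ (chordLength n x y ℕ.≟ j) ≡ 1 → toℕ x < toℕ y
      byCases (yes x<y) _ = x<y
      byCases (no _)    ()

    admissible-01 : ∀ j₀ P x y → (lengthSlot j₀ x y * χ (free? P x y) ≡ 0) ⊎ ((lengthSlot j₀ x y ≡ 1) × (χ (free? P x y) ≡ 1))
    admissible-01 j₀ P x y with χ≡0⊎χ≡1 (toℕ x ℕ.<? toℕ y) | χ≡0⊎χ≡1 (chordLength n x y ℕ.≟ j₀) | χ≡0⊎χ≡1 (free? P x y)
    ... | inj₁ e₁ | _       | _       = inj₁ (cong (λ z → z * χ (chordLength n x y ℕ.≟ j₀) * χ (free? P x y)) e₁)
    ... | inj₂ e₁ | inj₁ e₂ | _       = inj₁ (cong₂ (λ a b → a * b * χ (free? P x y)) e₁ e₂)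
    ... | inj₂ e₁ | inj₂ e₂ | inj₁ e₃ = inj₁ (cong₂ _*_ (cong₂ _*_ e₁ e₂) e₃)
    ... | inj₂ e₁ | inj₂ e₂ | inj₂ e₃ = inj₂ (cong₂ _*_ e₁ e₂ , e₃)

    admissible-extends : ∀ j₀ P → Valid P → Oriented P → ∀ x y → lengthSlot j₀ x y ≡ 1 → χ (free? P x y) ≡ 1 →
                         Valid ((x , y) ∷ P) × Oriented ((x , y) ∷ P)
    admissible-extends j₀ P valid oriented x y slot≡1 = byCases (free? P x y)
      where
      x<y : toℕ x < toℕ y
      x<y = lengthSlot-oriented j₀ x y slot≡1
      byCases : (d : Dec ((x ∉ points P) × (y ∉ points P))) → χ d ≡ 1 → Valid ((x , y) ∷ P) × Oriented ((x , y) ∷ P)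
      byCases (yes (x∉ , y∉)) _ = (¬Any⇒All¬ (y ∷ points P) x∉′ ∷ ¬Any⇒All¬ (points P) y∉ ∷ valid) , (x<y All.∷ oriented)
        where
        x∉′ : x ∉ y ∷ points P
        x∉′ (here x≡y)  = ℕₚ.<-irrefl (cong toℕ x≡y) x<y
        x∉′ (there x∈) = x∉ x∈
      byCases (no _) ()

    module _ (j : ℕ) (2[j+1]<M : suc j + suc j < M) where

      private
        χ-¬free≤ : ∀ P x y → χ (¬? (free? P x y)) ≤ χ (x ∈? points P) + χ (y ∈? points P)
        χ-¬free≤ P x y with x ∈? points P | y ∈? points P
        ... | yes _ | _     = s≤s z≤n
        ... | no _  | yes _ = s≤s z≤n
        ... | no _  | no _  = z≤n

        ∑-covered*2 : ∀ P → Valid P → ∑[ x < M ] (χ (x ∈? points P) * 2) ≡ 2 * (length P + length P)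
        ∑-covered*2 P valid = trans (sym (*-distribʳ-sum 2 (λ x → χ (x ∈? points P))))
          (trans (cong (_* 2) (trans (count-members (points P) valid) (length-points P))) (ℕₚ.*-comm (length P + length P) 2))

      ∑∑-touching≤ : ∀ P → Valid P → ∑[ x < M ] ∑[ y < M ] (lengthSlot j x y * χ (¬? (free? P x y))) ≤ 8 * length P
      ∑∑-touching≤ P valid = begin
        ∑[ x < M ] ∑[ y < M ] (lengthSlot j x y * χ (¬? (free? P x y)))
          ≤⟨ ∑-mono-≤ {M} (λ x → ∑-mono-≤ {M} (λ y → ℕₚ.*-monoʳ-≤ (lengthSlot j x y) (χ-¬free≤ P x y))) ⟩
        ∑[ x < M ] ∑[ y < M ] (lengthSlot j x y * (χ (x ∈? points P) + χ (y ∈? points P)))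
          ≡⟨ sum-cong-≗ {M} (λ x → trans (sum-cong-≗ {M} (λ y → ℕₚ.*-distribˡ-+ (lengthSlot j x y) (χ (x ∈? points P)) (χ (y ∈? points P))))
                                         (∑-distrib-+ {M} _ _)) ⟩
        ∑[ x < M ] (∑[ y < M ] (lengthSlot j x y * χ (x ∈? points P)) + ∑[ y < M ] (lengthSlot j x y * χ (y ∈? points P)))
          ≡⟨ trans (∑-distrib-+ {M} _ _) (cong (∑[ x < M ] ∑[ y < M ] (lengthSlot j x y * χ (x ∈? points P)) +_) (∑-comm {M} {M} _)) ⟩
        ∑[ x < M ] ∑[ y < M ] (lengthSlot j x y * χ (x ∈? points P)) + ∑[ y < M ] ∑[ x < M ] (lengthSlot j x y * χ (y ∈? points P))
          ≡⟨ cong₂ _+_ (sum-cong-≗ {M} (λ x → trans (sum-cong-≗ {M} (λ y → ℕₚ.*-comm (lengthSlot j x y) (χ (x ∈? points P))))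
                                                   (sym (*-distribˡ-sum (χ (x ∈? points P)) (lengthSlot j x)))))
                       (sum-cong-≗ {M} (λ y → trans (sum-cong-≗ {M} (λ x → ℕₚ.*-comm (lengthSlot j x y) (χ (y ∈? points P))))
                                                   (sym (*-distribˡ-sum (χ (y ∈? points P)) (λ x → lengthSlot j x y))))) ⟩
        ∑[ x < M ] (χ (x ∈? points P) * ∑[ y < M ] lengthSlot j x y) + ∑[ y < M ] (χ (y ∈? points P) * ∑[ x < M ] lengthSlot j x y)
          ≤⟨ ℕₚ.+-mono-≤ (∑-mono-≤ {M} (λ x → ℕₚ.*-monoʳ-≤ (χ (x ∈? points P)) (∑-slot-row≤2 M j 2[j+1]<M (toℕ x))))
                         (∑-mono-≤ {M} (λ y → ℕₚ.*-monoʳ-≤ (χ (y ∈? points P)) (∑-slot-column≤2 M j 2[j+1]<M (toℕ y) (FinP.toℕ<n y)))) ⟩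
        ∑[ x < M ] (χ (x ∈? points P) * 2) + ∑[ y < M ] (χ (y ∈? points P) * 2)
          ≡⟨ cong₂ _+_ (∑-covered*2 P valid) (∑-covered*2 P valid) ⟩
        2 * (length P + length P) + 2 * (length P + length P)
          ≡⟨ arith (length P) ⟩
        8 * length P ∎
        where
        open ℕₚ.≤-Reasoning
        arith : ∀ p → 2 * (p + p) + 2 * (p + p) ≡ 8 * p
        arith = solve-∀

      ∑∑-admissible≥ : ∀ P → Valid P → M ∸ 8 * length P ≤ ∑[ x < M ] ∑[ y < M ] (lengthSlot j x y * χ (free? P x y))
      ∑∑-admissible≥ P valid = begin
        M ∸ 8 * length P                    ≤⟨ ℕₚ.∸-monoʳ-≤ M (∑∑-touching≤ P valid) ⟩
        M ∸ Touching                        ≡⟨ cong (_∸ Touching) total ⟨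
        Admissible + Touching ∸ Touching    ≡⟨ ℕₚ.m+n∸n≡m Admissible Touching ⟩
        Admissible                          ∎
        where
        open ℕₚ.≤-Reasoning
        Admissible Touching : ℕ
        Admissible = ∑[ x < M ] ∑[ y < M ] (lengthSlot j x y * χ (free? P x y))
        Touching   = ∑[ x < M ] ∑[ y < M ] (lengthSlot j x y * χ (¬? (free? P x y)))
        total : Admissible + Touching ≡ M
        total = trans (sym (∑-distrib-+ {M} _ _))
          (trans (sum-cong-≗ {M} (λ x → trans (sym (∑-distrib-+ {M} _ _))
                    (sum-cong-≗ {M} (λ y → trans (sym (ℕₚ.*-distribˡ-+ (lengthSlot j x y) (χ (free? P x y)) (χ (¬? (free? P x y)))))
                                                 (trans (cong (lengthSlot j x y *_) (χ+χ¬≡1 (free? P x y))) (ℕₚ.*-identityʳ _))))))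
                 (∑∑-slot M j 2[j+1]<M))

    module RestrictedMoments (k : ℕ) (2[k+1]<M : suc k + suc k < M) where

      2[j+1]<M : ∀ (j : Fin (suc k)) → suc (toℕ j) + suc (toℕ j) < M
      2[j+1]<M j = ℕₚ.≤-<-trans (ℕₚ.+-mono-≤ (s≤s (ℕₚ.≤-pred (FinP.toℕ<n j))) (s≤s (ℕₚ.≤-pred (FinP.toℕ<n j)))) 2[k+1]<M

      weight : List Chord → (Fin (suc k) → ℕ) → Diagram n → ℕ
      weight P r v = product (λ j → (numChordsOfLength n v (toℕ j) ∸ countLength (toℕ j) P) ↓ r j)

      -- The r-th joint factorial moment of the chord counts, restricted to diagrams containing P and with the chords of P discounted.
      restrictedMoment : List Chord → (Fin (suc k) → ℕ) → ℕ
      restrictedMoment P r = sumℕ (chordDiagrams n) (λ v → χ (contains? P v) * weight P r v)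

      module _ (P : List Chord) (valid : Valid P) (oriented : Oriented P) (r : Fin (suc k) → ℕ) (j₀ : Fin (suc k)) (0<r : 0 < r j₀) where
        private
          r⁻ : Fin (suc k) → ℕ
          r⁻ = updateAt r j₀ ℕ.pred

          reduced : Diagram n → ℕ
          reduced v = product (λ j → (numChordsOfLength n v (toℕ j) ∸ (χ (toℕ j₀ ℕ.≟ toℕ j) + countLength (toℕ j) P)) ↓ r⁻ j)

          weight-extract : ∀ v → weight P r v ≡ (numChordsOfLength n v (toℕ j₀) ∸ countLength (toℕ j₀) P) * reduced v
          weight-extract v = product-extract _ _ j₀ A at-j₀ elsewhere
            where
            A : ℕ
            A = numChordsOfLength n v (toℕ j₀) ∸ countLength (toℕ j₀) P
            at-j₀ : A ↓ r j₀ ≡ A * (numChordsOfLength n v (toℕ j₀) ∸ (χ (toℕ j₀ ℕ.≟ toℕ j₀) + countLength (toℕ j₀) P)) ↓ r⁻ j₀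
            at-j₀ = begin
              A ↓ r j₀                                     ≡⟨ cong (A ↓_) (ℕₚ.suc-pred (r j₀) {{ℕ.>-nonZero 0<r}}) ⟨
              A ↓ suc (ℕ.pred (r j₀))                      ≡⟨⟩
              A * (A ∸ 1) ↓ ℕ.pred (r j₀)                  ≡⟨ cong₂ (λ a b → A * a ↓ b) A∸1≡ (sym (updateAt-updates j₀ r)) ⟩
              A * (numChordsOfLength n v (toℕ j₀) ∸ (χ (toℕ j₀ ℕ.≟ toℕ j₀) + countLength (toℕ j₀) P)) ↓ r⁻ j₀ ∎
              where
              open ≡-Reasoning
              A∸1≡ : A ∸ 1 ≡ numChordsOfLength n v (toℕ j₀) ∸ (χ (toℕ j₀ ℕ.≟ toℕ j₀) + countLength (toℕ j₀) P)
              A∸1≡ = trans (ℕₚ.∸-+-assoc (numChordsOfLength n v (toℕ j₀)) (countLength (toℕ j₀) P) 1)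
                           (cong (numChordsOfLength n v (toℕ j₀) ∸_)
                                 (trans (ℕₚ.+-comm (countLength (toℕ j₀) P) 1) (cong (_+ countLength (toℕ j₀) P) (sym (χ-yes refl (toℕ j₀ ℕ.≟ toℕ j₀))))))
            elsewhere : ∀ j → j ≢ j₀ → (numChordsOfLength n v (toℕ j) ∸ countLength (toℕ j) P) ↓ r j
                                     ≡ (numChordsOfLength n v (toℕ j) ∸ (χ (toℕ j₀ ℕ.≟ toℕ j) + countLength (toℕ j) P)) ↓ r⁻ j
            elsewhere j j≢j₀ = cong₂ (λ c r′ → (numChordsOfLength n v (toℕ j) ∸ (c + countLength (toℕ j) P)) ↓ r′)
              (sym (χ-no (λ J≡j → j≢j₀ (FinP.toℕ-injective (sym J≡j))) (toℕ j₀ ℕ.≟ toℕ j)))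
              (sym (updateAt-minimal j j₀ r j≢j₀))

          weight-cons : ∀ v x y → lengthSlot (toℕ j₀) x y ≡ 1 → weight ((x , y) ∷ P) r⁻ v ≡ reduced v
          weight-cons v x y slot≡1 = product-cong {suc k} (λ j →
            cong (λ c → (numChordsOfLength n v (toℕ j) ∸ (c + countLength (toℕ j) P)) ↓ r⁻ j) (lengthSlot-unique (toℕ j₀) x y slot≡1 (toℕ j)))

          pointwise : ∀ v → IsChordDiagram n v → (d : Dec (Contains P v)) →
                      χ d * weight P r v ≡
                      ∑[ x < M ] ∑[ y < M ] (lengthSlot (toℕ j₀) x y * χ (free? P x y) * (χ (lookup v x Fin.≟ y) * χ d * weight ((x , y) ∷ P) r⁻ v))
          pointwise v isCD (no _) = sym (∑-zero M (λ x → ∑-zero M (λ y →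
            vanish (lengthSlot (toℕ j₀) x y) (χ (free? P x y)) (χ (lookup v x Fin.≟ y)) (weight ((x , y) ∷ P) r⁻ v))))
            where
            vanish : ∀ s f c w → s * f * (c * 0 * w) ≡ 0
            vanish = solve-∀
          pointwise v isCD (yes contP) = begin
            1 * weight P r v
              ≡⟨ ℕₚ.+-identityʳ (weight P r v) ⟩
            weight P r v
              ≡⟨ weight-extract v ⟩
            (numChordsOfLength n v (toℕ j₀) ∸ countLength (toℕ j₀) P) * reduced v
              ≡⟨ cong (_* reduced v) (numChordsOfLength-remaining P valid oriented v isCD contP (toℕ j₀)) ⟩
            ∑[ x < M ] ∑[ y < M ] (χ (lookup v x Fin.≟ y) * lengthSlot (toℕ j₀) x y * χ (free? P x y)) * reduced v
              ≡⟨ trans (*-distribʳ-sum {M} (reduced v) (λ x → ∑[ y < M ] (χ (lookup v x Fin.≟ y) * lengthSlot (toℕ j₀) x y * χ (free? P x y))))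
                       (sum-cong-≗ {M} (λ x → *-distribʳ-sum {M} (reduced v) (λ y → χ (lookup v x Fin.≟ y) * lengthSlot (toℕ j₀) x y * χ (free? P x y)))) ⟩
            ∑[ x < M ] ∑[ y < M ] (χ (lookup v x Fin.≟ y) * lengthSlot (toℕ j₀) x y * χ (free? P x y) * reduced v)
              ≡⟨ sum-cong-≗ {M} (λ x → sum-cong-≗ {M} (λ y → perChord x y (admissible-01 (toℕ j₀) P x y))) ⟩
            ∑[ x < M ] ∑[ y < M ] (lengthSlot (toℕ j₀) x y * χ (free? P x y) * (χ (lookup v x Fin.≟ y) * 1 * weight ((x , y) ∷ P) r⁻ v)) ∎
            where
            open ≡-Reasoning
            perChord : ∀ x y → (lengthSlot (toℕ j₀) x y * χ (free? P x y) ≡ 0) ⊎ ((lengthSlot (toℕ j₀) x y ≡ 1) × (χ (free? P x y) ≡ 1)) →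
                       χ (lookup v x Fin.≟ y) * lengthSlot (toℕ j₀) x y * χ (free? P x y) * reduced v ≡
                       lengthSlot (toℕ j₀) x y * χ (free? P x y) * (χ (lookup v x Fin.≟ y) * 1 * weight ((x , y) ∷ P) r⁻ v)
            perChord x y (inj₁ sf≡0) = begin
              c * s * f * reduced v           ≡⟨ cong (_* reduced v) (ℕₚ.*-assoc c s f) ⟩
              c * (s * f) * reduced v         ≡⟨ cong (λ z → c * z * reduced v) sf≡0 ⟩
              c * 0 * reduced v               ≡⟨ cong (_* reduced v) (ℕₚ.*-zeroʳ c) ⟩
              0                               ≡⟨ cong (_* (c * 1 * weight ((x , y) ∷ P) r⁻ v)) sf≡0 ⟨
              s * f * (c * 1 * weight ((x , y) ∷ P) r⁻ v) ∎
              where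
              c s f : ℕ
              c = χ (lookup v x Fin.≟ y)
              s = lengthSlot (toℕ j₀) x y
              f = χ (free? P x y)
            perChord x y (inj₂ (s≡1 , f≡1)) rewrite s≡1 | f≡1 | weight-cons v x y s≡1 = regroup (χ (lookup v x Fin.≟ y)) (reduced v)
              where
              regroup : ∀ c w → c * 1 * 1 * w ≡ 1 * 1 * (c * 1 * w)
              regroup = solve-∀

        restrictedMoment-step :
          restrictedMoment P r ≡ ∑[ x < M ] ∑[ y < M ] (lengthSlot (toℕ j₀) x y * χ (free? P x y) * restrictedMoment ((x , y) ∷ P) (updateAt r j₀ ℕ.pred))
        restrictedMoment-step = begin
          sumℕ (chordDiagrams n) (λ v → χ (contains? P v) * weight P r v)
            ≡⟨ sumℕ-chordDiagrams-cong (λ v isCD → trans (pointwise v isCD (contains? P v))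
                 (sum-cong-≗ {M} (λ x → sum-cong-≗ {M} (λ y → cong (λ z → lengthSlot (toℕ j₀) x y * χ (free? P x y) * (z * weight ((x , y) ∷ P) r⁻ v))
                                                                 (sym (χ-contains-∷ x y P v)))))) ⟩
          sumℕ (chordDiagrams n) (λ v → ∑[ x < M ] ∑[ y < M ] (term x y v))
            ≡⟨ sumℕ-∑-comm (chordDiagrams n) M (λ v x → ∑[ y < M ] term x y v) ⟩
          ∑[ x < M ] sumℕ (chordDiagrams n) (λ v → ∑[ y < M ] term x y v)
            ≡⟨ sum-cong-≗ {M} (λ x → sumℕ-∑-comm (chordDiagrams n) M (λ v y → term x y v)) ⟩
          ∑[ x < M ] ∑[ y < M ] sumℕ (chordDiagrams n) (term x y)
            ≡⟨ sum-cong-≗ {M} (λ x → sum-cong-≗ {M} (λ y → sumℕ-*ˡ (chordDiagrams n) (lengthSlot (toℕ j₀) x y * χ (free? P x y))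
                                                                   (λ v → χ (contains? ((x , y) ∷ P) v) * weight ((x , y) ∷ P) r⁻ v))) ⟩
          ∑[ x < M ] ∑[ y < M ] (lengthSlot (toℕ j₀) x y * χ (free? P x y) * restrictedMoment ((x , y) ∷ P) r⁻) ∎
          where
          open ≡-Reasoning
          term : Fin M → Fin M → Diagram n → ℕ
          term x y v = lengthSlot (toℕ j₀) x y * χ (free? P x y) * (χ (contains? ((x , y) ∷ P) v) * weight ((x , y) ∷ P) r⁻ v)

      module _ (P : List Chord) (valid : Valid P) (oriented : Oriented P) (r : Fin (suc k) → ℕ) (j₀ : Fin (suc k)) (0<r : 0 < r j₀)
               (lo hi : ℕ) (between : ∀ x y → lengthSlot (toℕ j₀) x y ≡ 1 → χ (free? P x y) ≡ 1 →
                                      (lo ≤ restrictedMoment ((x , y) ∷ P) (updateAt r j₀ ℕ.pred)) ×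
                                      (restrictedMoment ((x , y) ∷ P) (updateAt r j₀ ℕ.pred) ≤ hi)) where
        private
          r⁻ : Fin (suc k) → ℕ
          r⁻ = updateAt r j₀ ℕ.pred

          term≤ : ∀ x y → lengthSlot (toℕ j₀) x y * χ (free? P x y) * restrictedMoment ((x , y) ∷ P) r⁻ ≤ lengthSlot (toℕ j₀) x y * hi
          term≤ x y with admissible-01 (toℕ j₀) P x y
          ... | inj₁ sf≡0        = subst (_≤ lengthSlot (toℕ j₀) x y * hi) (sym (cong (_* restrictedMoment ((x , y) ∷ P) r⁻) sf≡0)) z≤n
          ... | inj₂ (s≡1 , f≡1) rewrite s≡1 | f≡1 = ℕₚ.*-monoʳ-≤ 1 (proj₂ (between x y s≡1 f≡1))

          term≥ : ∀ x y → lengthSlot (toℕ j₀) x y * χ (free? P x y) * lo ≤ lengthSlot (toℕ j₀) x y * χ (free? P x y) * restrictedMoment ((x , y) ∷ P) r⁻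
          term≥ x y with admissible-01 (toℕ j₀) P x y
          ... | inj₁ sf≡0        = subst (_≤ lengthSlot (toℕ j₀) x y * χ (free? P x y) * restrictedMoment ((x , y) ∷ P) r⁻) (sym (cong (_* lo) sf≡0)) z≤n
          ... | inj₂ (s≡1 , f≡1) = ℕₚ.*-monoʳ-≤ (lengthSlot (toℕ j₀) x y * χ (free? P x y)) (proj₁ (between x y s≡1 f≡1))

        restrictedMoment≤M*hi : restrictedMoment P r ≤ M * hi
        restrictedMoment≤M*hi = begin
          restrictedMoment P r
            ≡⟨ restrictedMoment-step P valid oriented r j₀ 0<r ⟩
          ∑[ x < M ] ∑[ y < M ] (lengthSlot (toℕ j₀) x y * χ (free? P x y) * restrictedMoment ((x , y) ∷ P) r⁻)
            ≤⟨ ∑-mono-≤ {M} (λ x → ∑-mono-≤ {M} (term≤ x)) ⟩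
          ∑[ x < M ] ∑[ y < M ] (lengthSlot (toℕ j₀) x y * hi)
            ≡⟨ trans (sum-cong-≗ {M} (λ x → sym (*-distribʳ-sum {M} hi (lengthSlot (toℕ j₀) x))))
                     (sym (*-distribʳ-sum {M} hi (λ x → ∑[ y < M ] lengthSlot (toℕ j₀) x y))) ⟩
          (∑[ x < M ] ∑[ y < M ] lengthSlot (toℕ j₀) x y) * hi
            ≡⟨ cong (_* hi) (∑∑-slot M (toℕ j₀) (2[j+1]<M j₀)) ⟩
          M * hi ∎
          where open ℕₚ.≤-Reasoning

        [M∸8|P|]*lo≤restrictedMoment : (M ∸ 8 * length P) * lo ≤ restrictedMoment P r
        [M∸8|P|]*lo≤restrictedMoment = begin
          (M ∸ 8 * length P) * lo
            ≤⟨ ℕₚ.*-monoˡ-≤ lo (∑∑-admissible≥ (toℕ j₀) (2[j+1]<M j₀) P valid) ⟩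
          (∑[ x < M ] ∑[ y < M ] (lengthSlot (toℕ j₀) x y * χ (free? P x y))) * lo
            ≡⟨ trans (*-distribʳ-sum {M} lo _) (sum-cong-≗ {M} (λ x → *-distribʳ-sum {M} lo (λ y → lengthSlot (toℕ j₀) x y * χ (free? P x y)))) ⟩
          ∑[ x < M ] ∑[ y < M ] (lengthSlot (toℕ j₀) x y * χ (free? P x y) * lo)
            ≤⟨ ∑-mono-≤ {M} (λ x → ∑-mono-≤ {M} (term≥ x)) ⟩
          ∑[ x < M ] ∑[ y < M ] (lengthSlot (toℕ j₀) x y * χ (free? P x y) * restrictedMoment ((x , y) ∷ P) r⁻)
            ≡⟨ restrictedMoment-step P valid oriented r j₀ 0<r ⟨
          restrictedMoment P r ∎
          where open ℕₚ.≤-Reasoning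

      restrictedMoment-base : ∀ P r → (∀ j → r j ≡ 0) → Valid P → length P ≤ n → restrictedMoment P r ≡ matchings (n ∸ length P)
      restrictedMoment-base P r r≡0 valid |P|≤n = trans
        (sumℕ-cong (chordDiagrams n) (λ v → trans
          (cong (χ (contains? P v) *_) (product-1 (λ j → cong ((numChordsOfLength n v (toℕ j) ∸ countLength (toℕ j) P) ↓_) (r≡0 j))))
          (ℕₚ.*-identityʳ (χ (contains? P v)))))
        (extensions≡matchings (n ∸ length P) P (ℕₚ.m+[n∸m]≡n |P|≤n) valid)

      -- Each of the s steps of the recursion chooses one of at least M - 8q and at most M admissible chord slots.
      restrictedMoment-bounds :
        ∀ s P r → sum r ≡ s → Valid P → Oriented P → length P + s ≤ n →
        ((M ∸ 8 * (length P + s)) ^ s * matchings (n ∸ (length P + s)) ≤ restrictedMoment P r) ×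
        (restrictedMoment P r ≤ M ^ s * matchings (n ∸ (length P + s)))
      restrictedMoment-bounds zero P r ∑r≡0 valid oriented q≤n =
        ℕₚ.≤-reflexive (trans (ℕₚ.+-identityʳ _) (sym G≡)) , ℕₚ.≤-reflexive (trans G≡ (sym (ℕₚ.+-identityʳ _)))
        where
        G≡ : restrictedMoment P r ≡ matchings (n ∸ (length P + 0))
        G≡ = trans (restrictedMoment-base P r (∑≡0⇒≡0 r ∑r≡0) valid (subst (_≤ n) (ℕₚ.+-identityʳ (length P)) q≤n))
                   (cong (λ p → matchings (n ∸ p)) (sym (ℕₚ.+-identityʳ (length P))))
      restrictedMoment-bounds (suc s) P r ∑r≡1+s valid oriented q≤n =
        viaSlot (∑-pos r (subst (0 <_) (sym ∑r≡1+s) (s≤s z≤n)))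
        where
        q E : ℕ
        q = length P + suc s
        E = matchings (n ∸ q)
        viaSlot : ∃[ j₀ ] 0 < r j₀ → ((M ∸ 8 * q) ^ suc s * E ≤ restrictedMoment P r) × (restrictedMoment P r ≤ M ^ suc s * E)
        viaSlot (j₀ , 0<r) =
          ℕₚ.≤-trans (ℕₚ.≤-reflexive (ℕₚ.*-assoc (M ∸ 8 * q) ((M ∸ 8 * q) ^ s) E))
            (ℕₚ.≤-trans (ℕₚ.*-monoˡ-≤ ((M ∸ 8 * q) ^ s * E) (ℕₚ.∸-monoʳ-≤ M (ℕₚ.*-monoʳ-≤ 8 (ℕₚ.m≤m+n (length P) (suc s)))))
                        ([M∸8|P|]*lo≤restrictedMoment P valid oriented r j₀ 0<r _ _ extensions-between)) ,
          ℕₚ.≤-trans (restrictedMoment≤M*hi P valid oriented r j₀ 0<r _ _ extensions-between)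
                     (ℕₚ.≤-reflexive (sym (ℕₚ.*-assoc M (M ^ s) E)))
          where
          extensions-between : ∀ x y → lengthSlot (toℕ j₀) x y ≡ 1 → χ (free? P x y) ≡ 1 →
                               ((M ∸ 8 * q) ^ s * E ≤ restrictedMoment ((x , y) ∷ P) (updateAt r j₀ ℕ.pred)) ×
                               (restrictedMoment ((x , y) ∷ P) (updateAt r j₀ ℕ.pred) ≤ M ^ s * E)
          extensions-between x y slot≡1 free≡1 =
            subst (λ p → ((M ∸ 8 * p) ^ s * matchings (n ∸ p) ≤ restrictedMoment ((x , y) ∷ P) (updateAt r j₀ ℕ.pred)) ×
                         (restrictedMoment ((x , y) ∷ P) (updateAt r j₀ ℕ.pred) ≤ M ^ s * matchings (n ∸ p)))
              (sym (ℕₚ.+-suc (length P) s))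
              (restrictedMoment-bounds s ((x , y) ∷ P) (updateAt r j₀ ℕ.pred)
                (ℕₚ.suc-injective (trans (sym (∑-updateAt-pred r j₀ 0<r)) ∑r≡1+s))
                (proj₁ extends) (proj₂ extends) (subst (_≤ n) (ℕₚ.+-suc (length P) s) q≤n))
            where
            extends : Valid ((x , y) ∷ P) × Oriented ((x , y) ∷ P)
            extends = admissible-extends (toℕ j₀) P valid oriented x y slot≡1 free≡1


module OddProducts where

  open import Data.Nat using (ℕ; zero; suc; _+_; _*_; _≤_; _∸_; _^_; z≤n)
  import Data.Nat.Properties as ℕₚ
  open import Data.Nat.Tactic.RingSolver using (solve-∀)
  open import Relation.Binary.PropositionalEquality
  open import Data.Product using (_×_; _,_)
  open PerfectMatchings using (matchings)

  oddProduct : ℕ → ℕ → ℕ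
  oddProduct m zero    = 1
  oddProduct m (suc R) = suc ((m + R) + (m + R)) * oddProduct m R

  matchings-+ : ∀ m R → matchings (m + R) ≡ oddProduct m R * matchings m
  matchings-+ m zero    = trans (cong matchings (ℕₚ.+-identityʳ m)) (sym (ℕₚ.+-identityʳ (matchings m)))
  matchings-+ m (suc R) = begin
    matchings (m + suc R)                                      ≡⟨ cong matchings (ℕₚ.+-suc m R) ⟩
    suc ((m + R) + (m + R)) * matchings (m + R)                ≡⟨ cong (suc ((m + R) + (m + R)) *_) (matchings-+ m R) ⟩
    suc ((m + R) + (m + R)) * (oddProduct m R * matchings m)   ≡⟨ ℕₚ.*-assoc (suc ((m + R) + (m + R))) (oddProduct m R) (matchings m) ⟨
    oddProduct m (suc R) * matchings m                         ∎
    where open ≡-Reasoning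

  oddProduct-lower : ∀ m R → (m + m) ^ R ≤ oddProduct m R
  oddProduct-lower m zero    = ℕₚ.≤-refl
  oddProduct-lower m (suc R) = ℕₚ.*-mono-≤ (ℕₚ.≤-trans (ℕₚ.+-mono-≤ (ℕₚ.m≤m+n m R) (ℕₚ.m≤m+n m R)) (ℕₚ.n≤1+n _)) (oddProduct-lower m R)

  oddProduct-upper : ∀ m R → oddProduct m R ≤ (2 * (m + R)) ^ R
  oddProduct-upper m zero    = ℕₚ.≤-refl
  oddProduct-upper m (suc R) = ℕₚ.*-mono-≤ factor≤ (ℕₚ.≤-trans (oddProduct-upper m R) (ℕₚ.^-monoˡ-≤ R (ℕₚ.*-monoʳ-≤ 2 (ℕₚ.+-monoʳ-≤ m (ℕₚ.n≤1+n R)))))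
    where
    factor≤ : suc ((m + R) + (m + R)) ≤ 2 * (m + suc R)
    factor≤ = ℕₚ.≤-trans (ℕₚ.n≤1+n _) (ℕₚ.≤-reflexive (arith m R))
      where
      arith : ∀ m R → suc (suc ((m + R) + (m + R))) ≡ 2 * (m + suc R)
      arith = solve-∀

  bernoulli-estimate : ∀ R d c → (d + c) ^ R * (d + c) ≤ d ^ R * (d + c) + R * c * (d + c) ^ R
  bernoulli-estimate zero    d c = ℕₚ.≤-reflexive (sym (ℕₚ.+-identityʳ _))
  bernoulli-estimate (suc R) d c = begin
    (d + c) * (d + c) ^ R * (d + c)                               ≡⟨ arith₁ ((d + c) ^ R) (d + c) ⟩
    (d + c) * ((d + c) ^ R * (d + c))                             ≤⟨ ℕₚ.*-monoʳ-≤ (d + c) (bernoulli-estimate R d c) ⟩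
    (d + c) * (d ^ R * (d + c) + R * c * (d + c) ^ R)             ≡⟨ arith₂ d c (d ^ R) ((d + c) ^ R) R ⟩
    d * d ^ R * (d + c) + R * c * ((d + c) * (d + c) ^ R) + c * (d + c) * d ^ R
                                                                  ≤⟨ ℕₚ.+-monoʳ-≤ (d * d ^ R * (d + c) + R * c * ((d + c) * (d + c) ^ R))
                                                                                  (ℕₚ.*-monoʳ-≤ (c * (d + c)) (ℕₚ.^-monoˡ-≤ R (ℕₚ.m≤m+n d c))) ⟩
    d * d ^ R * (d + c) + R * c * ((d + c) * (d + c) ^ R) + c * (d + c) * (d + c) ^ R
                                                                  ≡⟨ arith₃ d c (d ^ R) ((d + c) ^ R) R ⟩
    d * d ^ R * (d + c) + suc R * c * ((d + c) * (d + c) ^ R)     ∎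
    where
    open ℕₚ.≤-Reasoning
    arith₁ : ∀ a m → m * a * m ≡ m * (a * m)
    arith₁ = solve-∀
    arith₂ : ∀ d c x y R → (d + c) * (x * (d + c) + R * c * y) ≡ d * x * (d + c) + R * c * ((d + c) * y) + c * (d + c) * x
    arith₂ = solve-∀
    arith₃ : ∀ d c x y R → d * x * (d + c) + R * c * ((d + c) * y) + c * (d + c) * y ≡ d * x * (d + c) + suc R * c * ((d + c) * y)
    arith₃ = solve-∀

  Q*[M^R∸[M∸8R]^R]≤[M∸8R]^R : ∀ R Q M → 1 ≤ Q → 8 * R ≤ M → 16 * R * R * Q ≤ M → Q * (M ^ R ∸ (M ∸ 8 * R) ^ R) ≤ (M ∸ 8 * R) ^ R
  Q*[M^R∸[M∸8R]^R]≤[M∸8R]^R zero     Q M _   _    _     = ℕₚ.≤-trans (ℕₚ.≤-reflexive (ℕₚ.*-zeroʳ Q)) z≤n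
  Q*[M^R∸[M∸8R]^R]≤[M∸8R]^R (suc R′) Q M 1≤Q 8R≤M 16R²Q≤M = ℕₚ.+-cancelʳ-≤ (Q * X) (Q * X) B (begin
    Q * X + Q * X             ≡⟨ arith₁ Q X ⟩
    X * (2 * Q)               ≤⟨ 2QX≤A ⟩
    A                         ≡⟨ ℕₚ.m+[n∸m]≡n B≤A ⟨
    B + X                     ≤⟨ ℕₚ.+-monoʳ-≤ B (ℕₚ.≤-trans (ℕₚ.≤-reflexive (sym (ℕₚ.*-identityˡ X))) (ℕₚ.*-monoˡ-≤ X 1≤Q)) ⟩
    B + Q * X                 ∎)
    where
    open ℕₚ.≤-Reasoning
    R c d A B X K : ℕ
    R = suc R′
    c = 8 * R
    d = M ∸ c
    A = M ^ R
    B = d ^ R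
    X = A ∸ B
    K = 8 * R * R
    B≤A : B ≤ A
    B≤A = ℕₚ.^-monoˡ-≤ R (ℕₚ.m∸n≤m M c)
    XM≤KA : X * M ≤ K * A
    XM≤KA = begin
      X * M                         ≡⟨ ℕₚ.*-distribʳ-∸ M A B ⟩
      A * M ∸ B * M                 ≤⟨ ℕₚ.∸-monoˡ-≤ (B * M) (subst (λ z → z ^ R * z ≤ d ^ R * z + R * c * z ^ R) (ℕₚ.m∸n+n≡m 8R≤M) (bernoulli-estimate R d c)) ⟩
      B * M + R * c * A ∸ B * M     ≡⟨ ℕₚ.m+n∸m≡n (B * M) (R * c * A) ⟩
      R * c * A                     ≡⟨ arith₂ R A ⟩
      K * A                         ∎
      where
      arith₂ : ∀ R A → R * (8 * R) * A ≡ 8 * R * R * A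
      arith₂ = solve-∀
    2QX≤A : X * (2 * Q) ≤ A
    2QX≤A = ℕₚ.*-cancelʳ-≤ (X * (2 * Q)) A K (begin
      X * (2 * Q) * K              ≡⟨ arith₃ X Q K ⟩
      X * (2 * K * Q)              ≤⟨ ℕₚ.*-monoʳ-≤ X (ℕₚ.≤-trans (ℕₚ.≤-reflexive (arith₄ R Q)) 16R²Q≤M) ⟩
      X * M                        ≤⟨ XM≤KA ⟩
      K * A                        ≡⟨ ℕₚ.*-comm K A ⟩
      A * K                        ∎)
      where
      arith₃ : ∀ x q k → x * (2 * q) * k ≡ x * (2 * k * q)
      arith₃ = solve-∀
      arith₄ : ∀ R Q → 2 * (8 * R * R) * Q ≡ 16 * R * R * Q
      arith₄ = solve-∀
    arith₁ : ∀ q x → q * x + q * x ≡ x * (2 * q)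
    arith₁ = solve-∀

  sandwich-gap : ∀ {G D A B e} → B * e ≤ G → G ≤ A * e → B * e ≤ D → D ≤ A * e → B ≤ A →
                 (G ≤ D + (A ∸ B) * e) × (D ≤ G + (A ∸ B) * e)
  sandwich-gap {G} {D} {A} {B} {e} Be≤G G≤Ae Be≤D D≤Ae B≤A =
    ℕₚ.≤-trans G≤Ae (ℕₚ.≤-trans (ℕₚ.≤-reflexive Ae≡Be+X) (ℕₚ.+-monoˡ-≤ ((A ∸ B) * e) Be≤D)) ,
    ℕₚ.≤-trans D≤Ae (ℕₚ.≤-trans (ℕₚ.≤-reflexive Ae≡Be+X) (ℕₚ.+-monoˡ-≤ ((A ∸ B) * e) Be≤G))
    where
    Ae≡Be+X : A * e ≡ B * e + (A ∸ B) * e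
    Ae≡Be+X = trans (cong (_* e) (sym (ℕₚ.m+[n∸m]≡n B≤A))) (ℕₚ.*-distribʳ-+ e B (A ∸ B))


module ChordLengthMoments where

  open import Data.Nat as ℕ using (ℕ; zero; suc; _∸_; _^_; z≤n; s≤s)
  import Data.Nat.Properties as ℕₚ
  open import Data.Fin as Fin using (Fin; toℕ)
  import Data.Fin.Properties as FinP
  open import Data.Rational using (ℚ; _+_; _*_; _-_; -_; ∣_∣; _≤_; 1ℚ)
  import Data.Rational.Properties as ℚₚ
  open import Data.List using (List; []; _∷_)
  open import Data.Product using (∃-syntax; _×_; _,_; proj₁; proj₂)
  import Data.List.Relation.Unary.All as All
  import Data.List.Relation.Unary.AllPairs as AllPairs
  open import Function using (_∘_)
  open import Relation.Binary.PropositionalEquality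
  open import Relation.Nullary using (Dec; yes; no)
  open import Tactic.RingSolver using (solve-∀)
  open import Defs
  open RationalFacts
  open Indicators
  open FiniteSums
  open BonferroniInequalities using (_↓_; invFact; choose; fromℕ-χ-yes; fromℕ-χ-no)
  open FiniteExpectations
  open MethodOfMoments using (∣prodFin∣≤1; ∣invFact∣≤1)
  open PerfectMatchings
  open OddProducts
  open FactorialMoments

  fromℕ-sumℕ : ∀ {A : Set} (xs : List A) (f : A → ℕ) → fromℕ (sumℕ xs f) ≡ sumℚ xs (fromℕ ∘ f)
  fromℕ-sumℕ []       f = refl
  fromℕ-sumℕ (x ∷ xs) f = trans (fromℕ-+ (f x) (sumℕ xs f)) (cong (fromℕ (f x) +_) (fromℕ-sumℕ xs f))

  fromℕ-product : ∀ K (f : Fin K → ℕ) → fromℕ (product f) ≡ prodFin K (fromℕ ∘ f)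
  fromℕ-product zero    f = refl
  fromℕ-product (suc K) f = trans (fromℕ-* (f Fin.zero) (product (f ∘ Fin.suc))) (cong (fromℕ (f Fin.zero) *_) (fromℕ-product K (f ∘ Fin.suc)))

  prodFin-* : ∀ K (f g : Fin K → ℚ) → prodFin K (λ j → f j * g j) ≡ prodFin K f * prodFin K g
  prodFin-* zero    f g = refl
  prodFin-* (suc K) f g = trans (cong (f Fin.zero * g Fin.zero *_) (prodFin-* K (f ∘ Fin.suc) (g ∘ Fin.suc)))
    (interchange (f Fin.zero) (g Fin.zero) (prodFin K (f ∘ Fin.suc)) (prodFin K (g ∘ Fin.suc)))
    where
    interchange : ∀ a b c d → a * b * (c * d) ≡ a * c * (b * d)
    interchange = solve-∀ ℚ-ring

  prodFin-χ : ∀ K {P : Fin K → Set} (P? : ∀ j → Dec (P j)) (all? : Dec (∀ j → P j)) →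
              fromℕ (χ all?) ≡ prodFin K (λ j → fromℕ (χ (P? j)))
  prodFin-χ zero    P? all? = fromℕ-χ-yes (λ ()) all?
  prodFin-χ (suc K) P? all? with P? Fin.zero
  ... | no ¬p₀ = trans (fromℕ-χ-no (λ ∀p → ¬p₀ (∀p Fin.zero)) all?) (sym (ℚₚ.*-zeroˡ (prodFin K (λ j → fromℕ (χ (P? (Fin.suc j)))))))
  ... | yes p₀ = trans (cong fromℕ (χ-⇔ (λ ∀p j → ∀p (Fin.suc j)) (λ ∀p → λ { Fin.zero → p₀ ; (Fin.suc j) → ∀p j }) all? (FinP.all? (P? ∘ Fin.suc))))
                       (trans (prodFin-χ K (P? ∘ Fin.suc) (FinP.all? (P? ∘ Fin.suc))) (sym (ℚₚ.*-identityˡ _)))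

  ∣G-D∣≤δD : ∀ (G D X Q : ℕ) → G ℕ.≤ D ℕ.+ X → D ℕ.≤ G ℕ.+ X → suc Q ℕ.* X ℕ.≤ D → ∀ δ → recip (suc Q) ≤ δ →
             ∣ fromℕ G - fromℕ D * 1ℚ ∣ ≤ δ * fromℕ D
  ∣G-D∣≤δD G D X Q G≤D+X D≤G+X [1+Q]X≤D δ 1/[1+Q]≤δ = begin
    ∣ fromℕ G - fromℕ D * 1ℚ ∣      ≡⟨ cong (λ z → ∣ fromℕ G - z ∣) (ℚₚ.*-identityʳ (fromℕ D)) ⟩
    ∣ fromℕ G - fromℕ D ∣           ≤⟨ -b≤p≤b⇒∣p∣≤b lower upper ⟩
    fromℕ X                         ≤⟨ X≤D/[1+Q] ⟩
    recip (suc Q) * fromℕ D         ≤⟨ *-monoʳ-≤-nonNeg {recip (suc Q)} {δ} {fromℕ D} (fromℕ-nonNeg D) 1/[1+Q]≤δ ⟩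
    δ * fromℕ D                     ∎
    where
    open ℚₚ.≤-Reasoning
    upper : fromℕ G - fromℕ D ≤ fromℕ X
    upper = ≤-by-diff (fromℕ D + fromℕ X - fromℕ G)
      (≤⇒0≤diff (subst (fromℕ G ≤_) (fromℕ-+ D X) (fromℕ-mono-≤ G≤D+X))) (rearrange (fromℕ G) (fromℕ D) (fromℕ X))
      where
      rearrange : ∀ g d x → x - (g - d) ≡ d + x - g
      rearrange = solve-∀ ℚ-ring
    lower : - fromℕ X ≤ fromℕ G - fromℕ D
    lower = ≤-by-diff (fromℕ G + fromℕ X - fromℕ D)
      (≤⇒0≤diff (subst (fromℕ D ≤_) (fromℕ-+ G X) (fromℕ-mono-≤ D≤G+X))) (rearrange (fromℕ G) (fromℕ D) (fromℕ X))
      where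
      rearrange : ∀ g d x → g - d - - x ≡ g + x - d
      rearrange = solve-∀ ℚ-ring
    X≤D/[1+Q] : fromℕ X ≤ recip (suc Q) * fromℕ D
    X≤D/[1+Q] = begin
      fromℕ X                                      ≡⟨ ℚₚ.*-identityˡ (fromℕ X) ⟨
      1ℚ * fromℕ X                                 ≡⟨ cong (_* fromℕ X) (trans (sym (fromℕ*recip≡1 (suc Q))) (ℚₚ.*-comm (fromℕ (suc Q)) (recip (suc Q)))) ⟩
      recip (suc Q) * fromℕ (suc Q) * fromℕ X      ≡⟨ ℚₚ.*-assoc (recip (suc Q)) (fromℕ (suc Q)) (fromℕ X) ⟩
      recip (suc Q) * (fromℕ (suc Q) * fromℕ X)    ≡⟨ cong (recip (suc Q) *_) (fromℕ-* (suc Q) X) ⟨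
      recip (suc Q) * fromℕ (suc Q ℕ.* X)          ≤⟨ *-monoˡ-≤-nonNeg {fromℕ (suc Q ℕ.* X)} {fromℕ D} {recip (suc Q)} (recip-nonNeg (suc Q)) (fromℕ-mono-≤ [1+Q]X≤D) ⟩
      recip (suc Q) * fromℕ D                      ∎

  module _ (k : ℕ) (r : Fin (suc k) → ℕ) where

    factorialMoment : ℕ → ℕ
    factorialMoment n = sumℕ (chordDiagrams n) (λ v → product (λ j → numChordsOfLength n v (toℕ j) ↓ r j))

    factorialMoment≈numDiagrams : ∀ q n → suc k ℕ.+ suc k ℕ.< 2 ℕ.* n → sum r ℕ.≤ n → 8 ℕ.* sum r ℕ.≤ 2 ℕ.* n →
      16 ℕ.* sum r ℕ.* sum r ℕ.* suc q ℕ.≤ 2 ℕ.* n →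
      ∃[ X ] (factorialMoment n ℕ.≤ numDiagrams n ℕ.+ X) × (numDiagrams n ℕ.≤ factorialMoment n ℕ.+ X) × (suc q ℕ.* X ℕ.≤ numDiagrams n)
    factorialMoment≈numDiagrams q n 2[k+1]<M R≤n 8R≤M 16R²Q≤M =
      X , subst₂ (λ g d → g ℕ.≤ d ℕ.+ X) (sym G≡) (sym D≡) (proj₁ gap) ,
          subst₂ (λ g d → d ℕ.≤ g ℕ.+ X) (sym G≡) (sym D≡) (proj₂ gap) ,
          subst (suc q ℕ.* X ℕ.≤_) (sym D≡) QX≤D
      where
      open Chords n
      open RestrictedMoments k 2[k+1]<M
      R : ℕ
      R = sum r
      e A B X : ℕ
      e = matchings (n ∸ R)
      A = M ^ R
      B = (M ∸ 8 ℕ.* R) ^ R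
      X = (A ∸ B) ℕ.* e

      G≡ : factorialMoment n ≡ restrictedMoment [] r
      G≡ = sumℕ-cong (chordDiagrams n) (λ v → sym (ℕₚ.+-identityʳ _))
      D≡ : numDiagrams n ≡ oddProduct (n ∸ R) R ℕ.* e
      D≡ = trans numDiagrams≡matchings (trans (cong matchings (sym (ℕₚ.m∸n+n≡m R≤n))) (matchings-+ (n ∸ R) R))

      B≤odd : B ℕ.≤ oddProduct (n ∸ R) R
      B≤odd = ℕₚ.≤-trans (ℕₚ.^-monoˡ-≤ R M∸8R≤2[n∸R]) (oddProduct-lower (n ∸ R) R)
        where
        M∸8R≤2[n∸R] : M ∸ 8 ℕ.* R ℕ.≤ (n ∸ R) ℕ.+ (n ∸ R)
        M∸8R≤2[n∸R] = ℕₚ.≤-trans (ℕₚ.∸-monoʳ-≤ M (ℕₚ.*-monoˡ-≤ R {2} {8} (s≤s (s≤s z≤n))))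
                                (ℕₚ.≤-reflexive (trans (sym (ℕₚ.*-distribˡ-∸ 2 n R)) (cong ((n ∸ R) ℕ.+_) (ℕₚ.+-identityʳ (n ∸ R)))))
      odd≤A : oddProduct (n ∸ R) R ℕ.≤ A
      odd≤A = subst (λ z → oddProduct (n ∸ R) R ℕ.≤ (2 ℕ.* z) ^ R) (ℕₚ.m∸n+n≡m R≤n) (oddProduct-upper (n ∸ R) R)

      bounds : (B ℕ.* e ℕ.≤ restrictedMoment [] r) × (restrictedMoment [] r ℕ.≤ A ℕ.* e)
      bounds = restrictedMoment-bounds R [] r refl AllPairs.[] All.[] R≤n

      gap : (restrictedMoment [] r ℕ.≤ oddProduct (n ∸ R) R ℕ.* e ℕ.+ X) × (oddProduct (n ∸ R) R ℕ.* e ℕ.≤ restrictedMoment [] r ℕ.+ X)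
      gap = sandwich-gap (proj₁ bounds) (proj₂ bounds) (ℕₚ.*-monoˡ-≤ e B≤odd) (ℕₚ.*-monoˡ-≤ e odd≤A) (ℕₚ.≤-trans B≤odd odd≤A)

      QX≤D : suc q ℕ.* X ℕ.≤ oddProduct (n ∸ R) R ℕ.* e
      QX≤D = ℕₚ.≤-trans (ℕₚ.≤-reflexive (sym (ℕₚ.*-assoc (suc q) (A ∸ B) e)))
        (ℕₚ.≤-trans (ℕₚ.*-monoˡ-≤ e (Q*[M^R∸[M∸8R]^R]≤[M∸8R]^R R (suc q) M (s≤s z≤n) 8R≤M 16R²Q≤M)) (ℕₚ.*-monoˡ-≤ e B≤odd))

    -- Each summand secures one hypothesis of factorialMoment≈numDiagrams.
    momentThreshold : ℕ → ℕ
    momentThreshold Q = suc k ℕ.+ suc k ℕ.+ 1 ℕ.+ 8 ℕ.* sum r ℕ.+ 16 ℕ.* sum r ℕ.* sum r ℕ.* Q ℕ.+ sum r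

    factorialMoment≈numDiagrams-eventually : ∀ q n → momentThreshold (suc q) ℕ.≤ n →
      ∃[ X ] (factorialMoment n ℕ.≤ numDiagrams n ℕ.+ X) × (numDiagrams n ℕ.≤ factorialMoment n ℕ.+ X) × (suc q ℕ.* X ℕ.≤ numDiagrams n)
    factorialMoment≈numDiagrams-eventually q n N≤n = factorialMoment≈numDiagrams q n
      (ℕₚ.≤-trans (ℕₚ.≤-reflexive (ℕₚ.+-comm 1 (suc k ℕ.+ suc k))) (ℕₚ.≤-trans (ℕₚ.m≤m+n a₁ (8 ℕ.* R)) a₂≤M))
      (ℕₚ.≤-trans (ℕₚ.m≤n+m R a₃) N≤n)
      (ℕₚ.≤-trans (ℕₚ.m≤n+m (8 ℕ.* R) a₁) a₂≤M)
      (ℕₚ.≤-trans (ℕₚ.m≤n+m (16 ℕ.* R ℕ.* R ℕ.* suc q) a₂) a₃≤M)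
      where
      R : ℕ
      R = sum r
      a₁ a₂ a₃ : ℕ
      a₁ = suc k ℕ.+ suc k ℕ.+ 1
      a₂ = a₁ ℕ.+ 8 ℕ.* R
      a₃ = a₂ ℕ.+ 16 ℕ.* R ℕ.* R ℕ.* suc q
      a₃≤M : a₃ ℕ.≤ 2 ℕ.* n
      a₃≤M = ℕₚ.≤-trans (ℕₚ.m≤m+n a₃ R) (ℕₚ.≤-trans N≤n (ℕₚ.m≤m+n n (n ℕ.+ 0)))
      a₂≤M : a₂ ℕ.≤ 2 ℕ.* n
      a₂≤M = ℕₚ.≤-trans (ℕₚ.m≤m+n a₂ (16 ℕ.* R ℕ.* R ℕ.* suc q)) a₃≤M

  open Expectations chordDiagrams

  factorialMoments-tendsTo : ∀ k (r : Fin (suc k) → ℕ) →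
    ExpectationTendsTo (λ n v → fromℕ (product (λ j → numChordsOfLength n v (toℕ j) ↓ r j))) (λ _ → 1ℚ)
  factorialMoments-tendsTo k r δ 0<δ = fromArchimedean (archimedean δ 0<δ)
    where
    fromArchimedean : ∃[ q ] recip (suc q) ≤ δ →
                      ExpectationWithin δ (λ n v → fromℕ (product (λ j → numChordsOfLength n v (toℕ j) ↓ r j))) (λ _ → 1ℚ)
    fromArchimedean (q , 1/[1+q]≤δ) = within (momentThreshold k r (suc q)) λ n _ N≤n _ → close n (factorialMoment≈numDiagrams-eventually k r q n N≤n)
      where
      close : ∀ n → ∃[ X ] (factorialMoment k r n ℕ.≤ numDiagrams n ℕ.+ X) × (numDiagrams n ℕ.≤ factorialMoment k r n ℕ.+ X) × (suc q ℕ.* X ℕ.≤ numDiagrams n) →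
              ∣ total (λ n v → fromℕ (product (λ j → numChordsOfLength n v (toℕ j) ↓ r j))) n - size n * 1ℚ ∣ ≤ δ * size n
      close n (X , G≤D+X , D≤G+X , QX≤D) =
        subst (λ t → ∣ t - size n * 1ℚ ∣ ≤ δ * size n) (fromℕ-sumℕ (chordDiagrams n) (λ v → product (λ j → numChordsOfLength n v (toℕ j) ↓ r j)))
          (∣G-D∣≤δD (factorialMoment k r n) (numDiagrams n) X q G≤D+X D≤G+X QX≤D δ 1/[1+q]≤δ)

  binomialMoments-tendsTo : ∀ k (r : Fin (suc k) → ℕ) →
    ExpectationTendsTo (λ n v → prodFin (suc k) (λ j → choose (numChordsOfLength n v (toℕ j)) (r j)) * 1ℚ)
                       (λ m → prodFin (suc k) (λ j → invFact (r j)) * 1ℚ)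
  binomialMoments-tendsTo k r = tendsTo-cong rearrange (λ _ → refl)
    (tendsTo-scale (prodFin (suc k) (λ j → invFact (r j))) 1 (∣prodFin∣≤1 (suc k) (λ j → invFact (r j)) (λ j → ∣invFact∣≤1 (r j)))
      (factorialMoments-tendsTo k r))
    where
    rearrange : ∀ n v → prodFin (suc k) (λ j → invFact (r j)) * fromℕ (product (λ j → numChordsOfLength n v (toℕ j) ↓ r j))
                      ≡ prodFin (suc k) (λ j → choose (numChordsOfLength n v (toℕ j)) (r j)) * 1ℚ
    rearrange n v = begin
      c * fromℕ (product (λ j → numChordsOfLength n v (toℕ j) ↓ r j))
        ≡⟨ cong (c *_) (fromℕ-product (suc k) (λ j → numChordsOfLength n v (toℕ j) ↓ r j)) ⟩
      c * prodFin (suc k) (λ j → fromℕ (numChordsOfLength n v (toℕ j) ↓ r j))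
        ≡⟨ ℚₚ.*-comm c _ ⟩
      prodFin (suc k) (λ j → fromℕ (numChordsOfLength n v (toℕ j) ↓ r j)) * c
        ≡⟨ prodFin-* (suc k) (λ j → fromℕ (numChordsOfLength n v (toℕ j) ↓ r j)) (λ j → invFact (r j)) ⟨
      prodFin (suc k) (λ j → choose (numChordsOfLength n v (toℕ j)) (r j))
        ≡⟨ ℚₚ.*-identityʳ _ ⟨
      prodFin (suc k) (λ j → choose (numChordsOfLength n v (toℕ j)) (r j)) * 1ℚ ∎
      where
      open ≡-Reasoning
      c : ℚ
      c = prodFin (suc k) (λ j → invFact (r j))

  sumℚ-jointIndicator≡numWithProfile : ∀ n k (a : Fin (suc k) → ℕ) →
    sumℚ (chordDiagrams n) (λ v → prodFin (suc k) (λ j → fromℕ (χ (numChordsOfLength n v (toℕ j) ℕ.≟ a j))))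
      ≡ fromℕ (numWithProfile n k a)
  sumℚ-jointIndicator≡numWithProfile n k a = begin
    sumℚ (chordDiagrams n) (λ v → prodFin (suc k) (λ j → fromℕ (χ (numChordsOfLength n v (toℕ j) ℕ.≟ a j))))
      ≡⟨ sumℚ-cong (chordDiagrams n) (λ v → sym (prodFin-χ (suc k) (λ j → numChordsOfLength n v (toℕ j) ℕ.≟ a j) (hasProfile? n k a v))) ⟩
    sumℚ (chordDiagrams n) (λ v → fromℕ (χ (hasProfile? n k a v)))
      ≡⟨ fromℕ-sumℕ (chordDiagrams n) (λ v → χ (hasProfile? n k a v)) ⟨
    fromℕ (sumℕ (chordDiagrams n) (λ v → χ (hasProfile? n k a v)))
      ≡⟨ cong fromℕ (length-filter≡sumℕ-χ (hasProfile? n k a) (chordDiagrams n)) ⟨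
    fromℕ (numWithProfile n k a) ∎
    where open ≡-Reasoning


open import Defs
open import Data.Nat using (ℕ; suc; _≤_)
open import Data.Fin using (Fin)
open import Data.Product using (∃-syntax)
open import Data.Integer using (+_)
open import Data.Rational using (ℚ; _/_; _*_; _-_; ∣_∣; _<_; 0ℚ)
import Data.Rational as ℚ

import Data.Nat as ℕ
import Data.Rational.Properties as ℚₚ
open import Data.Fin using (toℕ)
open import Data.Product using (_,_)
open import Relation.Binary.PropositionalEquality
open RationalFacts using (fromℕ)
open Indicators using (χ)
open FiniteExpectations using (module Expectations; sumℚ-cong)
open MethodOfMoments using (jointPointMass-tendsTo)
open ChordLengthMoments using (binomialMoments-tendsTo; sumℚ-jointIndicator≡numWithProfile)

mainTheorem4 : ∀ (k : ℕ) (a : Fin (suc k) → ℕ) (ε : ℚ) → 0ℚ < ε →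
    ∃[ N ] ∀ (n m : ℕ) → N ≤ n → N ≤ m →
      ∣ (+ numWithProfile n k a / 1) - (+ numDiagrams n / 1) * jointPoissonApprox k a m ∣
        ℚ.≤ ε * (+ numDiagrams n / 1)
mainTheorem4 k a ε 0<ε = threshold , λ n m N≤n N≤m →
  subst₂ (λ u w → ∣ u - size n * w ∣ ℚ.≤ ε * size n) (total≡ n) (ℚₚ.*-identityʳ (jointPoissonApprox k a m)) (bound n m N≤n N≤m)
  where
  open Expectations chordDiagrams
  pointMasses : ExpectationTendsTo (λ n v → prodFin (suc k) (λ j → fromℕ (χ (numChordsOfLength n v (toℕ j) ℕ.≟ a j))) * ℚ.1ℚ)
                                   (λ m → jointPoissonApprox k a m * ℚ.1ℚ)
  pointMasses = jointPointMass-tendsTo chordDiagrams (suc k) (λ j n v → numChordsOfLength n v (toℕ j)) (λ _ _ → ℚ.1ℚ) (λ _ → ℚ.1ℚ)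
                  (λ _ _ → ℚₚ.nonNegative⁻¹ ℚ.1ℚ) (λ _ → ℚₚ.≤-refl) (binomialMoments-tendsTo k) a
  open ExpectationWithin (pointMasses ε 0<ε)
  total≡ : ∀ n → total (λ n v → prodFin (suc k) (λ j → fromℕ (χ (numChordsOfLength n v (toℕ j) ℕ.≟ a j))) * ℚ.1ℚ) n
                 ≡ fromℕ (numWithProfile n k a)
  total≡ n = trans (sumℚ-cong (chordDiagrams n) (λ v → ℚₚ.*-identityʳ _)) (sumℚ-jointIndicator≡numWithProfile n k a)
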